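{- Let $n\ge1$ and $0\le i,j,k\le n$. The number of involutions $\sigma\in S_n$ avoiding $321$ with $\mathrm{fp}(\sigma)=i$, $\mathrm{exc}(\sigma)=j$ and $\ell(\sigma)=k$ equals the number of involutions $\sigma\in S_n$ avoiding $132$ with $\mathrm{fp}(\sigma)=i$, $\mathrm{exc}(\sigma)=j$ and $\mathrm{rk}(\sigma)=n-k$.
   Context: An involution is a permutation with $\sigma=\sigma^{ -1}$. Pattern avoidance: $\sigma$ avoids $321$ if there are no $a<b<c$ with $\sigma(a)>\sigma(b)>\sigma(c)$, and avoids $132$ if there are no $a<b<c$ with $\sigma(a)<\sigma(c)<\sigma(b)$. $\mathrm{fp}(\sigma)=\#\{i:\sigma(i)=i\}$, $\mathrm{exc}(\sigma)=\#\{i:\sigma(i)>i\}$, $\ell(\sigma)$ is the length of the longest increasing subsequence, and $\mathrm{rk}(\sigma)$ is the largest $k\ge0$ such that $\sigma(i)>k$ for all $i\le k$. -}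

module Defs where

open import Data.Nat using (ℕ; zero; suc; _+_; _<ᵇ_; _≡ᵇ_; _⊔_)
open import Data.Bool using (Bool; true; false; if_then_else_; _∧_; not)
open import Data.Fin using (Fin; toℕ)
open import Data.Vec using (Vec; lookup; []; _∷_)
open import Data.List using (List; []; _∷_; map; concatMap; length; upTo; allFin; foldr; _++_)
open import Data.Bool.ListAction using (all; any)

-- A candidate permutation of [n] = {1..n} is encoded 0-indexed as the vector
-- (σ(0),…,σ(n-1)) of values in Fin n; σ(i) is  lookup σ i.
Fn : ℕ → Set
Fn n = Vec (Fin n) n

allVecs : (n m : ℕ) → List (Vec (Fin n) m)
allVecs n zero = [] ∷ []
allVecs n (suc m) = concatMap (λ x → map (x ∷_) (allVecs n m)) (allFin n)

countB : {A : Set} → (A → Bool) → List A → ℕ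
countB p [] = 0
countB p (x ∷ xs) = (if p x then 1 else 0) + countB p xs

_<F_ : {n : ℕ} → Fin n → Fin n → Bool
a <F b = toℕ a <ᵇ toℕ b

_≡F_ : {n : ℕ} → Fin n → Fin n → Bool
a ≡F b = toℕ a ≡ᵇ toℕ b

-- σ ∘ σ = id  (such a map is automatically a bijection, i.e. an involution in S_n)
isInvolution : {n : ℕ} → Fn n → Bool
isInvolution {n} σ = all (λ i → lookup σ (lookup σ i) ≡F i) (allFin n)

contains321 : {n : ℕ} → Fn n → Bool
contains321 {n} σ =
  any (λ a → any (λ b → any (λ c →
    (a <F b) ∧ (b <F c) ∧ (lookup σ b <F lookup σ a) ∧ (lookup σ c <F lookup σ b))
    (allFin n)) (allFin n)) (allFin n)

contains132 : {n : ℕ} → Fn n → Bool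
contains132 {n} σ =
  any (λ a → any (λ b → any (λ c →
    (a <F b) ∧ (b <F c) ∧ (lookup σ a <F lookup σ c) ∧ (lookup σ c <F lookup σ b))
    (allFin n)) (allFin n)) (allFin n)

fp : {n : ℕ} → Fn n → ℕ
fp {n} σ = countB (λ i → lookup σ i ≡F i) (allFin n)

exc : {n : ℕ} → Fn n → ℕ
exc {n} σ = countB (λ i → i <F lookup σ i) (allFin n)

sublists : {A : Set} → List A → List (List A)
sublists [] = [] ∷ []
sublists (x ∷ xs) = let r = sublists xs in map (x ∷_) r ++ r

increasingAlong : {n : ℕ} → Fn n → List (Fin n) → Bool
increasingAlong σ [] = true
increasingAlong σ (a ∷ []) = true
increasingAlong σ (a ∷ b ∷ xs) = (lookup σ a <F lookup σ b) ∧ increasingAlong σ (b ∷ xs)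

maxList : List ℕ → ℕ
maxList = foldr _⊔_ 0

lis : {n : ℕ} → Fn n → ℕ
lis {n} σ = maxList (map (λ s → if increasingAlong σ s then length s else 0)
                         (sublists (allFin n)))

-- rk(σ) = largest k ≥ 0 such that σ(i) > k for all i ≤ k (1-indexed).
-- 0-indexed: for all positions p with p < k, k ≤ σ(p)  (i.e. σ(p)+1 > k).
rkHolds : {n : ℕ} → Fn n → ℕ → Bool
rkHolds {n} σ k = all (λ p → if toℕ p <ᵇ k then not (toℕ (lookup σ p) <ᵇ k) else true) (allFin n)

rk : {n : ℕ} → Fn n → ℕ
rk {n} σ = maxList (map (λ k → if rkHolds σ k then k else 0) (upTo (suc n)))

count321 : (n i j k : ℕ) → ℕ
count321 n i j k = countB
  (λ σ → isInvolution σ ∧ not (contains321 σ) ∧ (fp σ ≡ᵇ i) ∧ (exc σ ≡ᵇ j) ∧ (lis σ ≡ᵇ k))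
  (allVecs n n)

count132 : (n i j r : ℕ) → ℕ
count132 n i j r = countB
  (λ σ → isInvolution σ ∧ not (contains132 σ) ∧ (fp σ ≡ᵇ i) ∧ (exc σ ≡ᵇ j) ∧ (rk σ ≡ᵇ r))
  (allVecs n n)

-- For an involution σ of [n] we have n = fp + 2 exc.  If σ avoids 321, its weak excedances
-- (σ(i) ≥ i) form an increasing subsequence, and none is longer, since σ sends the deficiencies
-- of an increasing subsequence injectively to weak excedances outside it; so ℓ = fp + exc.
-- If σ avoids 132, its excedances are exactly the first exc positions, so rk = exc.  Hence,
-- given fp = i and exc = j, both ℓ = k and rk = n − k amount to n = i + 2j and k = i + j, and
-- it remains to show that 321- and 132-avoiding involutions with i fixed points are equinumerous.
-- Both are counted by words over {U, D, F} whose U/D letters form a Dyck path and whose F's sit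
-- at height 0.  A 321-avoiding involution is read off as the word of its excedances,
-- deficiencies and fixed points, the k-th U being paired with the k-th D.  A 132-avoiding
-- involution whose last point is fixed corresponds to a word with a leading F; if instead the
-- last point is paired with the (q+1)-st, it splits into a fixed-point-free one on 2q points and
-- an arbitrary one on the middle block, as a word splits into U d D r at the first return of
-- its Dyck path.

module Submission where

open import Defs
open import Data.Bool using (Bool; true; false; if_then_else_; _∧_; _∨_; not; T)
open import Data.Bool.ListAction using (all; any)
open import Data.Bool.Properties using (T-∧; T-≡; ∧-comm; ∧-identityʳ; ∧-zeroʳ; not-involutive)
open import Data.Empty using (⊥; ⊥-elim)
open import Data.Unit using (tt)
open import Data.Fin using (Fin; toℕ; fromℕ<) renaming (zero to fzero; suc to fsuc)
open import Data.Fin.Properties using (toℕ-injective; toℕ<n; toℕ-fromℕ<)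
open import Data.List using (List; []; _∷_; map; concatMap; length; upTo; allFin; _++_; drop; applyUpTo; tabulate; filterᵇ; cartesianProductWith; cartesianProduct)
open import Data.List.Membership.Propositional using (_∈_; lose)
open import Data.List.Membership.Propositional.Properties using (∈-allFin; ∈-upTo⁺; ∈-upTo⁻; ∈-map⁺; ∈-map⁻; ∈-++⁺ˡ; ∈-++⁺ʳ; ∈-++⁻; ∈-filter⁺; ∈-filter⁻; ∈-cartesianProductWith⁺; ∈-cartesianProductWith⁻; ∈-cartesianProduct⁺; ∈-cartesianProduct⁻)
open import Data.List.Properties using (map-tabulate; map-upTo; upTo-∷ʳ; map-∘; length-map; length-++; length-applyUpTo)
open import Data.List.Relation.Unary.All using (All; []; _∷_)
open import Data.List.Relation.Unary.AllPairs using (AllPairs; []; _∷_)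
open import Data.List.Relation.Unary.AllPairs.Properties using (applyUpTo⁺₁)
open import Data.List.Relation.Binary.Sublist.Propositional using (_⊆_; []; _∷_; _∷ʳ_)
open import Data.List.Relation.Binary.Sublist.Propositional.Properties using (All-resp-⊆) renaming (map⁺ to ⊆-map⁺)
import Data.List.Relation.Unary.All.Properties as All
import Data.List.Relation.Unary.All as All
open import Data.List.Relation.Unary.All.Properties using (All¬⇒¬Any; all⁺; all⁻)
open import Data.List.Relation.Unary.Any using (here; there)
import Data.List.Relation.Unary.Any as Any
open import Data.List.Relation.Unary.Any.Properties using (any⁺; any⁻)
open import Data.List.Relation.Unary.Unique.Propositional using (Unique)
open import Data.List.Relation.Unary.Unique.Propositional.Properties using (allFin⁺; upTo⁺; filter⁺; cartesianProductWith⁺; cartesianProduct⁺)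
open import Data.Nat using (ℕ; zero; suc; pred; _+_; _*_; _∸_; _≤_; _<_; z≤n; s≤s; _<ᵇ_; _≡ᵇ_; _<?_)
open import Data.Nat.Properties
open import Algebra.Properties.CommutativeSemigroup +-commutativeSemigroup using (interchange)
open import Data.Nat.Tactic.RingSolver using (solve-∀)
open import Data.Product using (Σ; _×_; _,_; proj₁; proj₂)
open import Data.Sum using (_⊎_; inj₁; inj₂)
open import Data.Vec using (Vec; []; _∷_; lookup) renaming (tabulate to tabulateᵛ)
open import Data.Vec.Properties using (∷-injective)
open import Function using (_∘_; id)
open import Function.Bundles using (Equivalence)
open import Relation.Binary using (tri<; tri≈; tri>)
open import Relation.Binary.PropositionalEquality using (_≡_; _≢_; ≢-sym; refl; sym; trans; cong; cong₂; subst; subst₂; module ≡-Reasoning)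
open import Relation.Nullary using (¬_; yes; no; T?)

private variable A B : Set

T∧⁻ : ∀ {x y} → T (x ∧ y) → T x × T y
T∧⁻ = Equivalence.to T-∧

T∧⁺ : ∀ {x y} → T x → T y → T (x ∧ y)
T∧⁺ p q = Equivalence.from T-∧ (p , q)

Tb : ∀ {b} → b ≡ true → T b
Tb = Equivalence.from T-≡

bT : ∀ {b} → T b → b ≡ true
bT = Equivalence.to T-≡

T<⁻ : ∀ {m n} → T (m <ᵇ n) → m < n
T<⁻ {m} {n} = <ᵇ⇒< m n

T<⁺ : ∀ {m n} → m < n → T (m <ᵇ n)
T<⁺ = <⇒<ᵇ

T≡⁻ : ∀ {m n} → T (m ≡ᵇ n) → m ≡ n
T≡⁻ {m} {n} = ≡ᵇ⇒≡ m n

T≡⁺ : ∀ {m n} → m ≡ n → T (m ≡ᵇ n)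
T≡⁺ {m} {n} = ≡⇒≡ᵇ m n

Tnot⁻ : ∀ {b} → T (not b) → ¬ T b
Tnot⁻ {true} ()

Tnot⁺ : ∀ {b} → ¬ T b → T (not b)
Tnot⁺ {true} h = h _
Tnot⁺ {false} h = _

≡ᵇ-refl : ∀ m → (m ≡ᵇ m) ≡ true
≡ᵇ-refl m = bT (T≡⁺ {m} refl)

≡ᵇ-sym : ∀ m n → (m ≡ᵇ n) ≡ (n ≡ᵇ m)
≡ᵇ-sym zero zero = refl
≡ᵇ-sym zero (suc n) = refl
≡ᵇ-sym (suc m) zero = refl
≡ᵇ-sym (suc m) (suc n) = ≡ᵇ-sym m n

≢⇒≡ᵇ-false : ∀ {m n} → m ≢ n → (m ≡ᵇ n) ≡ false
≢⇒≡ᵇ-false {m} {n} m≢n with m ≡ᵇ n in eq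
... | true = ⊥-elim (m≢n (T≡⁻ {m} {n} (Tb eq)))
... | false = refl

<⇒<ᵇ-true : ∀ {m n} → m < n → (m <ᵇ n) ≡ true
<⇒<ᵇ-true m<n = bT (T<⁺ m<n)

≥⇒<ᵇ-false : ∀ {m n} → n ≤ m → (m <ᵇ n) ≡ false
≥⇒<ᵇ-false {m} {n} n≤m with m <ᵇ n in eq
... | true = ⊥-elim (<⇒≱ (T<⁻ {m} {n} (Tb eq)) n≤m)
... | false = refl

≡ᵇ-cong⇔ : ∀ a b c d → (a ≡ b → c ≡ d) → (c ≡ d → a ≡ b) → (a ≡ᵇ b) ≡ (c ≡ᵇ d)
≡ᵇ-cong⇔ a b c d f g with a ≡ᵇ b in e₁ | c ≡ᵇ d in e₂
... | true | true = refl
... | false | false = refl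
... | true | false = ⊥-elim (subst T e₂ (T≡⁺ (f (T≡⁻ {a} {b} (Tb e₁)))))
... | false | true = ⊥-elim (subst T e₁ (T≡⁺ (g (T≡⁻ {c} {d} (Tb e₂)))))

trichotomy : ∀ x y → x < y ⊎ x ≡ y ⊎ y < x
trichotomy x y with <-cmp x y
... | tri< a _ _ = inj₁ a
... | tri≈ _ b _ = inj₂ (inj₁ b)
... | tri> _ _ c = inj₂ (inj₂ c)

≡⊎<⇒≤ : ∀ {q v} → v ≡ q ⊎ q < v → q ≤ v
≡⊎<⇒≤ (inj₁ refl) = ≤-refl
≡⊎<⇒≤ (inj₂ q<v) = <⇒≤ q<v

indicator : Bool → ℕ
indicator b = if b then 1 else 0

countN : ℕ → (ℕ → Bool) → ℕ
countN zero P = 0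
countN (suc n) P = countN n P + indicator (P n)

sumN : ℕ → (ℕ → ℕ) → ℕ
sumN zero f = 0
sumN (suc n) f = sumN n f + f n

indicator≤1 : ∀ b → indicator b ≤ 1
indicator≤1 true = ≤-refl
indicator≤1 false = z≤n

indicator-split : ∀ b c → indicator b ≡ indicator (b ∧ c) + indicator (b ∧ not c)
indicator-split true true = refl
indicator-split true false = refl
indicator-split false c = refl

countN-≤ : ∀ n (P : ℕ → Bool) → countN n P ≤ n
countN-≤ zero P = z≤n
countN-≤ (suc n) P = subst (countN n P + indicator (P n) ≤_) (+-comm n 1) (+-mono-≤ (countN-≤ n P) (indicator≤1 (P n)))

countN-mono : ∀ {m n} (P : ℕ → Bool) → m ≤ n → countN m P ≤ countN n P
countN-mono {m} {zero} P z≤n = z≤n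
countN-mono {m} {suc n} P le with m≤n⇒m<n∨m≡n le
... | inj₂ refl = ≤-refl
... | inj₁ (s≤s m≤n) = ≤-trans (countN-mono P m≤n) (m≤m+n _ _)

countN-cong : ∀ n (P Q : ℕ → Bool) → (∀ x → x < n → P x ≡ Q x) → countN n P ≡ countN n Q
countN-cong zero P Q h = refl
countN-cong (suc n) P Q h = cong₂ _+_ (countN-cong n P Q (λ x x<n → h x (m<n⇒m<1+n x<n))) (cong indicator (h n ≤-refl))

countN-< : ∀ (P : ℕ → Bool) {x y} → T (P x) → x < y → countN x P < countN y P
countN-< P {x} px x<y = ≤-trans (step (P x) px) (countN-mono P x<y)
  where
  step : ∀ b → T b → suc (countN x P) ≤ countN x P + indicator b
  step true _ = ≤-reflexive (+-comm 1 (countN x P))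

countN-reflects-< : ∀ (P : ℕ → Bool) a b → countN a P < countN b P → a < b
countN-reflects-< P a b lt = ≰⇒> (λ b≤a → <-irrefl refl (<-≤-trans lt (countN-mono P b≤a)))

countN-split : ∀ n (P R : ℕ → Bool) → countN n P ≡ countN n (λ x → P x ∧ R x) + countN n (λ x → P x ∧ not (R x))
countN-split zero P R = refl
countN-split (suc n) P R =
  trans (cong₂ _+_ (countN-split n P R) (indicator-split (P n) (R n)))
        (interchange (countN n (λ x → P x ∧ R x)) (countN n (λ x → P x ∧ not (R x))) (indicator (P n ∧ R n)) (indicator (P n ∧ not (R n))))

countN-none : ∀ n (P : ℕ → Bool) → (∀ x → x < n → ¬ T (P x)) → countN n P ≡ 0
countN-none zero P h = refl
countN-none (suc n) P h with P n in eq
... | true = ⊥-elim (h n ≤-refl (Tb eq))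
... | false = trans (+-identityʳ _) (countN-none n P (λ x x<n → h x (m<n⇒m<1+n x<n)))

countN-all : ∀ n (P : ℕ → Bool) → (∀ x → x < n → T (P x)) → countN n P ≡ n
countN-all zero P h = refl
countN-all (suc n) P h with P n in eq
... | true = trans (cong (_+ 1) (countN-all n P (λ x x<n → h x (m<n⇒m<1+n x<n)))) (+-comm n 1)
... | false = ⊥-elim (subst T eq (h n ≤-refl))

countN-singleton : ∀ n y → y < n → countN n (_≡ᵇ y) ≡ 1
countN-singleton (suc n) y y<n with m≤n⇒m<n∨m≡n (≤-pred y<n)
... | inj₁ y<n′ rewrite countN-singleton n y y<n′ | ≢⇒≡ᵇ-false (≢-sym (<⇒≢ y<n′)) = refl
... | inj₂ refl rewrite countN-none n (_≡ᵇ n) (λ x x<n e → <⇒≢ x<n (T≡⁻ {x} {n} e)) | ≡ᵇ-refl n = refl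

countN-attains : ∀ n (P : ℕ → Bool) r → r < countN n P → Σ ℕ λ y → y < n × T (P y) × countN y P ≡ r
countN-attains (suc n) P r r< with P n in eq
... | false with countN-attains n P r (subst (r <_) (+-identityʳ _) r<)
...   | y , y<n , py , c = y , m<n⇒m<1+n y<n , py , c
countN-attains (suc n) P r r< | true with m≤n⇒m<n∨m≡n (≤-pred (subst (suc r ≤_) (+-comm _ 1) r<))
... | inj₁ lt with countN-attains n P r lt
...   | y , y<n , py , c = y , m<n⇒m<1+n y<n , py , c
countN-attains (suc n) P r r< | true | inj₂ e = n , ≤-refl , Tb eq , sym e

countN-∨ : ∀ n (P Q : ℕ → Bool) → (∀ x → x < n → T (P x) → ¬ T (Q x)) → countN n (λ x → P x ∨ Q x) ≡ countN n P + countN n Q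
countN-∨ zero P Q h = refl
countN-∨ (suc n) P Q h =
  trans (cong₂ _+_ (countN-∨ n P Q (λ x x<n → h x (m<n⇒m<1+n x<n))) (indicator-∨ (P n) (Q n) (h n ≤-refl)))
        (interchange (countN n P) (countN n Q) (indicator (P n)) (indicator (Q n)))
  where
  indicator-∨ : ∀ b c → (T b → ¬ T c) → indicator (b ∨ c) ≡ indicator b + indicator c
  indicator-∨ true true k = ⊥-elim (k _ _)
  indicator-∨ true false k = refl
  indicator-∨ false c k = refl

countN-+ : ∀ a b (P : ℕ → Bool) → countN (a + b) P ≡ countN a P + countN b (λ x → P (a + x))
countN-+ a zero P rewrite +-identityʳ a = sym (+-identityʳ _)
countN-+ a (suc b) P rewrite +-suc a b | countN-+ a b P = +-assoc (countN a P) _ _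

downClosed⇒initialSegment : ∀ n (P : ℕ → Bool) → (∀ x y → y < n → x < y → T (P y) → T (P x)) →
  ∀ x → x < n → (T (P x) → x < countN n P) × (x < countN n P → T (P x))
downClosed⇒initialSegment (suc n) P dc x x<n with P n in e
... | true = (λ _ → subst (x <_) (sym count≡) x<n) , (λ _ → all-P x x<n)
  where
  all-P : ∀ y → y < suc n → T (P y)
  all-P y y<n with m≤n⇒m<n∨m≡n (≤-pred y<n)
  ... | inj₁ y<n′ = dc y n ≤-refl y<n′ (Tb e)
  ... | inj₂ refl = Tb e
  count≡ : countN n P + 1 ≡ suc n
  count≡ = trans (cong (_+ 1) (countN-all n P (λ y y<n → all-P y (m<n⇒m<1+n y<n)))) (+-comm n 1)
... | false with m≤n⇒m<n∨m≡n (≤-pred x<n)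
...   | inj₁ x<n′ = let (a , b) = downClosed⇒initialSegment n P (λ u v v<n → dc u v (m<n⇒m<1+n v<n)) x x<n′ in
                    (λ p → subst (x <_) (sym (+-identityʳ _)) (a p)) , (λ l → b (subst (x <_) (+-identityʳ _) l))
...   | inj₂ refl = (λ p → ⊥-elim (subst T e p)) ,
                    (λ l → ⊥-elim (<-irrefl refl (≤-trans l (subst (_≤ x) (sym (+-identityʳ _)) (countN-≤ x P)))))

sumN-indicator : ∀ n (R : ℕ → Bool) → sumN n (λ q → indicator (R q)) ≡ countN n R
sumN-indicator zero R = refl
sumN-indicator (suc n) R = cong (_+ indicator (R n)) (sumN-indicator n R)

sumN-+ : ∀ n (f g : ℕ → ℕ) → sumN n (λ q → f q + g q) ≡ sumN n f + sumN n g
sumN-+ zero f g = refl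
sumN-+ (suc n) f g = trans (cong (_+ (f n + g n)) (sumN-+ n f g)) (interchange (sumN n f) (sumN n g) (f n) (g n))

sumN-cong : ∀ n (f g : ℕ → ℕ) → (∀ q → q < n → f q ≡ g q) → sumN n f ≡ sumN n g
sumN-cong zero f g h = refl
sumN-cong (suc n) f g h = cong₂ _+_ (sumN-cong n f g (λ q q<n → h q (m<n⇒m<1+n q<n))) (h n ≤-refl)

sumN-zero : ∀ n → sumN n (λ _ → 0) ≡ 0
sumN-zero zero = refl
sumN-zero (suc n) = trans (+-identityʳ _) (sumN-zero n)

countB-++ : ∀ (p : A → Bool) xs ys → countB p (xs ++ ys) ≡ countB p xs + countB p ys
countB-++ p [] ys = refl
countB-++ p (x ∷ xs) ys = trans (cong (indicator (p x) +_) (countB-++ p xs ys)) (sym (+-assoc (indicator (p x)) _ _))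

countB-map : ∀ (p : B → Bool) (f : A → B) xs → countB p (map f xs) ≡ countB (p ∘ f) xs
countB-map p f [] = refl
countB-map p f (x ∷ xs) = cong (_ +_) (countB-map p f xs)

countB-cong : ∀ (p q : A → Bool) xs → (∀ x → x ∈ xs → p x ≡ q x) → countB p xs ≡ countB q xs
countB-cong p q [] h = refl
countB-cong p q (x ∷ xs) h = cong₂ _+_ (cong indicator (h x (here refl))) (countB-cong p q xs (λ y m → h y (there m)))

countB-none : ∀ (p : A → Bool) xs → (∀ x → x ∈ xs → ¬ T (p x)) → countB p xs ≡ 0
countB-none p [] h = refl
countB-none p (x ∷ xs) h with p x in e
... | true = ⊥-elim (h x (here refl) (Tb e))
... | false = countB-none p xs (λ y m → h y (there m))

countB-∧-const : ∀ (p : A → Bool) b xs → countB (λ x → p x ∧ b) xs ≡ (if b then countB p xs else 0)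
countB-∧-const p true xs = countB-cong _ _ xs (λ x _ → ∧-identityʳ (p x))
countB-∧-const p false xs = countB-none _ xs (λ x _ t → proj₂ (T∧⁻ {p x} {false} t))

countB-upTo : ∀ (Q : ℕ → Bool) n → countB Q (upTo n) ≡ countN n Q
countB-upTo Q zero = refl
countB-upTo Q (suc n) =
  trans (cong (countB Q) (sym (upTo-∷ʳ n)))
  (trans (countB-++ Q (upTo n) (n ∷ []))
         (cong₂ _+_ (countB-upTo Q n) (+-identityʳ _)))

map-toℕ-allFin : ∀ n → map toℕ (allFin n) ≡ upTo n
map-toℕ-allFin zero = refl
map-toℕ-allFin (suc n) = cong (0 ∷_)
  (trans (map-tabulate fsuc toℕ)
  (trans (sym (map-tabulate toℕ suc))
  (trans (cong (map suc) (trans (sym (map-tabulate id toℕ)) (map-toℕ-allFin n)))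
  (map-upTo suc n))))

countB-allFin : ∀ n (P : Fin n → Bool) (Q : ℕ → Bool) → (∀ i → P i ≡ Q (toℕ i)) → countB P (allFin n) ≡ countN n Q
countB-allFin n P Q h =
  trans (countB-cong P (Q ∘ toℕ) (allFin n) (λ i _ → h i))
  (trans (sym (countB-map Q toℕ (allFin n)))
  (trans (cong (countB Q) (map-toℕ-allFin n)) (countB-upTo Q n)))

countB≡length-filter : ∀ (p : A → Bool) xs → countB p xs ≡ length (filterᵇ p xs)
countB≡length-filter p [] = refl
countB≡length-filter p (x ∷ xs) with p x
... | true = cong suc (countB≡length-filter p xs)
... | false = countB≡length-filter p xs

length-≤-injection : ∀ (f : A → B) {xs ys} → Unique xs → (∀ x → x ∈ xs → f x ∈ ys) →
  (∀ x y → x ∈ xs → y ∈ xs → f x ≡ f y → x ≡ y) → length xs ≤ length ys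
length-≤-injection f {[]} _ _ _ = z≤n
length-≤-injection f {x ∷ xs} {ys} (x∉xs ∷ u) into inj =
  subst (suc (length xs) ≤_) (remove-length fx∈ys)
    (s≤s (length-≤-injection f u (λ y y∈xs → remove-keeps fx∈ys (into y (there y∈xs)) (fy≢fx y y∈xs))
                              (λ y z y∈ z∈ → inj y z (there y∈) (there z∈))))
  where
  fx∈ys = into x (here refl)
  fy≢fx : ∀ y → y ∈ xs → f y ≢ f x
  fy≢fx y y∈xs e = All¬⇒¬Any x∉xs (subst (_∈ xs) (inj y x (there y∈xs) (here refl) e) y∈xs)
  remove : ∀ {z : B} {zs} → z ∈ zs → List B
  remove {zs = _ ∷ zs} (here _) = zs
  remove {zs = z ∷ _} (there p) = z ∷ remove p
  remove-length : ∀ {z : B} {zs} (p : z ∈ zs) → suc (length (remove p)) ≡ length zs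
  remove-length (here _) = refl
  remove-length (there p) = cong suc (remove-length p)
  remove-keeps : ∀ {z w : B} {zs} (p : z ∈ zs) → w ∈ zs → w ≢ z → w ∈ remove p
  remove-keeps (here refl) (here refl) w≢z = ⊥-elim (w≢z refl)
  remove-keeps (here refl) (there m) _ = m
  remove-keeps (there p) (here refl) _ = here refl
  remove-keeps (there p) (there m) w≢z = there (remove-keeps p m w≢z)

countB-injection : ∀ (xs : List A) (ys : List B) (p : A → Bool) (q : B → Bool) (f : A → B) →
  Unique xs → (∀ x → x ∈ xs → T (p x) → f x ∈ ys × T (q (f x))) →
  (∀ x x′ → x ∈ xs → x′ ∈ xs → T (p x) → T (p x′) → f x ≡ f x′ → x ≡ x′) → countB p xs ≤ countB q ys
countB-injection xs ys p q f u into inj =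
  subst₂ _≤_ (sym (countB≡length-filter p xs)) (sym (countB≡length-filter q ys))
    (length-≤-injection f (filter⁺ (λ x → T? (p x)) u)
      (λ x m → let (x∈ , px) = ∈-filter⁻ (T? ∘ p) m in
               let (fx∈ , qfx) = into x x∈ px in ∈-filter⁺ (T? ∘ q) fx∈ qfx)
      (λ x x′ m m′ → let (x∈ , px) = ∈-filter⁻ (T? ∘ p) m in
                     let (x′∈ , px′) = ∈-filter⁻ (T? ∘ p) m′ in inj x x′ x∈ x′∈ px px′))

countB-bijection : ∀ (xs : List A) (ys : List B) (p : A → Bool) (q : B → Bool) (f : A → B) (g : B → A) →
  Unique xs → Unique ys →
  (∀ x → x ∈ xs → T (p x) → f x ∈ ys × T (q (f x)) × g (f x) ≡ x) →
  (∀ y → y ∈ ys → T (q y) → g y ∈ xs × T (p (g y)) × f (g y) ≡ y) →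
  countB p xs ≡ countB q ys
countB-bijection xs ys p q f g uxs uys fwd bwd = ≤-antisym
  (countB-injection xs ys p q f uxs (λ x m px → let (a , b , _) = fwd x m px in a , b)
     (λ x x′ m m′ px px′ e → trans (sym (proj₂ (proj₂ (fwd x m px)))) (trans (cong g e) (proj₂ (proj₂ (fwd x′ m′ px′))))))
  (countB-injection ys xs q p g uys (λ y m qy → let (a , b , _) = bwd y m qy in a , b)
     (λ y y′ m m′ qy qy′ e → trans (sym (proj₂ (proj₂ (bwd y m qy)))) (trans (cong f e) (proj₂ (proj₂ (bwd y′ m′ qy′))))))

countN-injection : ∀ a b (P Q : ℕ → Bool) (h : ℕ → ℕ) →
  (∀ x → x < a → T (P x) → h x < b × T (Q (h x))) →
  (∀ x y → x < a → y < a → T (P x) → T (P y) → h x ≡ h y → x ≡ y) →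
  countN a P ≤ countN b Q
countN-injection a b P Q h into inj =
  subst₂ _≤_ (countB-upTo P a) (countB-upTo Q b)
    (countB-injection (upTo a) (upTo b) P Q h (upTo⁺ a)
      (λ x m px → let (hx<b , qhx) = into x (∈-upTo⁻ m) px in ∈-upTo⁺ hx<b , qhx)
      (λ x y mx my → inj x y (∈-upTo⁻ mx) (∈-upTo⁻ my)))

countN-bijection : ∀ a b (P Q : ℕ → Bool) (h g : ℕ → ℕ) →
  (∀ x → x < a → T (P x) → h x < b × T (Q (h x))) →
  (∀ y → y < b → T (Q y) → g y < a × T (P (g y))) →
  (∀ x → x < a → T (P x) → g (h x) ≡ x) →
  (∀ y → y < b → T (Q y) → h (g y) ≡ y) →
  countN a P ≡ countN b Q
countN-bijection a b P Q h g hm gm gh hg = ≤-antisym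
  (countN-injection a b P Q h hm (λ x y x<a y<a px py e → trans (sym (gh x x<a px)) (trans (cong g e) (gh y y<a py))))
  (countN-injection b a Q P g gm (λ x y x<b y<b qx qy e → trans (sym (hg x x<b qx)) (trans (cong h e) (hg y y<b qy))))

countB-cartesianProduct : ∀ (xs : List A) (ys : List B) (p : A → Bool) (q : B → Bool) →
  countB (λ z → p (proj₁ z) ∧ q (proj₂ z)) (cartesianProduct xs ys) ≡ countB p xs * countB q ys
countB-cartesianProduct [] ys p q = refl
countB-cartesianProduct (x ∷ xs) ys p q =
  trans (countB-++ _ (map (x ,_) ys) _)
  (trans (cong₂ _+_ (countB-map _ (x ,_) ys) (countB-cartesianProduct xs ys p q)) (row (p x)))
  where
  row : ∀ b → countB (λ y → b ∧ q y) ys + countB p xs * countB q ys ≡ (indicator b + countB p xs) * countB q ys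
  row true = refl
  row false = cong (_+ countB p xs * countB q ys) (countB-none _ ys (λ _ _ ()))

countB-byValue : ∀ (P : A → Bool) (g : A → ℕ) n xs → (∀ x → x ∈ xs → T (P x) → g x < n) →
  countB P xs ≡ sumN n (λ q → countB (λ x → P x ∧ (g x ≡ᵇ q)) xs)
countB-byValue P g n [] h = sym (trans (sumN-cong n _ (λ _ → 0) (λ _ _ → refl)) (sumN-zero n))
countB-byValue P g n (x ∷ xs) h =
  trans (cong₂ _+_ (head-term (P x) refl) (countB-byValue P g n xs (λ y m → h y (there m))))
        (sym (sumN-+ n _ _))
  where
  head-term : ∀ b → P x ≡ b → indicator b ≡ sumN n (λ q → indicator (b ∧ (g x ≡ᵇ q)))
  head-term false _ = sym (trans (sumN-cong n _ (λ _ → 0) (λ _ _ → refl)) (sumN-zero n))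
  head-term true e = sym
    (trans (sumN-cong n _ (λ q → indicator (q ≡ᵇ g x)) (λ q _ → cong indicator (≡ᵇ-sym (g x) q)))
    (trans (sumN-indicator n (_≡ᵇ g x)) (countN-singleton n (g x) (h x (here refl) (Tb e)))))

allVecs-cartesian : ∀ n m → allVecs n (suc m) ≡ cartesianProductWith _∷_ (allFin n) (allVecs n m)
allVecs-cartesian n m = concatMap≡cartesianProductWith (allFin n)
  where
  concatMap≡cartesianProductWith : ∀ xs → concatMap (λ x → map (x ∷_) (allVecs n m)) xs ≡ cartesianProductWith _∷_ xs (allVecs n m)
  concatMap≡cartesianProductWith [] = refl
  concatMap≡cartesianProductWith (x ∷ xs) = cong (map (x ∷_) (allVecs n m) ++_) (concatMap≡cartesianProductWith xs)

allVecs-unique : ∀ n m → Unique (allVecs n m)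
allVecs-unique n zero = [] ∷ []
allVecs-unique n (suc m) = subst Unique (sym (allVecs-cartesian n m))
  (cartesianProductWith⁺ _∷_ ∷-injective (allFin⁺ n) (allVecs-unique n m))

allVecs-complete : ∀ n m (v : Vec (Fin n) m) → v ∈ allVecs n m
allVecs-complete n zero [] = here refl
allVecs-complete n (suc m) (x ∷ v) = subst (x ∷ v ∈_) (sym (allVecs-cartesian n m))
  (∈-cartesianProductWith⁺ _∷_ (∈-allFin x) (allVecs-complete n m v))

⟦_⟧ : ∀ {n m} → Vec (Fin n) m → ℕ → ℕ
⟦ [] ⟧ x = 0
⟦ a ∷ v ⟧ zero = toℕ a
⟦ a ∷ v ⟧ (suc x) = ⟦ v ⟧ x

toℕ-lookup : ∀ {n m} (v : Vec (Fin n) m) (i : Fin m) → toℕ (lookup v i) ≡ ⟦ v ⟧ (toℕ i)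
toℕ-lookup (a ∷ v) fzero = refl
toℕ-lookup (a ∷ v) (fsuc i) = toℕ-lookup v i

⟦⟧-< : ∀ {n m} (v : Vec (Fin n) m) x → x < m → ⟦ v ⟧ x < n
⟦⟧-< (a ∷ v) zero _ = toℕ<n a
⟦⟧-< (a ∷ v) (suc x) (s≤s x<m) = ⟦⟧-< v x x<m

⟦⟧-injective : ∀ {n m} (v w : Vec (Fin n) m) → (∀ x → x < m → ⟦ v ⟧ x ≡ ⟦ w ⟧ x) → v ≡ w
⟦⟧-injective [] [] h = refl
⟦⟧-injective (a ∷ v) (b ∷ w) h = cong₂ _∷_ (toℕ-injective (h 0 (s≤s z≤n))) (⟦⟧-injective v w (λ x x<m → h (suc x) (s≤s x<m)))

clamp : ∀ {n} → Fin n → ℕ → Fin n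
clamp {n} d v with v <? n
... | yes v<n = fromℕ< v<n
... | no _ = d

toℕ-clamp : ∀ {n} (d : Fin n) v → v < n → toℕ (clamp d v) ≡ v
toℕ-clamp {n} d v v<n with v <? n
... | yes p = toℕ-fromℕ< p
... | no v≮n = ⊥-elim (v≮n v<n)

-- Out-of-range values of f are replaced by the position itself, so that vecOf is total.
vecOf : ∀ n → (ℕ → ℕ) → Fn n
vecOf n f = tabulateᵛ (λ i → clamp i (f (toℕ i)))

⟦tabulate⟧ : ∀ {n m} (h : Fin m → Fin n) x (x<m : x < m) → ⟦ tabulateᵛ h ⟧ x ≡ toℕ (h (fromℕ< x<m))
⟦tabulate⟧ {m = suc m} h zero _ = refl
⟦tabulate⟧ {m = suc m} h (suc x) (s≤s x<m) = ⟦tabulate⟧ (h ∘ fsuc) x x<m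

⟦vecOf⟧ : ∀ n f x → x < n → f x < n → ⟦ vecOf n f ⟧ x ≡ f x
⟦vecOf⟧ n f x x<n fx<n =
  trans (⟦tabulate⟧ _ x x<n)
  (trans (toℕ-clamp _ _ (subst (λ z → f z < n) (sym (toℕ-fromℕ< x<n)) fx<n))
         (cong f (toℕ-fromℕ< x<n)))

allFin-all⁻ : ∀ {n} (P : Fin n → Bool) → T (all P (allFin n)) → ∀ i → T (P i)
allFin-all⁻ {n} P t i = All.lookup (all⁺ P (allFin n) t) (∈-allFin i)

allFin-all⁺ : ∀ {n} (P : Fin n → Bool) → (∀ i → T (P i)) → T (all P (allFin n))
allFin-all⁺ {n} P h = all⁻ P {allFin n} (All.tabulate (λ {i} _ → h i))

anyFin³⁻ : ∀ {n} (P : Fin n → Fin n → Fin n → Bool) →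
  T (any (λ a → any (λ b → any (P a b) (allFin n)) (allFin n)) (allFin n)) →
  Σ (Fin n) λ a → Σ (Fin n) λ b → Σ (Fin n) λ c → T (P a b c)
anyFin³⁻ {n} P t =
  let (a , t₁) = Any.satisfied (any⁻ _ (allFin n) t) in
  let (b , t₂) = Any.satisfied (any⁻ _ (allFin n) t₁) in
  let (c , t₃) = Any.satisfied (any⁻ _ (allFin n) t₂) in
  a , b , c , t₃

anyFin³⁺ : ∀ {n} (P : Fin n → Fin n → Fin n → Bool) a b c → T (P a b c) →
  T (any (λ a → any (λ b → any (P a b) (allFin n)) (allFin n)) (allFin n))
anyFin³⁺ P a b c t = anyFin a (anyFin b (anyFin c t))
  where
  anyFin : ∀ {n} {Q : Fin n → Bool} i → T (Q i) → T (any Q (allFin n))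
  anyFin {Q = Q} i q = any⁺ Q (lose (∈-allFin i) q)

MapsBelow : ℕ → (ℕ → ℕ) → Set
MapsBelow n f = ∀ x → x < n → f x < n

Involutive : ℕ → (ℕ → ℕ) → Set
Involutive n f = ∀ x → x < n → f (f x) ≡ x

Contains321 : ℕ → (ℕ → ℕ) → Set
Contains321 n f = Σ ℕ λ a → Σ ℕ λ b → Σ ℕ λ c → c < n × a < b × b < c × f b < f a × f c < f b

Contains132 : ℕ → (ℕ → ℕ) → Set
Contains132 n f = Σ ℕ λ a → Σ ℕ λ b → Σ ℕ λ c → c < n × a < b × b < c × f a < f c × f c < f b

Contains321-cong : ∀ n f g → (∀ x → x < n → f x ≡ g x) → Contains321 n f → Contains321 n g
Contains321-cong n f g e (a , b , c , c<n , a<b , b<c , v₁ , v₂) =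
  a , b , c , c<n , a<b , b<c , subst₂ _<_ (e b b<n) (e a a<n) v₁ , subst₂ _<_ (e c c<n) (e b b<n) v₂
  where b<n = <-trans b<c c<n
        a<n = <-trans a<b b<n

Contains132-cong : ∀ n f g → (∀ x → x < n → f x ≡ g x) → Contains132 n f → Contains132 n g
Contains132-cong n f g e (a , b , c , c<n , a<b , b<c , v₁ , v₂) =
  a , b , c , c<n , a<b , b<c , subst₂ _<_ (e a a<n) (e c c<n) v₁ , subst₂ _<_ (e c c<n) (e b b<n) v₂
  where b<n = <-trans b<c c<n
        a<n = <-trans a<b b<n

module _ {n : ℕ} (σ : Fn n) where
  private
    f : ℕ → ℕ
    f = ⟦ σ ⟧
    σ-toℕ : ∀ i → toℕ (lookup σ i) ≡ f (toℕ i)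
    σ-toℕ = toℕ-lookup σ
    σ-fromℕ< : ∀ {x} (x<n : x < n) → toℕ (lookup σ (fromℕ< x<n)) ≡ f x
    σ-fromℕ< x<n = trans (σ-toℕ _) (cong f (toℕ-fromℕ< x<n))
    <F⁺ : ∀ {x y} (x<n : x < n) (y<n : y < n) → x < y → T (fromℕ< x<n <F fromℕ< y<n)
    <F⁺ x<n y<n x<y = T<⁺ (subst₂ _<_ (sym (toℕ-fromℕ< x<n)) (sym (toℕ-fromℕ< y<n)) x<y)
    <σ⁺ : ∀ {x y} (x<n : x < n) (y<n : y < n) → f x < f y → T (lookup σ (fromℕ< x<n) <F lookup σ (fromℕ< y<n))
    <σ⁺ x<n y<n fx<fy = T<⁺ (subst₂ _<_ (sym (σ-fromℕ< x<n)) (sym (σ-fromℕ< y<n)) fx<fy)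
    <σ⁻ : ∀ {i j} → T (lookup σ i <F lookup σ j) → f (toℕ i) < f (toℕ j)
    <σ⁻ t = subst₂ _<_ (σ-toℕ _) (σ-toℕ _) (T<⁻ t)

  isInvolution⇒Involutive : T (isInvolution σ) → Involutive n f
  isInvolution⇒Involutive t x x<n =
    subst (λ z → f (f z) ≡ x) (toℕ-fromℕ< x<n)
      (trans (sym (trans (σ-toℕ (lookup σ i)) (cong f (σ-toℕ i))))
             (trans (T≡⁻ (allFin-all⁻ _ t i)) (toℕ-fromℕ< x<n)))
    where i = fromℕ< x<n

  Involutive⇒isInvolution : Involutive n f → T (isInvolution σ)
  Involutive⇒isInvolution h =
    allFin-all⁺ _ (λ i → T≡⁺ (trans (trans (σ-toℕ (lookup σ i)) (cong f (σ-toℕ i))) (h (toℕ i) (toℕ<n i))))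

  fp≡countN : fp σ ≡ countN n (λ x → f x ≡ᵇ x)
  fp≡countN = countB-allFin n _ _ (λ i → cong (_≡ᵇ toℕ i) (σ-toℕ i))

  exc≡countN : exc σ ≡ countN n (λ x → x <ᵇ f x)
  exc≡countN = countB-allFin n _ _ (λ i → cong (toℕ i <ᵇ_) (σ-toℕ i))

  contains321⇒Contains321 : T (contains321 σ) → Contains321 n f
  contains321⇒Contains321 t with anyFin³⁻ _ t
  ... | a , b , c , t′ with T∧⁻ t′
  ... | a<b , t″ with T∧⁻ t″
  ... | b<c , t‴ with T∧⁻ t‴
  ... | v₁ , v₂ = toℕ a , toℕ b , toℕ c , toℕ<n c , T<⁻ a<b , T<⁻ b<c , <σ⁻ v₁ , <σ⁻ v₂

  Contains321⇒contains321 : Contains321 n f → T (contains321 σ)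
  Contains321⇒contains321 (a , b , c , c<n , a<b , b<c , v₁ , v₂) =
    anyFin³⁺ _ (fromℕ< a<n) (fromℕ< b<n) (fromℕ< c<n)
      (T∧⁺ (<F⁺ a<n b<n a<b) (T∧⁺ (<F⁺ b<n c<n b<c) (T∧⁺ (<σ⁺ b<n a<n v₁) (<σ⁺ c<n b<n v₂))))
    where b<n = <-trans b<c c<n
          a<n = <-trans a<b b<n

  contains132⇒Contains132 : T (contains132 σ) → Contains132 n f
  contains132⇒Contains132 t with anyFin³⁻ _ t
  ... | a , b , c , t′ with T∧⁻ t′
  ... | a<b , t″ with T∧⁻ t″
  ... | b<c , t‴ with T∧⁻ t‴
  ... | v₁ , v₂ = toℕ a , toℕ b , toℕ c , toℕ<n c , T<⁻ a<b , T<⁻ b<c , <σ⁻ v₁ , <σ⁻ v₂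

  Contains132⇒contains132 : Contains132 n f → T (contains132 σ)
  Contains132⇒contains132 (a , b , c , c<n , a<b , b<c , v₁ , v₂) =
    anyFin³⁺ _ (fromℕ< a<n) (fromℕ< b<n) (fromℕ< c<n)
      (T∧⁺ (<F⁺ a<n b<n a<b) (T∧⁺ (<F⁺ b<n c<n b<c) (T∧⁺ (<σ⁺ a<n c<n v₁) (<σ⁺ c<n b<n v₂))))
    where b<n = <-trans b<c c<n
          a<n = <-trans a<b b<n

isFix isExc isDef isWeakExc : (ℕ → ℕ) → ℕ → Bool
isFix f x = f x ≡ᵇ x
isExc f x = x <ᵇ f x
isDef f x = f x <ᵇ x
isWeakExc f x = not (isDef f x)

indicator-trichotomy : ∀ f x → indicator (isFix f x) + (indicator (isExc f x) + indicator (isDef f x)) ≡ 1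
indicator-trichotomy f x with trichotomy x (f x)
... | inj₁ x<fx rewrite ≢⇒≡ᵇ-false (≢-sym (<⇒≢ x<fx)) | <⇒<ᵇ-true x<fx | ≥⇒<ᵇ-false (<⇒≤ x<fx) = refl
... | inj₂ (inj₁ x≡fx) rewrite sym x≡fx | ≡ᵇ-refl x | ≥⇒<ᵇ-false (≤-refl {x}) = refl
... | inj₂ (inj₂ fx<x) rewrite ≢⇒≡ᵇ-false (<⇒≢ fx<x) | <⇒<ᵇ-true fx<x | ≥⇒<ᵇ-false (<⇒≤ fx<x) = refl

isWeakExc≡isFix∨isExc : ∀ f x → isWeakExc f x ≡ (isFix f x ∨ isExc f x)
isWeakExc≡isFix∨isExc f x with trichotomy x (f x)
... | inj₁ x<fx rewrite ≢⇒≡ᵇ-false (≢-sym (<⇒≢ x<fx)) | <⇒<ᵇ-true x<fx | ≥⇒<ᵇ-false (<⇒≤ x<fx) = refl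
... | inj₂ (inj₁ x≡fx) rewrite sym x≡fx | ≡ᵇ-refl x | ≥⇒<ᵇ-false (≤-refl {x}) = refl
... | inj₂ (inj₂ fx<x) rewrite ≢⇒≡ᵇ-false (<⇒≢ fx<x) | <⇒<ᵇ-true fx<x | ≥⇒<ᵇ-false (<⇒≤ fx<x) = refl

#fix+#exc+#def≡n : ∀ n f → countN n (isFix f) + (countN n (isExc f) + countN n (isDef f)) ≡ n
#fix+#exc+#def≡n zero f = refl
#fix+#exc+#def≡n (suc n) f =
  trans (regroup (countN n (isFix f)) (countN n (isExc f)) (countN n (isDef f))
                 (indicator (isFix f n)) (indicator (isExc f n)) (indicator (isDef f n)))
  (trans (cong₂ _+_ (#fix+#exc+#def≡n n f) (indicator-trichotomy f n)) (+-comm n 1))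
  where
  regroup : ∀ a b c d e g → (a + d) + ((b + e) + (c + g)) ≡ (a + (b + c)) + (d + (e + g))
  regroup = solve-∀

module Involution (n : ℕ) (f : ℕ → ℕ) (maps : MapsBelow n f) (inv : Involutive n f) where

  injective : ∀ x y → x < n → y < n → f x ≡ f y → x ≡ y
  injective x y x<n y<n e = trans (sym (inv x x<n)) (trans (cong f e) (inv y y<n))

  #exc≡#def : countN n (isExc f) ≡ countN n (isDef f)
  #exc≡#def = countN-bijection n n (isExc f) (isDef f) f f
    (λ x x<n u → maps x x<n , T<⁺ (subst (_< f x) (sym (inv x x<n)) (T<⁻ u)))
    (λ x x<n d → maps x x<n , T<⁺ (subst (f x <_) (sym (inv x x<n)) (T<⁻ d)))
    (λ x x<n _ → inv x x<n) (λ x x<n _ → inv x x<n)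

  #fix+2#exc≡n : countN n (isFix f) + 2 * countN n (isExc f) ≡ n
  #fix+2#exc≡n =
    trans (cong (λ d → countN n (isFix f) + (countN n (isExc f) + d)) (trans (+-identityʳ _) #exc≡#def))
          (#fix+#exc+#def≡n n f)

  module Avoiding132 (avoid : ¬ Contains132 n f) where
    exc-downClosed : ∀ x y → y < n → x < y → T (isExc f y) → T (isExc f x)
    exc-downClosed x y y<n x<y exc-y with x <ᵇ f x in e
    ... | true = _
    ... | false = ⊥-elim (avoid (x , y , f y , maps y y<n , x<y , T<⁻ exc-y ,
                     ≤-<-trans (≮⇒≥ (λ l → subst T e (T<⁺ l))) (subst (x <_) (sym (inv y y<n)) x<y) ,
                     subst (_< f y) (sym (inv y y<n)) (T<⁻ exc-y)))

    #exc : ℕ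
    #exc = countN n (isExc f)

    isExc⇔<#exc : ∀ x → x < n → (T (isExc f x) → x < #exc) × (x < #exc → T (isExc f x))
    isExc⇔<#exc = downClosed⇒initialSegment n (isExc f) exc-downClosed

-- The rank of a 132-avoiding involution

maxList-≤ : ∀ xs k → (∀ y → y ∈ xs → y ≤ k) → maxList xs ≤ k
maxList-≤ [] k h = z≤n
maxList-≤ (x ∷ xs) k h = ⊔-lub (h x (here refl)) (maxList-≤ xs k (λ y m → h y (there m)))

∈⇒≤maxList : ∀ xs k → k ∈ xs → k ≤ maxList xs
∈⇒≤maxList (x ∷ xs) k (here refl) = m≤m⊔n x _
∈⇒≤maxList (x ∷ xs) k (there m) = ≤-trans (∈⇒≤maxList xs k m) (m≤n⊔m x _)

maxList-≡ : ∀ xs k → (∀ y → y ∈ xs → y ≤ k) → k ∈ xs → maxList xs ≡ k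
maxList-≡ xs k h m = ≤-antisym (maxList-≤ xs k h) (∈⇒≤maxList xs k m)

module _ {n : ℕ} (σ : Fn n) where
  private
    f : ℕ → ℕ
    f = ⟦ σ ⟧

  rkHolds⇒ : ∀ k → T (rkHolds σ k) → ∀ x → x < n → x < k → k ≤ f x
  rkHolds⇒ k t x x<n x<k =
    subst (k ≤_) (trans (toℕ-lookup σ i) (cong f (toℕ-fromℕ< x<n)))
      (at-i (toℕ i <ᵇ k) (toℕ (lookup σ i) <ᵇ k) refl refl (allFin-all⁻ _ t i))
    where
    i = fromℕ< x<n
    at-i : ∀ b c → (toℕ i <ᵇ k) ≡ b → (toℕ (lookup σ i) <ᵇ k) ≡ c → T (if b then not c else true) → k ≤ toℕ (lookup σ i)
    at-i true false _ e _ = ≮⇒≥ (λ l → subst T e (T<⁺ l))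
    at-i false _ e _ _ = ⊥-elim (subst T e (T<⁺ (subst (_< k) (sym (toℕ-fromℕ< x<n)) x<k)))

  ⇒rkHolds : ∀ k → (∀ x → x < n → x < k → k ≤ f x) → T (rkHolds σ k)
  ⇒rkHolds k h = allFin-all⁺ _ (λ i → at-i i (toℕ i <ᵇ k) refl)
    where
    at-i : ∀ i b → (toℕ i <ᵇ k) ≡ b → T (if b then not (toℕ (lookup σ i) <ᵇ k) else true)
    at-i i false _ = _
    at-i i true e = Tnot⁺ (λ l → <-irrefl refl
      (≤-<-trans (subst (k ≤_) (sym (toℕ-lookup σ i)) (h (toℕ i) (toℕ<n i) (T<⁻ {toℕ i} {k} (Tb e)))) (T<⁻ l)))

  -- The rank is attained at k = #exc: below it all values are excedances, hence ≥ #exc,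
  -- and position #exc itself is not an excedance, so no larger k qualifies.
  rk≡exc : Involutive n f → ¬ Contains132 n f → rk σ ≡ exc σ
  rk≡exc inv avoid = trans (maxList-≡ _ #exc bounded attained) (sym (exc≡countN σ))
    where
    open Involution n f (⟦⟧-< σ) inv
    open Avoiding132 avoid
    candidate : ℕ → ℕ
    candidate k = if rkHolds σ k then k else 0
    holds : T (rkHolds σ #exc)
    holds = ⇒rkHolds #exc (λ x x<n x<e → ≮⇒≥ (λ fx<e →
      let exc-x = proj₂ (isExc⇔<#exc x x<n) x<e in
      let exc-fx = proj₂ (isExc⇔<#exc (f x) (⟦⟧-< σ x x<n)) fx<e in
      <-asym (T<⁻ {x} {f x} exc-x) (subst (f x <_) (inv x x<n) (T<⁻ exc-fx))))
    attained : #exc ∈ map candidate (upTo (suc n))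
    attained = subst (_∈ map candidate (upTo (suc n))) (cong (λ b → if b then #exc else 0) (bT holds))
                     (∈-map⁺ candidate (∈-upTo⁺ (s≤s (countN-≤ n (isExc f)))))
    bounded : ∀ y → y ∈ map candidate (upTo (suc n)) → y ≤ #exc
    bounded y y∈ with ∈-map⁻ candidate y∈
    ... | k , k∈ , refl with rkHolds σ k in e
    ...   | false = z≤n
    ...   | true = ≮⇒≥ (λ e<k →
      let e<n = <-≤-trans e<k (≤-pred (∈-upTo⁻ k∈)) in
      let not-exc : ¬ T (isExc f #exc)
          not-exc u = <-irrefl refl (proj₁ (isExc⇔<#exc #exc e<n) u) in
      <-irrefl refl (<-≤-trans e<k (≤-trans (rkHolds⇒ k (Tb e) #exc e<n e<k) (≮⇒≥ (λ l → not-exc (T<⁺ l))))))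

_∈ᵇ_ : ℕ → List ℕ → Bool
x ∈ᵇ [] = false
x ∈ᵇ (y ∷ ys) = (x ≡ᵇ y) ∨ (x ∈ᵇ ys)

∈ᵇ⇒∈ : ∀ x ys → T (x ∈ᵇ ys) → x ∈ ys
∈ᵇ⇒∈ x (y ∷ ys) t with x ≡ᵇ y in e
... | true = here (T≡⁻ {x} {y} (Tb e))
... | false = there (∈ᵇ⇒∈ x ys t)

countN-∈ᵇ : ∀ n ps → AllPairs _<_ ps → (∀ y → y ∈ ps → y < n) → countN n (_∈ᵇ ps) ≡ length ps
countN-∈ᵇ n [] _ _ = countN-none n _ (λ _ _ ())
countN-∈ᵇ n (p ∷ ps) (p< ∷ asc) below =
  trans (countN-∨ n (_≡ᵇ p) (_∈ᵇ ps) (λ x _ x≡p x∈ps → <-irrefl (sym (T≡⁻ {x} {p} x≡p)) (All.lookup p< (∈ᵇ⇒∈ x ps x∈ps))))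
        (cong₂ _+_ (countN-singleton n p (below p (here refl))) (countN-∈ᵇ n ps asc (λ y m → below y (there m))))

sublists⇒⊆ : ∀ (xs : List A) {s} → s ∈ sublists xs → s ⊆ xs
sublists⇒⊆ [] (here refl) = []
sublists⇒⊆ (x ∷ xs) m with ∈-++⁻ (map (x ∷_) (sublists xs)) m
... | inj₁ m₁ with ∈-map⁻ (x ∷_) m₁
...   | s′ , m′ , refl = refl ∷ sublists⇒⊆ xs m′
sublists⇒⊆ (x ∷ xs) m | inj₂ m₂ = x ∷ʳ sublists⇒⊆ xs m₂

filterᵇ∈sublists : ∀ (p : A → Bool) xs → filterᵇ p xs ∈ sublists xs
filterᵇ∈sublists p [] = here refl
filterᵇ∈sublists p (x ∷ xs) with p x
... | true = ∈-++⁺ˡ (∈-map⁺ (x ∷_) (filterᵇ∈sublists p xs))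
... | false = ∈-++⁺ʳ (map (x ∷_) (sublists xs)) (filterᵇ∈sublists p xs)

AllPairs-resp-⊆ : ∀ {R : A → A → Set} {xs ys} → xs ⊆ ys → AllPairs R ys → AllPairs R xs
AllPairs-resp-⊆ [] [] = []
AllPairs-resp-⊆ (_ ∷ʳ p) (_ ∷ rs) = AllPairs-resp-⊆ p rs
AllPairs-resp-⊆ (refl ∷ p) (r ∷ rs) = All-resp-⊆ p r ∷ AllPairs-resp-⊆ p rs

positions-ascending : ∀ n {s} → s ∈ sublists (allFin n) → AllPairs _<_ (map toℕ s)
positions-ascending n s∈ =
  AllPairs-resp-⊆ (⊆-map⁺ toℕ (sublists⇒⊆ (allFin n) s∈))
    (subst (AllPairs _<_) (sym (map-toℕ-allFin n)) (applyUpTo⁺₁ id n (λ i<j _ → i<j)))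

module _ {n : ℕ} (σ : Fn n) where
  private
    f : ℕ → ℕ
    f = ⟦ σ ⟧

  increasingAlong⇒ascending : ∀ s → T (increasingAlong σ s) → AllPairs _<_ (map (f ∘ toℕ) s)
  increasingAlong⇒ascending [] t = []
  increasingAlong⇒ascending (a ∷ []) t = [] ∷ []
  increasingAlong⇒ascending (a ∷ b ∷ s) t =
    let (a<b , t′) = T∧⁻ {lookup σ a <F lookup σ b} t in
    extend (subst₂ _<_ (toℕ-lookup σ a) (toℕ-lookup σ b) (T<⁻ a<b)) (increasingAlong⇒ascending (b ∷ s) t′)
    where
    extend : f (toℕ a) < f (toℕ b) → AllPairs _<_ (map (f ∘ toℕ) (b ∷ s)) → AllPairs _<_ (map (f ∘ toℕ) (a ∷ b ∷ s))
    extend fa<fb (b< ∷ asc) = (fa<fb ∷ All.map (<-trans fa<fb) b<) ∷ (b< ∷ asc)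

  ascending⇒increasingAlong : ∀ s → AllPairs _<_ (map (f ∘ toℕ) s) → T (increasingAlong σ s)
  ascending⇒increasingAlong [] _ = _
  ascending⇒increasingAlong (a ∷ []) _ = _
  ascending⇒increasingAlong (a ∷ b ∷ s) ((fa<fb ∷ _) ∷ asc) =
    T∧⁺ (T<⁺ (subst₂ _<_ (sym (toℕ-lookup σ a)) (sym (toℕ-lookup σ b)) fa<fb)) (ascending⇒increasingAlong (b ∷ s) asc)

ascending-map⇒monotone : ∀ (f : ℕ → ℕ) ps → AllPairs _<_ ps → AllPairs _<_ (map f ps) →
  ∀ y z → y ∈ ps → z ∈ ps → y < z → f y < f z
ascending-map⇒monotone f (p ∷ ps) _ _ y z (here refl) (here refl) y<z = ⊥-elim (<-irrefl refl y<z)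
ascending-map⇒monotone f (p ∷ ps) _ (fp< ∷ _) y z (here refl) (there z∈) _ = All.lookup fp< (∈-map⁺ f z∈)
ascending-map⇒monotone f (p ∷ ps) (p< ∷ _) _ y z (there y∈) (here refl) y<z = ⊥-elim (<-asym y<z (All.lookup p< y∈))
ascending-map⇒monotone f (p ∷ ps) (_ ∷ asc) (_ ∷ fasc) y z (there y∈) (there z∈) y<z = ascending-map⇒monotone f ps asc fasc y z y∈ z∈ y<z

monotone⇒ascending-map : ∀ (f : ℕ → ℕ) ps → AllPairs _<_ ps → (∀ y z → y ∈ ps → z ∈ ps → y < z → f y < f z) → AllPairs _<_ (map f ps)
monotone⇒ascending-map f [] _ _ = []
monotone⇒ascending-map f (p ∷ ps) (p< ∷ asc) mono =
  All.map⁺ (All.tabulate (λ {z} z∈ → mono p z (here refl) (there z∈) (All.lookup p< z∈)))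
  ∷ monotone⇒ascending-map f ps asc (λ y z y∈ z∈ → mono y z (there y∈) (there z∈))

-- The longest increasing subsequence of a 321-avoiding involution

module _ {n : ℕ} (σ : Fn n) (inv : Involutive n ⟦ σ ⟧) where
  private
    f : ℕ → ℕ
    f = ⟦ σ ⟧
  open Involution n f (⟦⟧-< σ) inv

  #weakExc≡fp+exc : countN n (isWeakExc f) ≡ fp σ + exc σ
  #weakExc≡fp+exc =
    trans (countN-cong n _ _ (λ x _ → isWeakExc≡isFix∨isExc f x))
    (trans (countN-∨ n (isFix f) (isExc f) (λ x _ fix exc → <-irrefl (sym (T≡⁻ {f x} {x} fix)) (T<⁻ {x} {f x} exc)))
           (sym (cong₂ _+_ (fp≡countN σ) (exc≡countN σ))))

  -- x ↦ σ(x) maps the deficiencies on an increasing subsequence injectively to weak excedances off it.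
  increasing⇒length≤#weakExc : ∀ s → s ∈ sublists (allFin n) → T (increasingAlong σ s) → length s ≤ countN n (isWeakExc f)
  increasing⇒length≤#weakExc s s∈ t =
    subst (_≤ countN n (isWeakExc f)) (trans (countN-∈ᵇ n ps asc below) (length-map toℕ s))
      (subst₂ _≤_ (sym (countN-split n (_∈ᵇ ps) (isWeakExc f))) (sym (countN-split n (isWeakExc f) (_∈ᵇ ps)))
        (+-mono-≤ (≤-reflexive (countN-cong n _ _ (λ x _ → ∧-comm (x ∈ᵇ ps) (isWeakExc f x)))) deficient≤))
    where
    ps = map toℕ s
    asc : AllPairs _<_ ps
    asc = positions-ascending n s∈
    values-asc : AllPairs _<_ (map f ps)
    values-asc = subst (AllPairs _<_) (map-∘ s) (increasingAlong⇒ascending σ s t)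
    below : ∀ y → y ∈ ps → y < n
    below y y∈ = let (i , _ , e) = ∈-map⁻ toℕ y∈ in subst (_< n) (sym e) (toℕ<n i)
    deficient≤ : countN n (λ x → (x ∈ᵇ ps) ∧ not (isWeakExc f x)) ≤ countN n (λ x → isWeakExc f x ∧ not (x ∈ᵇ ps))
    deficient≤ = countN-injection n n _ _ f
      (λ x x<n t → let (x∈ , d) = T∧⁻ {x ∈ᵇ ps} t in
         let fx<x : f x < x
             fx<x = T<⁻ {f x} {x} (subst T (not-involutive _) d) in
         ⟦⟧-< σ x x<n ,
         T∧⁺ (Tnot⁺ (λ d′ → <-asym fx<x (subst (_< f x) (inv x x<n) (T<⁻ {f (f x)} {f x} d′))))
             (Tnot⁺ (λ fx∈ → <-asym fx<x (subst (_< f x) (inv x x<n)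
                (ascending-map⇒monotone f ps asc values-asc (f x) x (∈ᵇ⇒∈ (f x) ps fx∈) (∈ᵇ⇒∈ x ps x∈) fx<x)))))
      (λ x y x<n y<n _ _ e → injective x y x<n y<n e)

  module Avoiding321 (avoid : ¬ Contains321 n f) where
    weakExc-monotone : ∀ x y → x < y → y < n → T (isWeakExc f x) → T (isWeakExc f y) → f x < f y
    weakExc-monotone x y x<y y<n wx wy with trichotomy (f x) (f y)
    ... | inj₁ l = l
    ... | inj₂ (inj₁ e) = ⊥-elim (<-irrefl (injective x y (<-trans x<y y<n) y<n e) x<y)
    ... | inj₂ (inj₂ fy<fx) with trichotomy y (f y)
    ...   | inj₁ y<fy = ⊥-elim (avoid (x , y , f y , ⟦⟧-< σ y y<n , x<y , y<fy , fy<fx , subst (_< f y) (sym (inv y y<n)) y<fy))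
    ...   | inj₂ (inj₂ fy<y) = ⊥-elim (Tnot⁻ wy (T<⁺ fy<y))
    ...   | inj₂ (inj₁ y≡fy) = ⊥-elim (avoid (x , y , f x , ⟦⟧-< σ x x<n , x<y , y<fx , fy<fx ,
                                    subst (_< f y) (sym (inv x x<n)) (subst (x <_) y≡fy x<y)))
      where
      x<n = <-trans x<y y<n
      y<fx : y < f x
      y<fx = subst (_< f x) (sym y≡fy) fy<fx

    weakExcPositions : List (Fin n)
    weakExcPositions = filterᵇ (λ i → not (toℕ (lookup σ i) <ᵇ toℕ i)) (allFin n)

    length-weakExcPositions : length weakExcPositions ≡ countN n (isWeakExc f)
    length-weakExcPositions =
      trans (sym (countB≡length-filter _ (allFin n)))
            (countB-allFin n _ (isWeakExc f) (λ i → cong (λ z → not (z <ᵇ toℕ i)) (toℕ-lookup σ i)))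

    weakExcPositions-increasing : T (increasingAlong σ weakExcPositions)
    weakExcPositions-increasing =
      ascending⇒increasingAlong σ weakExcPositions
        (subst (AllPairs _<_) (sym (map-∘ weakExcPositions)) (monotone⇒ascending-map f ps asc mono))
      where
      ps = map toℕ weakExcPositions
      asc : AllPairs _<_ ps
      asc = positions-ascending n (filterᵇ∈sublists _ (allFin n))
      weakExc-below : ∀ y → y ∈ ps → T (isWeakExc f y) × y < n
      weakExc-below y y∈ =
        let (i , i∈ , e) = ∈-map⁻ toℕ y∈ in
        let w = proj₂ (∈-filter⁻ (λ i → T? (not (toℕ (lookup σ i) <ᵇ toℕ i))) {xs = allFin n} i∈) in
        subst (T ∘ isWeakExc f) (sym e) (subst (λ z → T (not (z <ᵇ toℕ i))) (toℕ-lookup σ i) w) ,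
        subst (_< n) (sym e) (toℕ<n i)
      mono : ∀ y z → y ∈ ps → z ∈ ps → y < z → f y < f z
      mono y z y∈ z∈ y<z = weakExc-monotone y z y<z (proj₂ (weakExc-below z z∈)) (proj₁ (weakExc-below y y∈)) (proj₁ (weakExc-below z z∈))

    lis≡fp+exc : lis σ ≡ fp σ + exc σ
    lis≡fp+exc = trans (maxList-≡ _ (countN n (isWeakExc f)) bounded attained) #weakExc≡fp+exc
      where
      candidate : List (Fin n) → ℕ
      candidate s = if increasingAlong σ s then length s else 0
      attained : countN n (isWeakExc f) ∈ map candidate (sublists (allFin n))
      attained = subst (_∈ map candidate (sublists (allFin n)))
                   (trans (cong (λ b → if b then length weakExcPositions else 0) (bT weakExcPositions-increasing)) length-weakExcPositions)
                   (∈-map⁺ candidate (filterᵇ∈sublists _ (allFin n)))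
      bounded : ∀ y → y ∈ map candidate (sublists (allFin n)) → y ≤ countN n (isWeakExc f)
      bounded y y∈ with ∈-map⁻ candidate y∈
      ... | s , s∈ , refl with increasingAlong σ s in e
      ...   | false = z≤n
      ...   | true = increasing⇒length≤#weakExc s s∈ (Tb e)

-- Words encoding involutions: U opens a 2-cycle, D closes one, F is a fixed point

data Letter : Set where
  F U D : Letter

letters : List Letter
letters = F ∷ U ∷ D ∷ []

allWords : ℕ → List (List Letter)
allWords zero = [] ∷ []
allWords (suc n) = cartesianProductWith _∷_ letters (allWords n)

allWords-unique : ∀ n → Unique (allWords n)
allWords-unique zero = [] ∷ []
allWords-unique (suc n) = cartesianProductWith⁺ _∷_ ∷-injective′ letters-unique (allWords-unique n)
  where
  letters-unique : Unique letters
  letters-unique = ((λ ()) ∷ (λ ()) ∷ []) ∷ ((λ ()) ∷ []) ∷ [] ∷ []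
  ∷-injective′ : ∀ {a b : Letter} {v w} → a ∷ v ≡ b ∷ w → a ≡ b × v ≡ w
  ∷-injective′ refl = refl , refl

allWords-complete : ∀ n w → length w ≡ n → w ∈ allWords n
allWords-complete zero [] refl = here refl
allWords-complete (suc n) (l ∷ w) e = ∈-cartesianProductWith⁺ _∷_ (∈-letters l) (allWords-complete n w (suc-injective e))
  where
  ∈-letters : ∀ l → l ∈ letters
  ∈-letters F = here refl
  ∈-letters U = there (here refl)
  ∈-letters D = there (there (here refl))

allWords-length : ∀ n w → w ∈ allWords n → length w ≡ n
allWords-length zero w (here refl) = refl
allWords-length (suc n) w w∈ with ∈-cartesianProductWith⁻ _∷_ letters (allWords n) w∈
... | l , w′ , _ , w′∈ , refl = cong suc (allWords-length n w′ w′∈)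

valid : ℕ → List Letter → Bool
valid h [] = h ≡ᵇ 0
valid h (F ∷ w) = (h ≡ᵇ 0) ∧ valid h w
valid h (U ∷ w) = valid (suc h) w
valid h (D ∷ w) = not (h ≡ᵇ 0) ∧ valid (pred h) w

dyck : ℕ → List Letter → Bool
dyck h [] = h ≡ᵇ 0
dyck h (F ∷ w) = false
dyck h (U ∷ w) = dyck (suc h) w
dyck h (D ∷ w) = not (h ≡ᵇ 0) ∧ dyck (pred h) w

#F : List Letter → ℕ
#F [] = 0
#F (F ∷ w) = suc (#F w)
#F (U ∷ w) = #F w
#F (D ∷ w) = #F w

#U : List Letter → ℕ
#U [] = 0
#U (U ∷ w) = suc (#U w)
#U (F ∷ w) = #U w
#U (D ∷ w) = #U w

splitAtReturn : ℕ → List Letter → List Letter × List Letter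
splitAtReturn h [] = [] , []
splitAtReturn h (F ∷ w) = (F ∷ proj₁ (splitAtReturn h w)) , proj₂ (splitAtReturn h w)
splitAtReturn h (U ∷ w) = (U ∷ proj₁ (splitAtReturn (suc h) w)) , proj₂ (splitAtReturn (suc h) w)
splitAtReturn zero (D ∷ w) = [] , w
splitAtReturn (suc h) (D ∷ w) = (D ∷ proj₁ (splitAtReturn h w)) , proj₂ (splitAtReturn h w)

dyck⇒#F≡0 : ∀ h w → T (dyck h w) → #F w ≡ 0
dyck⇒#F≡0 h [] t = refl
dyck⇒#F≡0 h (U ∷ w) t = dyck⇒#F≡0 (suc h) w t
dyck⇒#F≡0 (suc h) (D ∷ w) t = dyck⇒#F≡0 h w t
dyck⇒#F≡0 zero (D ∷ w) ()

dyck≡valid : ∀ h w → #F w ≡ 0 → dyck h w ≡ valid h w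
dyck≡valid h [] e = refl
dyck≡valid h (U ∷ w) e = dyck≡valid (suc h) w e
dyck≡valid h (D ∷ w) e = cong (not (h ≡ᵇ 0) ∧_) (dyck≡valid (pred h) w e)

valid∧#F≡0≡dyck : ∀ w → (valid 0 w ∧ (#F w ≡ᵇ 0)) ≡ dyck 0 w
valid∧#F≡0≡dyck w with #F w in e
... | zero = trans (∧-identityʳ _) (sym (dyck≡valid 0 w e))
... | suc k with dyck 0 w in e₂
...   | true = ⊥-elim (0≢1+n (trans (sym (dyck⇒#F≡0 0 w (Tb e₂))) e))
...   | false = ∧-zeroʳ _

dyck-length : ∀ j w → T (dyck j w) → length w ≡ 2 * #U w + j
dyck-length j [] t = trans (sym (+-identityʳ 0)) (cong (0 +_) (sym (T≡⁻ {j} {0} t)))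
dyck-length j (U ∷ w) t = trans (cong suc (dyck-length (suc j) w t)) (l (#U w) j)
  where l : ∀ a j → suc (2 * a + suc j) ≡ 2 * suc a + j
        l = solve-∀
dyck-length (suc j) (D ∷ w) t = trans (cong suc (dyck-length j w t)) (sym (+-suc _ j))

valid⇒split : ∀ j h w → T (valid (suc (j + h)) w) →
  w ≡ proj₁ (splitAtReturn j w) ++ D ∷ proj₂ (splitAtReturn j w) × T (dyck j (proj₁ (splitAtReturn j w))) × T (valid h (proj₂ (splitAtReturn j w)))
valid⇒split j h (U ∷ w) t with valid⇒split (suc j) h w t
... | e , d , o = cong (U ∷_) e , d , o
valid⇒split zero h (D ∷ w) t = refl , tt , t
valid⇒split (suc j) h (D ∷ w) t with valid⇒split j h w t
... | e , d , o = cong (D ∷_) e , d , o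

split⇒valid : ∀ j h d r → T (dyck j d) → T (valid h r) → T (valid (suc (j + h)) (d ++ D ∷ r)) × splitAtReturn j (d ++ D ∷ r) ≡ (d , r)
split⇒valid zero h [] r t o = o , refl
split⇒valid (suc j) h [] r () o
split⇒valid j h (U ∷ d) r t o with split⇒valid (suc j) h d r t o
... | a , b = a , cong (λ p → (U ∷ proj₁ p) , proj₂ p) b
split⇒valid (suc j) h (D ∷ d) r t o with split⇒valid j h d r t o
... | a , b = a , cong (λ p → (D ∷ proj₁ p) , proj₂ p) b

#F-++ : ∀ a b → #F (a ++ b) ≡ #F a + #F b
#F-++ [] b = refl
#F-++ (F ∷ a) b = cong suc (#F-++ a b)
#F-++ (U ∷ a) b = #F-++ a b
#F-++ (D ∷ a) b = #F-++ a b


lastValue : ℕ → List Letter → ℕ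
lastValue n (F ∷ w) = n ∸ 1
lastValue n (U ∷ w) = #U (proj₁ (splitAtReturn 0 w))
lastValue n _ = 0

validWith : (ℕ → Bool) → List Letter → Bool
validWith P w = valid 0 w ∧ P (#F w)

wordCount : ℕ → (ℕ → Bool) → ℕ
wordCount n P = countB (validWith P) (allWords n)

U-length : ∀ w → T (valid 0 (U ∷ w)) → length (U ∷ w) ≡ 2 + 2 * #U (proj₁ (splitAtReturn 0 w)) + length (proj₂ (splitAtReturn 0 w))
U-length w t with valid⇒split 0 0 w t
... | e , d , _ = begin
  suc (length w)                                 ≡⟨ cong (suc ∘ length) e ⟩
  suc (length (block ++ D ∷ rest))               ≡⟨ cong suc (length-++ block) ⟩
  suc (length block + suc (length rest))         ≡⟨ cong (λ z → suc (z + suc (length rest))) (trans (dyck-length 0 block d) (+-identityʳ _)) ⟩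
  suc (2 * #U block + suc (length rest))         ≡⟨ regroup (#U block) (length rest) ⟩
  2 + 2 * #U block + length rest                 ∎
  where
  open ≡-Reasoning
  block = proj₁ (splitAtReturn 0 w)
  rest = proj₂ (splitAtReturn 0 w)
  regroup : ∀ a b → suc (2 * a + suc b) ≡ 2 + 2 * a + b
  regroup = solve-∀

lastValue-< : ∀ n P w → 0 < n → w ∈ allWords n → T (validWith P w) → lastValue n w < n
lastValue-< n P (F ∷ w) _ m t rewrite sym (allWords-length n _ m) = ≤-refl
lastValue-< n P (U ∷ w) _ m t rewrite sym (allWords-length n _ m) =
  subst (#U (proj₁ (splitAtReturn 0 w)) <_) (sym (U-length w (proj₁ (T∧⁻ t)))) (lt (#U (proj₁ (splitAtReturn 0 w))) (length (proj₂ (splitAtReturn 0 w))))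
  where
  l : ∀ a b → 2 + 2 * a + b ≡ suc a + suc (a + b)
  l = solve-∀
  lt : ∀ a b → a < 2 + 2 * a + b
  lt a b = subst (suc a ≤_) (sym (l a b)) (m≤m+n (suc a) _)
lastValue-< n P (D ∷ w) _ m ()
lastValue-< n P [] 0<n m t = ⊥-elim (<-irrefl (allWords-length n [] m) 0<n)

words-headF : ∀ M P → countB (λ w → validWith P w ∧ (lastValue (suc M) w ≡ᵇ M)) (allWords (suc M)) ≡ countB (validWith (P ∘ suc)) (allWords M)
words-headF M P = countB-bijection _ _ _ _ (drop 1) (F ∷_) (allWords-unique (suc M)) (allWords-unique M) forward backward
  where
  forward : ∀ a → a ∈ allWords (suc M) → T (validWith P a ∧ (lastValue (suc M) a ≡ᵇ M)) →
       drop 1 a ∈ allWords M × T (validWith (P ∘ suc) (drop 1 a)) × (F ∷ drop 1 a) ≡ a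
  forward (F ∷ w) w∈ t with T∧⁻ {validWith P (F ∷ w)} t
  ... | valid-P , _ with T∧⁻ {valid 0 (F ∷ w)} valid-P
  ... | valid-w , P-#F = allWords-complete M w (suc-injective (allWords-length (suc M) _ w∈)) , T∧⁺ (proj₂ (T∧⁻ {0 ≡ᵇ 0} valid-w)) P-#F , refl
  forward (U ∷ w) w∈ t with T∧⁻ {validWith P (U ∷ w)} t
  ... | valid-P , lastValue≡ = ⊥-elim (<-irrefl refl M<M)
    where
    length≡ : suc M ≡ 2 + 2 * M + length (proj₂ (splitAtReturn 0 w))
    length≡ = trans (sym (allWords-length (suc M) _ w∈))
              (trans (U-length w (proj₁ (T∧⁻ {valid 0 (U ∷ w)} valid-P)))
                     (cong (λ z → 2 + 2 * z + length (proj₂ (splitAtReturn 0 w))) (T≡⁻ {#U (proj₁ (splitAtReturn 0 w))} {M} lastValue≡)))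
    regroup : ∀ a b → 2 + 2 * a + b ≡ (2 + a) + (a + b)
    regroup = solve-∀
    M<M : suc M < suc M
    M<M = subst (2 + M ≤_) (trans (sym (regroup M _)) (sym length≡)) (m≤m+n (2 + M) _)
  forward (D ∷ w) w∈ ()
  forward [] w∈ t = ⊥-elim (0≢1+n (allWords-length (suc M) [] w∈))
  backward : ∀ b → b ∈ allWords M → T (validWith (P ∘ suc) b) →
       (F ∷ b) ∈ allWords (suc M) × T (validWith P (F ∷ b) ∧ (lastValue (suc M) (F ∷ b) ≡ᵇ M)) × drop 1 (F ∷ b) ≡ b
  backward b w∈ t with T∧⁻ {valid 0 b} t
  ... | valid-w , P-#F = allWords-complete (suc M) (F ∷ b) (cong suc (allWords-length M b w∈)) , T∧⁺ (T∧⁺ (T∧⁺ {0 ≡ᵇ 0} tt valid-w) P-#F) (T≡⁺ {M} refl) , refl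

joinFirstBlock : List Letter × List Letter → List Letter
joinFirstBlock (d , r) = U ∷ (d ++ D ∷ r)

splitFirstBlock : List Letter → List Letter × List Letter
splitFirstBlock w = splitAtReturn 0 (drop 1 w)

words-headU : ∀ q R P → countB (λ w → validWith P w ∧ (lastValue (2 + 2 * q + R) w ≡ᵇ q)) (allWords (2 + 2 * q + R))
             ≡ countB (λ p → dyck 0 (proj₁ p) ∧ validWith P (proj₂ p)) (cartesianProduct (allWords (2 * q)) (allWords R))
words-headU q R P = countB-bijection _ _ _ _ splitFirstBlock joinFirstBlock (allWords-unique N) (cartesianProduct⁺ (allWords-unique (2 * q)) (allWords-unique R)) forward backward
  where
  N : ℕ
  N = 2 + 2 * q + R
  forward : ∀ a → a ∈ allWords N → T (validWith P a ∧ (lastValue N a ≡ᵇ q)) →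
       splitFirstBlock a ∈ cartesianProduct (allWords (2 * q)) (allWords R) ×
       T (dyck 0 (proj₁ (splitFirstBlock a)) ∧ validWith P (proj₂ (splitFirstBlock a))) ×
       joinFirstBlock (splitFirstBlock a) ≡ a
  forward (F ∷ w) w∈ t = ⊥-elim (<-irrefl refl (subst (q <_) (T≡⁻ {N ∸ 1} {q} (proj₂ (T∧⁻ {validWith P (F ∷ w)} t))) q<N-1))
    where
    q<N-1 : q < N ∸ 1
    q<N-1 = s≤s (≤-trans (m≤m+n q (q + 0)) (m≤m+n (2 * q) R))
  forward (U ∷ w) w∈ t with T∧⁻ {validWith P (U ∷ w)} t
  ... | valid-P , lastValue≡ with T∧⁻ {valid 0 (U ∷ w)} valid-P
  ... | valid-w , P-#F with valid⇒split 0 0 w valid-w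
  ... | e , dyck-d , valid-r = ∈-cartesianProduct⁺ (allWords-complete (2 * q) d length-d) (allWords-complete R r length-r) ,
                      T∧⁺ dyck-d (T∧⁺ valid-r (subst (T ∘ P) #F≡ P-#F)) , sym (cong (U ∷_) e)
    where
    d = proj₁ (splitAtReturn 0 w)
    r = proj₂ (splitAtReturn 0 w)
    #U≡q : #U d ≡ q
    #U≡q = T≡⁻ {#U d} {q} lastValue≡
    length-d : length d ≡ 2 * q
    length-d = trans (dyck-length 0 d dyck-d) (trans (+-identityʳ _) (cong (2 *_) #U≡q))
    length-r : length r ≡ R
    length-r = +-cancelˡ-≡ (2 + 2 * q) _ _ (sym (trans (sym (allWords-length N _ w∈)) (subst (λ z → length (U ∷ w) ≡ 2 + 2 * z + length r) #U≡q (U-length w valid-w))))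
    #F≡ : #F (U ∷ w) ≡ #F r
    #F≡ = trans (cong #F e) (trans (#F-++ d (D ∷ r)) (cong (_+ #F r) (dyck⇒#F≡0 0 d dyck-d)))
  forward (D ∷ w) w∈ ()
  forward [] w∈ t = ⊥-elim (0≢1+n (allWords-length N [] w∈))
  backward : ∀ b → b ∈ cartesianProduct (allWords (2 * q)) (allWords R) → T (dyck 0 (proj₁ b) ∧ validWith P (proj₂ b)) →
       joinFirstBlock b ∈ allWords N × T (validWith P (joinFirstBlock b) ∧ (lastValue N (joinFirstBlock b) ≡ᵇ q)) × splitFirstBlock (joinFirstBlock b) ≡ b
  backward (d , r) w∈ t with ∈-cartesianProduct⁻ (allWords (2 * q)) (allWords R) w∈ | T∧⁻ {dyck 0 d} t
  ... | d∈ , r∈ | dyck-d , valid-P-r with T∧⁻ {valid 0 r} valid-P-r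
  ... | valid-r , P-#F with split⇒valid 0 0 d r dyck-d valid-r
  ... | valid-w , split-join = allWords-complete N (U ∷ (d ++ D ∷ r)) len ,
                 T∧⁺ (T∧⁺ valid-w (subst (T ∘ P) (sym #F≡) P-#F)) (subst (λ z → T (#U (proj₁ z) ≡ᵇ q)) (sym split-join) (T≡⁺ #U≡q)) ,
                 split-join
    where
    #F≡ : #F (U ∷ (d ++ D ∷ r)) ≡ #F r
    #F≡ = trans (#F-++ d (D ∷ r)) (cong (_+ #F r) (dyck⇒#F≡0 0 d dyck-d))
    #U≡q : #U d ≡ q
    #U≡q = *-cancelˡ-≡ _ _ 2 (trans (sym (trans (dyck-length 0 d dyck-d) (+-identityʳ _))) (allWords-length (2 * q) d d∈))
    len : length (U ∷ (d ++ D ∷ r)) ≡ N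
    len = trans (cong suc (length-++ d)) (trans (cong₂ (λ a b → suc (a + suc b)) (allWords-length (2 * q) d d∈) (allWords-length R r r∈)) (regroup q R))
      where regroup : ∀ a b → suc (2 * a + suc b) ≡ 2 + 2 * a + b
            regroup = solve-∀

words-lastValue-none : ∀ N q P → q ≢ N ∸ 1 → N < 2 + 2 * q → countB (λ w → validWith P w ∧ (lastValue N w ≡ᵇ q)) (allWords N) ≡ 0
words-lastValue-none N q P q≢N-1 N<2+2q = countB-none _ (allWords N) impossible
  where
  impossible : ∀ w → w ∈ allWords N → T (validWith P w ∧ (lastValue N w ≡ᵇ q)) → ⊥
  impossible (F ∷ w) w∈ t = q≢N-1 (sym (T≡⁻ {N ∸ 1} {q} (proj₂ (T∧⁻ {validWith P (F ∷ w)} t))))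
  impossible (U ∷ w) w∈ t with T∧⁻ {validWith P (U ∷ w)} t
  ... | valid-P , lastValue≡ = <-irrefl refl (<-≤-trans N<2+2q (subst (2 + 2 * q ≤_) length≡ (m≤m+n _ _)))
    where
    length≡ : 2 + 2 * q + length (proj₂ (splitAtReturn 0 w)) ≡ N
    length≡ = trans (sym (trans (U-length w (proj₁ (T∧⁻ {valid 0 (U ∷ w)} valid-P)))
                                (cong (λ z → 2 + 2 * z + length (proj₂ (splitAtReturn 0 w))) (T≡⁻ {#U (proj₁ (splitAtReturn 0 w))} {q} lastValue≡))))
                    (allWords-length N _ w∈)
  impossible (D ∷ w) w∈ ()
  impossible [] w∈ t = q≢N-1 (trans (sym (T≡⁻ {0} {q} (proj₂ (T∧⁻ {validWith P []} t)))) (cong (_∸ 1) (allWords-length N [] w∈)))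

letterAt : List Letter → ℕ → Letter
letterAt [] x = F
letterAt (l ∷ w) zero = l
letterAt (l ∷ w) (suc x) = letterAt w x

isU isD isF : Letter → Bool
isU U = true
isU _ = false
isD D = true
isD _ = false
isF F = true
isF _ = false

#U< #D< : List Letter → ℕ → ℕ
#U< w t = countN t (λ y → isU (letterAt w y))
#D< w t = countN t (λ y → isD (letterAt w y))

countN-suc : ∀ t (P : ℕ → Bool) → countN (suc t) P ≡ indicator (P 0) + countN t (λ y → P (suc y))
countN-suc t P = countN-+ 1 t P

-- valid h w restated through prefix counts; in this form the k-th U is matched with the k-th D.
Balanced : ℕ → List Letter → Set
Balanced h w = (∀ t → t ≤ length w → #D< w t ≤ h + #U< w t) ×
               (∀ x → x < length w → letterAt w x ≡ F → h + #U< w x ≡ #D< w x) ×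
               (h + #U< w (length w) ≡ #D< w (length w))

#U<-∷ : ∀ l w t → #U< (l ∷ w) (suc t) ≡ indicator (isU l) + #U< w t
#U<-∷ l w t = countN-suc t (λ y → isU (letterAt (l ∷ w) y))
#D<-∷ : ∀ l w t → #D< (l ∷ w) (suc t) ≡ indicator (isD l) + #D< w t
#D<-∷ l w t = countN-suc t (λ y → isD (letterAt (l ∷ w) y))

Balanced-U⁻ : ∀ h w → Balanced h (U ∷ w) → Balanced (suc h) w
Balanced-U⁻ h w (v₁ , v₂ , v₃) =
  (λ t t≤ → subst₂ _≤_ (#D<-∷ U w t) (trans (cong (h +_) (#U<-∷ U w t)) (+-suc h _)) (v₁ (suc t) (s≤s t≤))) ,
  (λ x x< e → trans (sym (trans (cong (h +_) (#U<-∷ U w x)) (+-suc h _))) (trans (v₂ (suc x) (s≤s x<) e) (#D<-∷ U w x))) ,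
  trans (sym (trans (cong (h +_) (#U<-∷ U w (length w))) (+-suc h _))) (trans v₃ (#D<-∷ U w (length w)))

Balanced-U⁺ : ∀ h w → Balanced (suc h) w → Balanced h (U ∷ w)
Balanced-U⁺ h w (v₁ , v₂ , v₃) = w₁ , w₂ , w₃
  where
  w₁ : ∀ t → t ≤ suc (length w) → #D< (U ∷ w) t ≤ h + #U< (U ∷ w) t
  w₁ zero _ = z≤n
  w₁ (suc t) (s≤s t≤) = subst₂ _≤_ (sym (#D<-∷ U w t)) (sym (trans (cong (h +_) (#U<-∷ U w t)) (+-suc h _))) (v₁ t t≤)
  w₂ : ∀ x → x < suc (length w) → letterAt (U ∷ w) x ≡ F → h + #U< (U ∷ w) x ≡ #D< (U ∷ w) x
  w₂ zero _ ()
  w₂ (suc x) (s≤s x<) e = trans (trans (cong (h +_) (#U<-∷ U w x)) (+-suc h _)) (trans (v₂ x x< e) (sym (#D<-∷ U w x)))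
  w₃ : h + #U< (U ∷ w) (suc (length w)) ≡ #D< (U ∷ w) (suc (length w))
  w₃ = trans (trans (cong (h +_) (#U<-∷ U w (length w))) (+-suc h _)) (trans v₃ (sym (#D<-∷ U w (length w))))

Balanced-D⁻ : ∀ h w → Balanced h (D ∷ w) → Σ ℕ λ h′ → h ≡ suc h′ × Balanced h′ w
Balanced-D⁻ zero w (v₁ , v₂ , v₃) = ⊥-elim (<-irrefl refl (v₁ 1 (s≤s z≤n)))
Balanced-D⁻ (suc h) w (v₁ , v₂ , v₃) = h , refl ,
  (λ t t≤ → ≤-pred (subst₂ _≤_ (#D<-∷ D w t) (cong (suc h +_) (#U<-∷ D w t)) (v₁ (suc t) (s≤s t≤)))) ,
  (λ x x< e → suc-injective (trans (sym (cong (suc h +_) (#U<-∷ D w x))) (trans (v₂ (suc x) (s≤s x<) e) (#D<-∷ D w x)))) ,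
  suc-injective (trans (sym (cong (suc h +_) (#U<-∷ D w (length w)))) (trans v₃ (#D<-∷ D w (length w))))

Balanced-D⁺ : ∀ h w → Balanced h w → Balanced (suc h) (D ∷ w)
Balanced-D⁺ h w (v₁ , v₂ , v₃) = w₁ , w₂ , w₃
  where
  w₁ : ∀ t → t ≤ suc (length w) → #D< (D ∷ w) t ≤ suc h + #U< (D ∷ w) t
  w₁ zero _ = z≤n
  w₁ (suc t) (s≤s t≤) = subst₂ _≤_ (sym (#D<-∷ D w t)) (sym (cong (suc h +_) (#U<-∷ D w t))) (s≤s (v₁ t t≤))
  w₂ : ∀ x → x < suc (length w) → letterAt (D ∷ w) x ≡ F → suc h + #U< (D ∷ w) x ≡ #D< (D ∷ w) x
  w₂ zero _ ()
  w₂ (suc x) (s≤s x<) e = trans (cong (suc h +_) (#U<-∷ D w x)) (trans (cong suc (v₂ x x< e)) (sym (#D<-∷ D w x)))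
  w₃ : suc h + #U< (D ∷ w) (suc (length w)) ≡ #D< (D ∷ w) (suc (length w))
  w₃ = trans (cong (suc h +_) (#U<-∷ D w (length w))) (trans (cong suc v₃) (sym (#D<-∷ D w (length w))))

Balanced-F⁻ : ∀ h w → Balanced h (F ∷ w) → h ≡ 0 × Balanced 0 w
Balanced-F⁻ h w (v₁ , v₂ , v₃) = h0 ,
  (λ t t≤ → subst₂ _≤_ (#D<-∷ F w t) (trans (cong (_+ #U< (F ∷ w) (suc t)) h0) (#U<-∷ F w t)) (v₁ (suc t) (s≤s t≤))) ,
  (λ x x< e → trans (sym (trans (cong (_+ #U< (F ∷ w) (suc x)) h0) (#U<-∷ F w x))) (trans (v₂ (suc x) (s≤s x<) e) (#D<-∷ F w x))) ,
  trans (sym (trans (cong (_+ #U< (F ∷ w) (suc (length w))) h0) (#U<-∷ F w (length w)))) (trans v₃ (#D<-∷ F w (length w)))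
  where
  h0 : h ≡ 0
  h0 = trans (sym (+-identityʳ h)) (v₂ 0 (s≤s z≤n) refl)

Balanced-F⁺ : ∀ w → Balanced 0 w → Balanced 0 (F ∷ w)
Balanced-F⁺ w (v₁ , v₂ , v₃) = w₁ , w₂ , w₃
  where
  w₁ : ∀ t → t ≤ suc (length w) → #D< (F ∷ w) t ≤ 0 + #U< (F ∷ w) t
  w₁ zero _ = z≤n
  w₁ (suc t) (s≤s t≤) = subst₂ _≤_ (sym (#D<-∷ F w t)) (sym (#U<-∷ F w t)) (v₁ t t≤)
  w₂ : ∀ x → x < suc (length w) → letterAt (F ∷ w) x ≡ F → 0 + #U< (F ∷ w) x ≡ #D< (F ∷ w) x
  w₂ zero _ _ = refl
  w₂ (suc x) (s≤s x<) e = trans (#U<-∷ F w x) (trans (v₂ x x< e) (sym (#D<-∷ F w x)))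
  w₃ : 0 + #U< (F ∷ w) (suc (length w)) ≡ #D< (F ∷ w) (suc (length w))
  w₃ = trans (#U<-∷ F w (length w)) (trans v₃ (sym (#D<-∷ F w (length w))))

valid⇒Balanced : ∀ h w → T (valid h w) → Balanced h w
valid⇒Balanced h [] t = (λ { zero _ → z≤n }) , (λ x ()) , trans (+-identityʳ h) (T≡⁻ {h} {0} t)
valid⇒Balanced h (U ∷ w) t = Balanced-U⁺ h w (valid⇒Balanced (suc h) w t)
valid⇒Balanced zero (D ∷ w) ()
valid⇒Balanced (suc h) (D ∷ w) t = Balanced-D⁺ h w (valid⇒Balanced h w t)
valid⇒Balanced zero (F ∷ w) t = Balanced-F⁺ w (valid⇒Balanced 0 w t)
valid⇒Balanced (suc h) (F ∷ w) ()

Balanced⇒valid : ∀ h w → Balanced h w → T (valid h w)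
Balanced⇒valid h [] (v₁ , v₂ , v₃) = T≡⁺ (trans (sym (+-identityʳ h)) v₃)
Balanced⇒valid h (U ∷ w) v = Balanced⇒valid (suc h) w (Balanced-U⁻ h w v)
Balanced⇒valid h (D ∷ w) v with Balanced-D⁻ h w v
... | h′ , refl , v′ = Balanced⇒valid h′ w v′
Balanced⇒valid h (F ∷ w) v with Balanced-F⁻ h w v
... | refl , v′ = Balanced⇒valid 0 w v′

-- Decoding a balanced word into a 321-avoiding involution

least : ℕ → (ℕ → Bool) → ℕ
least zero P = 0
least (suc n) P = if P 0 then 0 else suc (least n (λ y → P (suc y)))

least-unique : ∀ n (P : ℕ → Bool) y0 → y0 < n → T (P y0) → (∀ y → y < n → T (P y) → y ≡ y0) → least n P ≡ y0
least-unique (suc n) P y0 y0<n py0 u with P 0 in e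
... | true = u 0 (s≤s z≤n) (Tb e)
least-unique (suc n) P zero y0<n py0 u | false = ⊥-elim (subst T e py0)
least-unique (suc n) P (suc y0) (s≤s y0<n) py0 u | false =
  cong suc (least-unique n (λ y → P (suc y)) y0 y0<n py0 (λ y y<n py → suc-injective (u (suc y) (s≤s y<n) py)))

≡U⇒isU : ∀ {l} → l ≡ U → T (isU l)
≡U⇒isU refl = tt
≡D⇒isD : ∀ {l} → l ≡ D → T (isD l)
≡D⇒isD refl = tt

isU⇒≡U : ∀ {l} → T (isU l) → l ≡ U
isU⇒≡U {U} _ = refl
isD⇒≡D : ∀ {l} → T (isD l) → l ≡ D
isD⇒≡D {D} _ = refl

#F≡countN : ∀ w → #F w ≡ countN (length w) (λ y → isF (letterAt w y))
#F≡countN [] = refl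
#F≡countN (l ∷ w) = trans (by-letter l) (sym (countN-suc (length w) (λ y → isF (letterAt (l ∷ w) y))))
  where
  by-letter : ∀ l → #F (l ∷ w) ≡ indicator (isF l) + countN (length w) (λ y → isF (letterAt w y))
  by-letter F = cong suc (#F≡countN w)
  by-letter U = #F≡countN w
  by-letter D = #F≡countN w

module Decoding (w : List Letter) where
  N : ℕ
  N = length w

  isNthD isNthU : ℕ → ℕ → Bool
  isNthD r y = isD (letterAt w y) ∧ (#D< w y ≡ᵇ r)
  isNthU r y = isU (letterAt w y) ∧ (#U< w y ≡ᵇ r)

  nthD nthU : ℕ → ℕ
  nthD r = least N (isNthD r)
  nthU r = least N (isNthU r)

  decodeLetter : Letter → ℕ → ℕ
  decodeLetter F x = x
  decodeLetter U x = nthD (#U< w x)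
  decodeLetter D x = nthU (#D< w x)

  decode : ℕ → ℕ
  decode x = decodeLetter (letterAt w x) x

  decode-F≡ : ∀ x → letterAt w x ≡ F → decode x ≡ x
  decode-F≡ x e rewrite e = refl
  decode-U≡ : ∀ x → letterAt w x ≡ U → decode x ≡ nthD (#U< w x)
  decode-U≡ x e rewrite e = refl
  decode-D≡ : ∀ x → letterAt w x ≡ D → decode x ≡ nthU (#D< w x)
  decode-D≡ x e rewrite e = refl

module Decode (w : List Letter) (v : Balanced 0 w) where
  open Decoding w public
  D≤U : ∀ t → t ≤ N → #D< w t ≤ #U< w t
  D≤U = proj₁ v
  U≡D-at-F : ∀ x → x < N → letterAt w x ≡ F → #U< w x ≡ #D< w x
  U≡D-at-F = proj₁ (proj₂ v)
  U≡D-total : #U< w N ≡ #D< w N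
  U≡D-total = proj₂ (proj₂ v)

  #D<-injective : ∀ y y′ → T (isD (letterAt w y)) → T (isD (letterAt w y′)) → #D< w y ≡ #D< w y′ → y ≡ y′
  #D<-injective y y′ d d′ e with trichotomy y y′
  ... | inj₁ l = ⊥-elim (<-irrefl e (countN-< (λ z → isD (letterAt w z)) d l))
  ... | inj₂ (inj₁ q) = q
  ... | inj₂ (inj₂ l) = ⊥-elim (<-irrefl (sym e) (countN-< (λ z → isD (letterAt w z)) d′ l))
  #U<-injective : ∀ y y′ → T (isU (letterAt w y)) → T (isU (letterAt w y′)) → #U< w y ≡ #U< w y′ → y ≡ y′
  #U<-injective y y′ d d′ e with trichotomy y y′
  ... | inj₁ l = ⊥-elim (<-irrefl e (countN-< (λ z → isU (letterAt w z)) d l))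
  ... | inj₂ (inj₁ q) = q
  ... | inj₂ (inj₂ l) = ⊥-elim (<-irrefl (sym e) (countN-< (λ z → isU (letterAt w z)) d′ l))

  nthD-#D< : ∀ y → y < N → T (isD (letterAt w y)) → nthD (#D< w y) ≡ y
  nthD-#D< y y<N d = least-unique N (isNthD (#D< w y)) y y<N (T∧⁺ d (T≡⁺ {#D< w y} refl))
    (λ y′ _ p → let (d′ , e) = T∧⁻ {isD (letterAt w y′)} p in #D<-injective y′ y d′ d (T≡⁻ {#D< w y′} {#D< w y} e))
  nthU-#U< : ∀ y → y < N → T (isU (letterAt w y)) → nthU (#U< w y) ≡ y
  nthU-#U< y y<N d = least-unique N (isNthU (#U< w y)) y y<N (T∧⁺ d (T≡⁺ {#U< w y} refl))
    (λ y′ _ p → let (d′ , e) = T∧⁻ {isU (letterAt w y′)} p in #U<-injective y′ y d′ d (T≡⁻ {#U< w y′} {#U< w y} e))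

  #D<-step : ∀ x → T (isD (letterAt w x)) → #D< w (suc x) ≡ suc (#D< w x)
  #D<-step x d = trans (cong (λ b → #D< w x + indicator b) (bT d)) (+-comm _ 1)

  decode-U : ∀ x → x < N → letterAt w x ≡ U → Σ ℕ λ y → decode x ≡ y × y < N × letterAt w y ≡ D × #D< w y ≡ #U< w x × x < y
  decode-U x x<N e with countN-attains N (λ z → isD (letterAt w z)) (#U< w x)
                      (subst (#U< w x <_) U≡D-total (<-≤-trans (countN-< (λ z → isU (letterAt w z)) (≡U⇒isU e) x<N) ≤-refl))
  ... | y , y<N , D-at-y , #D<y≡ = y , trans (decode-U≡ x e) (trans (cong nthD (sym #D<y≡)) (nthD-#D< y y<N D-at-y)) , y<N , isD⇒≡D D-at-y , #D<y≡ , x<y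
    where
    x<y : x < y
    x<y with trichotomy x y
    ... | inj₁ l = l
    ... | inj₂ (inj₁ refl) = ⊥-elim (U≢D (trans (sym e) (isD⇒≡D D-at-y)))
      where U≢D : U ≢ D
            U≢D ()
    ... | inj₂ (inj₂ y<x) = ⊥-elim (<-irrefl refl (≤-trans (subst (_≤ #D< w x) (trans (#D<-step y D-at-y) (cong suc #D<y≡)) (countN-mono (λ z → isD (letterAt w z)) y<x))
                                                             (D≤U x (<⇒≤ x<N))))

  decode-D : ∀ x → x < N → letterAt w x ≡ D → Σ ℕ λ y → decode x ≡ y × y < N × letterAt w y ≡ U × #U< w y ≡ #D< w x × y < x
  decode-D x x<N e with countN-attains (suc x) (λ z → isU (letterAt w z)) (#D< w x)
                      (<-≤-trans (subst (#D< w x <_) (sym (#D<-step x (≡D⇒isD e))) ≤-refl) (D≤U (suc x) x<N))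
  ... | y , y<sx , U-at-y , #D<y≡ = y , trans (decode-D≡ x e) (trans (cong nthU (sym #D<y≡)) (nthU-#U< y (<-≤-trans y<sx x<N) U-at-y)) ,
                             <-≤-trans y<sx x<N , isU⇒≡U U-at-y , #D<y≡ , y<x
    where
    y<x : y < x
    y<x with m≤n⇒m<n∨m≡n (≤-pred y<sx)
    ... | inj₁ l = l
    ... | inj₂ refl = ⊥-elim (D≢U (trans (sym e) (isU⇒≡U U-at-y)))
      where D≢U : D ≢ U
            D≢U ()

  decode-< : ∀ x → x < N → decode x < N
  decode-< x x<N = by-letter (letterAt w x) refl
    where
    by-letter : ∀ l → letterAt w x ≡ l → decode x < N
    by-letter F e = subst (_< N) (sym (decode-F≡ x e)) x<N
    by-letter U e = let (y , d , y<N , _) = decode-U x x<N e in subst (_< N) (sym d) y<N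
    by-letter D e = let (y , d , y<N , _) = decode-D x x<N e in subst (_< N) (sym d) y<N

  decode-involutive : ∀ x → x < N → decode (decode x) ≡ x
  decode-involutive x x<N = by-letter (letterAt w x) refl
    where
    by-letter : ∀ l → letterAt w x ≡ l → decode (decode x) ≡ x
    by-letter F e = trans (cong decode (decode-F≡ x e)) (decode-F≡ x e)
    by-letter U e = let (y , d , y<N , ay , #D<y≡ , _) = decode-U x x<N e in
             trans (cong decode d) (trans (decode-D≡ y ay) (trans (cong nthU #D<y≡) (nthU-#U< x x<N (≡U⇒isU e))))
    by-letter D e = let (y , d , y<N , ay , #D<y≡ , _) = decode-D x x<N e in
             trans (cong decode d) (trans (decode-U≡ y ay) (trans (cong nthD #D<y≡) (nthD-#D< x x<N (≡D⇒isD e))))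

  decode-direction : ∀ x → x < N → (letterAt w x ≡ F → decode x ≡ x) × (letterAt w x ≡ U → x < decode x) × (letterAt w x ≡ D → decode x < x)
  decode-direction x x<N = decode-F≡ x ,
    (λ e → let (y , d , _ , _ , _ , x<y) = decode-U x x<N e in subst (x <_) (sym d) x<y) ,
    (λ e → let (y , d , _ , _ , _ , y<x) = decode-D x x<N e in subst (_< x) (sym d) y<x)

  decode-monotone-nonD : ∀ x y → x < y → y < N → letterAt w x ≢ D → letterAt w y ≢ D → decode x < decode y
  decode-monotone-nonD x y x<y y<N nx ny = by-letter (letterAt w x) (letterAt w y) refl refl
    where
    x<N = <-trans x<y y<N
    by-letter : ∀ l m → letterAt w x ≡ l → letterAt w y ≡ m → decode x < decode y
    by-letter D _ e _ = ⊥-elim (nx e)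
    by-letter _ D _ e = ⊥-elim (ny e)
    by-letter F F e e′ = subst₂ _<_ (sym (decode-F≡ x e)) (sym (decode-F≡ y e′)) x<y
    by-letter F U e e′ = subst (_< decode y) (sym (decode-F≡ x e)) (<-trans x<y (proj₁ (proj₂ (decode-direction y y<N)) e′))
    by-letter U F e e′ = let (z , d , z<N , az , cz , _) = decode-U x x<N e in
       subst₂ _<_ (sym d) (sym (decode-F≡ y e′))
         (countN-reflects-< (λ u → isD (letterAt w u)) z y (subst₂ _<_ (sym cz) (U≡D-at-F y y<N e′) (countN-< (λ u → isU (letterAt w u)) (≡U⇒isU e) x<y)))
    by-letter U U e e′ = let (z1 , d1 , _ , _ , c1 , _) = decode-U x x<N e in
                     let (z2 , d2 , _ , _ , c2 , _) = decode-U y y<N e′ in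
       subst₂ _<_ (sym d1) (sym d2)
         (countN-reflects-< (λ u → isD (letterAt w u)) z1 z2 (subst₂ _<_ (sym c1) (sym c2) (countN-< (λ u → isU (letterAt w u)) (≡U⇒isU e) x<y)))

  decode-monotone-D : ∀ x y → x < y → y < N → letterAt w x ≡ D → letterAt w y ≡ D → decode x < decode y
  decode-monotone-D x y x<y y<N e e′ =
    let (z1 , d1 , _ , _ , c1 , _) = decode-D x (<-trans x<y y<N) e in
    let (z2 , d2 , _ , _ , c2 , _) = decode-D y y<N e′ in
    subst₂ _<_ (sym d1) (sym d2)
      (countN-reflects-< (λ u → isU (letterAt w u)) z1 z2 (subst₂ _<_ (sym c1) (sym c2) (countN-< (λ u → isD (letterAt w u)) (≡D⇒isD e) x<y)))

  decode-monotone : ∀ x y → x < y → y < N → (letterAt w x ≡ D × letterAt w y ≡ D) ⊎ (letterAt w x ≢ D × letterAt w y ≢ D) → decode x < decode y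
  decode-monotone x y x<y y<N (inj₁ (a , b)) = decode-monotone-D x y x<y y<N a b
  decode-monotone x y x<y y<N (inj₂ (a , b)) = decode-monotone-nonD x y x<y y<N a b

  D? : ∀ x → (letterAt w x ≡ D) ⊎ (letterAt w x ≢ D)
  D? x with letterAt w x
  ... | D = inj₁ refl
  ... | F = inj₂ (λ ())
  ... | U = inj₂ (λ ())

  -- decode increases along the D positions and along the other positions, and among three
  -- positions two are of the same kind.
  decode-avoids321 : ¬ Contains321 N decode
  decode-avoids321 (a , b , c , c<N , a<b , b<c , vb<va , vc<vb) with D? a | D? b | D? c
  ... | inj₁ da | inj₁ db | _ = <-asym vb<va (decode-monotone a b a<b (<-trans b<c c<N) (inj₁ (da , db)))
  ... | inj₂ da | inj₂ db | _ = <-asym vb<va (decode-monotone a b a<b (<-trans b<c c<N) (inj₂ (da , db)))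
  ... | _ | inj₁ db | inj₁ dc = <-asym vc<vb (decode-monotone b c b<c c<N (inj₁ (db , dc)))
  ... | _ | inj₂ db | inj₂ dc = <-asym vc<vb (decode-monotone b c b<c c<N (inj₂ (db , dc)))
  ... | inj₁ da | inj₂ db | inj₁ dc = <-asym (<-trans vc<vb vb<va) (decode-monotone a c (<-trans a<b b<c) c<N (inj₁ (da , dc)))
  ... | inj₂ da | inj₁ db | inj₂ dc = <-asym (<-trans vc<vb vb<va) (decode-monotone a c (<-trans a<b b<c) c<N (inj₂ (da , dc)))

  decode-fp : countN N (λ x → decode x ≡ᵇ x) ≡ #F w
  decode-fp = trans (countN-cong N _ _ fixed⇔F) (sym (#F≡countN w))
    where
    fixed⇔F : ∀ x → x < N → (decode x ≡ᵇ x) ≡ isF (letterAt w x)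
    fixed⇔F x x<N = by-letter (letterAt w x) refl
      where
      by-letter : ∀ l → letterAt w x ≡ l → (decode x ≡ᵇ x) ≡ isF (letterAt w x)
      by-letter F q = trans (cong (_≡ᵇ x) (decode-F≡ x q)) (trans (≡ᵇ-refl x) (sym (cong isF q)))
      by-letter U q = trans (≢⇒≡ᵇ-false (λ e → <-irrefl (sym e) (proj₁ (proj₂ (decode-direction x x<N)) q))) (sym (cong isF q))
      by-letter D q = trans (≢⇒≡ᵇ-false (λ e → <-irrefl e (proj₂ (proj₂ (decode-direction x x<N)) q))) (sym (cong isF q))

-- Encoding a 321-avoiding involution as a balanced word

letter : ℕ → ℕ → Letter
letter x y = if y ≡ᵇ x then F else (if x <ᵇ y then U else D)

letter-F : ∀ x → letter x x ≡ F
letter-F x rewrite ≡ᵇ-refl x = refl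

letter-U : ∀ x y → x < y → letter x y ≡ U
letter-U x y x<y rewrite ≢⇒≡ᵇ-false (≢-sym (<⇒≢ x<y)) | <⇒<ᵇ-true x<y = refl

letter-D : ∀ x y → y < x → letter x y ≡ D
letter-D x y y<x rewrite ≢⇒≡ᵇ-false (<⇒≢ y<x) | ≥⇒<ᵇ-false (<⇒≤ y<x) = refl

letter⁻ : ∀ x y → (letter x y ≡ F → y ≡ x) × (letter x y ≡ U → x < y) × (letter x y ≡ D → y < x)
letter⁻ x y with trichotomy x y
... | inj₁ x<y rewrite letter-U x y x<y = (λ ()) , (λ _ → x<y) , (λ ())
... | inj₂ (inj₁ refl) rewrite letter-F x = (λ _ → refl) , (λ ()) , (λ ())
... | inj₂ (inj₂ y<x) rewrite letter-D x y y<x = (λ ()) , (λ ()) , (λ _ → y<x)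

isF-letter : ∀ x y → isF (letter x y) ≡ (y ≡ᵇ x)
isF-letter x y with trichotomy x y
... | inj₁ x<y rewrite letter-U x y x<y | ≢⇒≡ᵇ-false (≢-sym (<⇒≢ x<y)) = refl
... | inj₂ (inj₁ refl) rewrite letter-F x | ≡ᵇ-refl x = refl
... | inj₂ (inj₂ y<x) rewrite letter-D x y y<x | ≢⇒≡ᵇ-false (<⇒≢ y<x) = refl

isU-letter : ∀ x y → isU (letter x y) ≡ (x <ᵇ y)
isU-letter x y with trichotomy x y
... | inj₁ x<y rewrite letter-U x y x<y | <⇒<ᵇ-true x<y = refl
... | inj₂ (inj₁ refl) rewrite letter-F x | ≥⇒<ᵇ-false (≤-refl {x}) = refl
... | inj₂ (inj₂ y<x) rewrite letter-D x y y<x | ≥⇒<ᵇ-false (<⇒≤ y<x) = refl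

isD-letter : ∀ x y → isD (letter x y) ≡ (y <ᵇ x)
isD-letter x y with trichotomy x y
... | inj₁ x<y rewrite letter-U x y x<y | ≥⇒<ᵇ-false (<⇒≤ x<y) = refl
... | inj₂ (inj₁ refl) rewrite letter-F x | ≥⇒<ᵇ-false (≤-refl {x}) = refl
... | inj₂ (inj₂ y<x) rewrite letter-D x y y<x | <⇒<ᵇ-true y<x = refl

letterAt-applyUpTo : ∀ (h : ℕ → Letter) n x → x < n → letterAt (applyUpTo h n) x ≡ h x
letterAt-applyUpTo h (suc n) zero _ = refl
letterAt-applyUpTo h (suc n) (suc x) (s≤s x<n) = letterAt-applyUpTo (h ∘ suc) n x x<n

letterAt-ext : ∀ (u w : List Letter) → length u ≡ length w → (∀ x → x < length u → letterAt u x ≡ letterAt w x) → u ≡ w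
letterAt-ext [] [] e h = refl
letterAt-ext (a ∷ u) (b ∷ w) e h = cong₂ _∷_ (h 0 (s≤s z≤n)) (letterAt-ext u w (suc-injective e) (λ x x< → h (suc x) (s≤s x<)))

wordOf : ℕ → (ℕ → ℕ) → List Letter
wordOf n f = applyUpTo (λ x → letter x (f x)) n

length-wordOf : ∀ n f → length (wordOf n f) ≡ n
length-wordOf n f = length-applyUpTo _ n

module Encode {N : ℕ} (σ : Fn N) (inv : Involutive N ⟦ σ ⟧) (avoid : ¬ Contains321 N ⟦ σ ⟧) where
  private
    f : ℕ → ℕ
    f = ⟦ σ ⟧
    maps : MapsBelow N f
    maps = ⟦⟧-< σ
  open Involution N f maps inv
  open Avoiding321 σ inv avoid using (weakExc-monotone)
  w : List Letter
  w = wordOf N f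

  letterAt-w : ∀ x → x < N → letterAt w x ≡ letter x (f x)
  letterAt-w x x<N = letterAt-applyUpTo _ N x x<N

  #U<-w : ∀ t → t ≤ N → #U< w t ≡ countN t (isExc f)
  #U<-w t t≤N = countN-cong t _ _ (λ y y<t → trans (cong isU (letterAt-w y (<-≤-trans y<t t≤N))) (isU-letter y (f y)))

  #D<-w : ∀ t → t ≤ N → #D< w t ≡ countN t (isDef f)
  #D<-w t t≤N = countN-cong t _ _ (λ y y<t → trans (cong isD (letterAt-w y (<-≤-trans y<t t≤N))) (isD-letter y (f y)))

  #F-w : #F w ≡ fp σ
  #F-w = trans (#F≡countN w)
         (trans (cong (λ z → countN z (λ y → isF (letterAt w y))) (length-wordOf N f))
         (trans (countN-cong N _ _ (λ y y<N → trans (cong isF (letterAt-w y y<N)) (isF-letter y (f y)))) (sym (fp≡countN σ))))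

  def-monotone : ∀ x y → x < y → y < N → f x < x → f y < y → f x < f y
  def-monotone x y x<y y<N fx<x fy<y with trichotomy (f x) (f y)
  ... | inj₁ l = l
  ... | inj₂ (inj₁ e) = ⊥-elim (<-irrefl (injective x y (<-trans x<y y<N) y<N e) x<y)
  ... | inj₂ (inj₂ l) = ⊥-elim (avoid (f x , x , y , y<N , fx<x , x<y , subst (f x <_) (sym (inv x (<-trans x<y y<N))) fx<x , l))

  exc-before-fix : ∀ z y → z < N → f z ≡ z → y < z → y < f y → f y < z
  exc-before-fix z y z<N fz≡z y<z y<fy with trichotomy (f y) z
  ... | inj₁ l = l
  ... | inj₂ (inj₁ e) = ⊥-elim (<-irrefl (injective y z (<-trans y<z z<N) z<N (trans e (sym fz≡z))) y<z)
  ... | inj₂ (inj₂ z<fy) = ⊥-elim (avoid (y , z , f y , maps y (<-trans y<z z<N) , y<z , z<fy , subst (_< f y) (sym fz≡z) z<fy ,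
                                    subst (_< f z) (sym (inv y (<-trans y<z z<N))) (subst (y <_) (sym fz≡z) y<z)))

  ≮⇒isWeakExc : ∀ x → ¬ (f x < x) → T (isWeakExc f x)
  ≮⇒isWeakExc x h = Tnot⁺ (λ t → h (T<⁻ {f x} {x} t))

  -- Every deficiency closes an earlier excedance, and no 2-cycle spans a fixed point.
  w-balanced : Balanced 0 w
  w-balanced =
    (λ t t≤ → let t≤N = subst (t ≤_) (length-wordOf N f) t≤ in
              subst₂ _≤_ (sym (#D<-w t t≤N)) (sym (#U<-w t t≤N)) (#def≤#exc t t≤N)) ,
    (λ x x< e → let x<N = subst (x <_) (length-wordOf N f) x< in
                let fx≡x = proj₁ (letter⁻ x (f x)) (trans (sym (letterAt-w x x<N)) e) in
                trans (#U<-w x (<⇒≤ x<N)) (trans (#exc≡#def-before-fix x x<N fx≡x) (sym (#D<-w x (<⇒≤ x<N))))) ,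
    subst (λ z → 0 + #U< w z ≡ #D< w z) (sym (length-wordOf N f))
          (trans (#U<-w N ≤-refl) (trans #exc≡#def (sym (#D<-w N ≤-refl))))
    where
    #def≤#exc : ∀ t → t ≤ N → countN t (isDef f) ≤ countN t (isExc f)
    #def≤#exc t t≤N = countN-injection t t (isDef f) (isExc f) f
      (λ y y<t d → <-trans (T<⁻ {f y} {y} d) y<t , T<⁺ (subst (f y <_) (sym (inv y (<-≤-trans y<t t≤N))) (T<⁻ {f y} {y} d)))
      (λ a b a<t b<t _ _ e → injective a b (<-≤-trans a<t t≤N) (<-≤-trans b<t t≤N) e)
    #exc≡#def-before-fix : ∀ x → x < N → f x ≡ x → countN x (isExc f) ≡ countN x (isDef f)
    #exc≡#def-before-fix x x<N fx≡x = countN-bijection x x (isExc f) (isDef f) f f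
      (λ y y<x u → exc-before-fix x y x<N fx≡x y<x (T<⁻ {y} {f y} u) , T<⁺ (subst (_< f y) (sym (inv y (<-trans y<x x<N))) (T<⁻ {y} {f y} u)))
      (λ y y<x d → <-trans (T<⁻ {f y} {y} d) y<x , T<⁺ (subst (f y <_) (sym (inv y (<-trans y<x x<N))) (T<⁻ {f y} {y} d)))
      (λ y y<x _ → inv y (<-trans y<x x<N)) (λ y y<x _ → inv y (<-trans y<x x<N))

  open Decode w w-balanced using (decode; decode-U; decode-D; decode-F≡; #D<-injective; #U<-injective)

  -- Both the k-th U and the partner of the k-th excedance are the k-th D, since excedances
  -- and deficiencies both appear in increasing order of their partners.
  decode-w : ∀ x → x < N → decode x ≡ f x
  decode-w x x<N with trichotomy x (f x)
  ... | inj₂ (inj₁ e) = trans (decode-F≡ x (trans (letterAt-w x x<N) (subst (λ z → letter x z ≡ F) e (letter-F x)))) e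
  ... | inj₁ x<fx = let (y , d , y<N , ay , cy , _) = decode-U x (subst (x <_) (sym (length-wordOf N f)) x<N) (trans (letterAt-w x x<N) (letter-U x (f x) x<fx)) in
      trans d (#D<-injective y (f x) (≡D⇒isD ay) D-at-fx (trans cy (trans (#U<-w x (<⇒≤ x<N)) (trans same-rank (sym (#D<-w (f x) (<⇒≤ fx<N)))))))
    where
    fx<N = maps x x<N
    D-at-fx : T (isD (letterAt w (f x)))
    D-at-fx = ≡D⇒isD (trans (letterAt-w (f x) fx<N) (letter-D (f x) (f (f x)) (subst (_< f x) (sym (inv x x<N)) x<fx)))
    same-rank : countN x (isExc f) ≡ countN (f x) (isDef f)
    same-rank = countN-bijection x (f x) (isExc f) (isDef f) f f
      (λ z z<x u → weakExc-monotone z x z<x x<N (≮⇒isWeakExc z (λ l → <-asym l (T<⁻ {z} {f z} u))) (≮⇒isWeakExc x (λ l → <-asym l x<fx)) ,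
                   T<⁺ (subst (_< f z) (sym (inv z (<-trans z<x x<N))) (T<⁻ {z} {f z} u)))
      (λ z z<fx d → subst (f z <_) (inv x x<N) (def-monotone z (f x) z<fx fx<N (T<⁻ {f z} {z} d) (subst (_< f x) (sym (inv x x<N)) x<fx)) ,
                    T<⁺ (subst (f z <_) (sym (inv z (<-trans z<fx fx<N))) (T<⁻ {f z} {z} d)))
      (λ z z<x _ → inv z (<-trans z<x x<N)) (λ z z<fx _ → inv z (<-trans z<fx fx<N))
  ... | inj₂ (inj₂ fx<x) = let (y , d , y<N , ay , cy , _) = decode-D x (subst (x <_) (sym (length-wordOf N f)) x<N) (trans (letterAt-w x x<N) (letter-D x (f x) fx<x)) in
      trans d (#U<-injective y (f x) (≡U⇒isU ay) U-at-fx (trans cy (trans (#D<-w x (<⇒≤ x<N)) (trans (sym same-rank) (sym (#U<-w (f x) (<⇒≤ fx<N)))))))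
    where
    fx<N = maps x x<N
    U-at-fx : T (isU (letterAt w (f x)))
    U-at-fx = ≡U⇒isU (trans (letterAt-w (f x) fx<N) (letter-U (f x) (f (f x)) (subst (f x <_) (sym (inv x x<N)) fx<x)))
    same-rank : countN (f x) (isExc f) ≡ countN x (isDef f)
    same-rank = countN-bijection (f x) x (isExc f) (isDef f) f f
      (λ z z<fx u → subst (f z <_) (inv x x<N) (weakExc-monotone z (f x) z<fx fx<N (≮⇒isWeakExc z (λ l → <-asym l (T<⁻ {z} {f z} u)))
                        (≮⇒isWeakExc (f x) (λ l → <-asym l (subst (f x <_) (sym (inv x x<N)) fx<x)))) ,
                    T<⁺ (subst (_< f z) (sym (inv z (<-trans z<fx fx<N))) (T<⁻ {z} {f z} u)))
      (λ z z<x d → def-monotone z x z<x x<N (T<⁻ {f z} {z} d) fx<x ,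
                   T<⁺ (subst (f z <_) (sym (inv z (<-trans z<x x<N))) (T<⁻ {f z} {z} d)))
      (λ z z<fx _ → inv z (<-trans z<fx fx<N)) (λ z z<x _ → inv z (<-trans z<x x<N))

inv321 : ∀ {n} → (ℕ → Bool) → Fn n → Bool
inv321 P σ = isInvolution σ ∧ not (contains321 σ) ∧ P (fp σ)

validWith-encode : ∀ N P (σ : Fn N) → T (inv321 P σ) →
  T (validWith P (wordOf N ⟦ σ ⟧)) × vecOf N (Decoding.decode (wordOf N ⟦ σ ⟧)) ≡ σ
validWith-encode N P σ t =
  T∧⁺ (Balanced⇒valid 0 w w-balanced) (subst (T ∘ P) (sym #F-w) fp-P) , ⟦⟧-injective _ _ decode-encode
  where
  t₁ = T∧⁻ {isInvolution σ} t
  t₂ = T∧⁻ {not (contains321 σ)} (proj₂ t₁)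
  fp-P = proj₂ t₂
  open Encode σ (isInvolution⇒Involutive σ (proj₁ t₁)) (λ c → Tnot⁻ (proj₁ t₂) (Contains321⇒contains321 σ c))
  decode-encode : ∀ x → x < N → ⟦ vecOf N (Decoding.decode w) ⟧ x ≡ ⟦ σ ⟧ x
  decode-encode x x<N =
    trans (⟦vecOf⟧ N (Decoding.decode w) x x<N
            (subst (Decoding.decode w x <_) (length-wordOf N ⟦ σ ⟧) (Decode.decode-< w w-balanced x (subst (x <_) (sym (length-wordOf N ⟦ σ ⟧)) x<N))))
          (decode-w x x<N)

inv321-decode : ∀ N P w → length w ≡ N → T (validWith P w) →
  T (inv321 P (vecOf N (Decoding.decode w))) × wordOf N ⟦ vecOf N (Decoding.decode w) ⟧ ≡ w
inv321-decode N P w refl t =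
  T∧⁺ (Involutive⇒isInvolution σ σ-inv)
      (T∧⁺ (Tnot⁺ (λ c → decode-avoids321 (Contains321-cong N ⟦ σ ⟧ decode ⟦σ⟧≡decode (contains321⇒Contains321 σ c))))
           (subst (T ∘ P) (sym fp≡#F) (proj₂ (T∧⁻ {valid 0 w} t)))) ,
  letterAt-ext _ _ (length-wordOf N ⟦ σ ⟧) (λ x x< → let x<N = subst (x <_) (length-wordOf N ⟦ σ ⟧) x< in
    trans (letterAt-applyUpTo _ N x x<N) (trans (cong (letter x) (⟦σ⟧≡decode x x<N)) (letter-decode x x<N)))
  where
  open Decode w (valid⇒Balanced 0 w (proj₁ (T∧⁻ {valid 0 w} t))) hiding (N)
  σ : Fn N
  σ = vecOf N decode
  ⟦σ⟧≡decode : ∀ x → x < N → ⟦ σ ⟧ x ≡ decode x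
  ⟦σ⟧≡decode x x<N = ⟦vecOf⟧ N decode x x<N (decode-< x x<N)
  σ-inv : Involutive N ⟦ σ ⟧
  σ-inv x x<N = trans (cong ⟦ σ ⟧ (⟦σ⟧≡decode x x<N)) (trans (⟦σ⟧≡decode (decode x) (decode-< x x<N)) (decode-involutive x x<N))
  fp≡#F : fp σ ≡ #F w
  fp≡#F = trans (fp≡countN σ) (trans (countN-cong N _ _ (λ x x<N → cong (_≡ᵇ x) (⟦σ⟧≡decode x x<N))) decode-fp)
  letter-decode : ∀ x → x < N → letter x (decode x) ≡ letterAt w x
  letter-decode x x<N = by-letter (letterAt w x) refl
    where
    by-letter : ∀ l → letterAt w x ≡ l → letter x (decode x) ≡ letterAt w x
    by-letter F e = trans (subst (λ z → letter x z ≡ F) (sym (proj₁ (decode-direction x x<N) e)) (letter-F x)) (sym e)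
    by-letter U e = trans (letter-U x (decode x) (proj₁ (proj₂ (decode-direction x x<N)) e)) (sym e)
    by-letter D e = trans (letter-D x (decode x) (proj₂ (proj₂ (decode-direction x x<N)) e)) (sym e)

#inv321≡wordCount : ∀ N P → countB (inv321 P) (allVecs N N) ≡ wordCount N P
#inv321≡wordCount N P =
  countB-bijection (allVecs N N) (allWords N) (inv321 P) (validWith P)
    (λ σ → wordOf N ⟦ σ ⟧) (λ w → vecOf N (Decoding.decode w)) (allVecs-unique N N) (allWords-unique N)
    (λ σ _ t → let (valid , back) = validWith-encode N P σ t in
               allWords-complete N _ (length-wordOf N ⟦ σ ⟧) , valid , back)
    (λ w w∈ t → let (inv , back) = inv321-decode N P w (allWords-length N w w∈) t in
                allVecs-complete N N _ , inv , back)

Contains132-lift : ∀ m N (κ σ φ ψ : ℕ → ℕ) →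
  (∀ x y → x < y → φ x < φ y) → (∀ u v → u < v → ψ u < ψ v) → (∀ x → x < m → φ x < N) →
  (∀ x → x < m → σ (φ x) ≡ ψ (κ x)) → Contains132 m κ → Contains132 N σ
Contains132-lift m N κ σ φ ψ φm ψm φb e (a , b , c , c<m , a<b , b<c , v₁ , v₂) =
  φ a , φ b , φ c , φb c c<m , φm a b a<b , φm b c b<c ,
  subst₂ _<_ (sym (e a a<m)) (sym (e c c<m)) (ψm _ _ v₁) , subst₂ _<_ (sym (e c c<m)) (sym (e b b<m)) (ψm _ _ v₂)
  where b<m = <-trans b<c c<m
        a<m = <-trans a<b b<m

-- The inverse of gluing: the outer blocks of f shifted to [0, 2q), the middle block shifted to [0, R).
outerOf innerOf : ℕ → ℕ → (ℕ → ℕ) → ℕ → ℕ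
outerOf q R f x = if x <ᵇ q then f x ∸ suc R else f (x + suc R)
innerOf q R f x = f (x + suc q) ∸ suc q

-- On [0, M′] with M′ = 2q + R + 1: κ, an involution of [0, 2q), occupies the outer blocks
-- [0, q) and (q + R, M′) shifted by R + 1, τ occupies the middle block (q, q + R], and q ↔ M′.
module Glue (q R : ℕ) (κ τ : ℕ → ℕ) where
  M′ : ℕ
  M′ = suc q + R + q

  glue : ℕ → ℕ
  glue x = if x <ᵇ q then κ x + suc R
         else if x ≡ᵇ q then M′
         else if x <ᵇ suc q + R then τ (x ∸ suc q) + suc q
         else if x <ᵇ M′ then κ (x ∸ suc R)
         else q

  glue-L : ∀ x → x < q → glue x ≡ κ x + suc R
  glue-L x lt rewrite <⇒<ᵇ-true lt = refl

  glue-q : glue q ≡ M′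
  glue-q rewrite ≥⇒<ᵇ-false {q} {q} ≤-refl | ≡ᵇ-refl q = refl

  glue-M : ∀ x → q < x → x < suc q + R → glue x ≡ τ (x ∸ suc q) + suc q
  glue-M x l₁ l₂ rewrite ≥⇒<ᵇ-false {x} {q} (<⇒≤ l₁) | ≢⇒≡ᵇ-false {x} {q} (λ e → <-irrefl (sym e) l₁) | <⇒<ᵇ-true l₂ = refl

  glue-R : ∀ x → suc q + R ≤ x → x < M′ → glue x ≡ κ (x ∸ suc R)
  glue-R x l₁ l₂ rewrite ≥⇒<ᵇ-false {x} {q} (≤-trans (m≤m+n q _) (≤-trans (n≤1+n _) l₁)) |
                       ≢⇒≡ᵇ-false {x} {q} (λ e → <-irrefl refl (≤-trans (s≤s (m≤m+n q R)) (subst (suc q + R ≤_) e l₁))) |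
                       ≥⇒<ᵇ-false {x} {suc q + R} l₁ | <⇒<ᵇ-true l₂ = refl

  glue-T : glue M′ ≡ q
  glue-T rewrite ≥⇒<ᵇ-false {M′} {q} (≤-trans (m≤m+n q _) (≤-trans (n≤1+n _) (m≤m+n (suc q + R) q))) |
               ≢⇒≡ᵇ-false {M′} {q} (λ e → <-irrefl refl (≤-trans (s≤s (m≤m+n q R)) (subst (suc q + R ≤_) e (m≤m+n (suc q + R) q)))) |
               ≥⇒<ᵇ-false {M′} {suc q + R} (m≤m+n (suc q + R) q) | ≥⇒<ᵇ-false {M′} {M′} ≤-refl = refl

  data Region (x : ℕ) : Set where
    rL : x < q → Region x
    rq : x ≡ q → Region x
    rM : q < x → x < suc q + R → Region x
    rR : suc q + R ≤ x → x < M′ → Region x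
    rT : x ≡ M′ → Region x

  region : ∀ x → x < suc M′ → Region x
  region x x<N with trichotomy x q
  ... | inj₁ l = rL l
  ... | inj₂ (inj₁ e) = rq e
  ... | inj₂ (inj₂ l) with x <? suc q + R
  ...   | yes l₂ = rM l l₂
  ...   | no ≮₂ with m≤n⇒m<n∨m≡n (≤-pred x<N)
  ...     | inj₁ l₃ = rR (≮⇒≥ ≮₂) l₃
  ...     | inj₂ e = rT e

≤⇒≡+ : ∀ k x → k ≤ x → Σ ℕ λ y → x ≡ y + k
≤⇒≡+ k x le = x ∸ k , sym (m∸n+n≡m le)

size-split : ∀ q R → suc q + R + q ≡ q + q + suc R
size-split = solve-∀
size-LM : ∀ q R → suc q + R ≡ q + suc R
size-LM = solve-∀
size-LM′ : ∀ q R → suc q + R ≡ R + suc q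
size-LM′ = solve-∀

R-position : ∀ q R y → q ≤ y → y < q + q → suc q + R ≤ y + suc R × y + suc R < suc q + R + q
R-position q R y l₁ l₂ = subst (_≤ y + suc R) (sym (size-LM q R)) (+-monoˡ-≤ (suc R) l₁) , subst (y + suc R <_) (sym (size-split q R)) (+-monoˡ-< (suc R) l₂)

M-position : ∀ q R y → y < R → q < y + suc q × y + suc q < suc q + R
M-position q R y l = m≤n+m (suc q) y , subst (y + suc q <_) (sym (size-LM′ q R)) (+-monoˡ-< (suc q) l)

M-position< : ∀ q R y → y < R → y + suc q < suc (suc q + R + q)
M-position< q R y l = <-trans (<-≤-trans (proj₂ (M-position q R y l)) (m≤m+n (suc q + R) q)) ≤-refl

size-split′ : ∀ q R → suc (suc q + R + q) ≡ suc q + (R + suc q)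
size-split′ = solve-∀

module Glued (q R : ℕ) (κ τ : ℕ → ℕ)
  (κ-lowHalf : ∀ x → x < q → q ≤ κ x × κ x < q + q)
  (κ-highHalf : ∀ x → q ≤ x → x < q + q → κ x < q)
  (κ-involutive : ∀ x → x < q + q → κ (κ x) ≡ x)
  (κ-avoids : ¬ Contains132 (q + q) κ)
  (τ-maps : ∀ x → x < R → τ x < R)
  (τ-involutive : ∀ x → x < R → τ (τ x) ≡ x)
  (τ-avoids : ¬ Contains132 R τ) where
  open Glue q R κ τ

  glue-R′ : ∀ y → q ≤ y → y < q + q → glue (y + suc R) ≡ κ y
  glue-R′ y l₁ l₂ = trans (glue-R (y + suc R) (subst (_≤ y + suc R) (sym (size-LM q R)) (+-monoˡ-≤ (suc R) l₁))
                          (subst (y + suc R <_) (sym (size-split q R)) (+-monoˡ-< (suc R) l₂)))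
                       (cong κ (m+n∸n≡m y (suc R)))
  glue-M′ : ∀ y → y < R → glue (y + suc q) ≡ τ y + suc q
  glue-M′ y l = trans (glue-M (y + suc q) (m≤n+m (suc q) y) (subst (y + suc q <_) (sym (size-LM′ q R)) (+-monoˡ-< (suc q) l)))
                   (cong (λ z → τ z + suc q) (m+n∸n≡m y (suc q)))

  glue-L-range : ∀ x → x < q → suc q + R ≤ glue x × glue x < M′
  glue-L-range x l = subst₂ _≤_ (sym (size-LM q R)) (sym (glue-L x l)) (+-monoˡ-≤ (suc R) (proj₁ (κ-lowHalf x l))) ,
           subst₂ _<_ (sym (glue-L x l)) (sym (size-split q R)) (+-monoˡ-< (suc R) (proj₂ (κ-lowHalf x l)))

  R-offset : ∀ x → suc q + R ≤ x → x < M′ → Σ ℕ λ y → x ≡ y + suc R × q ≤ y × y < q + q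
  R-offset x l₁ l₂ with ≤⇒≡+ (suc R) x (≤-trans (s≤s (m≤n+m R q)) l₁)
  ... | y , refl = y , refl , +-cancelʳ-≤ (suc R) q y (subst (_≤ y + suc R) (size-LM q R) l₁) ,
                   +-cancelʳ-< (suc R) y (q + q) (subst (y + suc R <_) (size-split q R) l₂)

  M-offset : ∀ x → q < x → x < suc q + R → Σ ℕ λ y → x ≡ y + suc q × y < R
  M-offset x l₁ l₂ with ≤⇒≡+ (suc q) x l₁
  ... | y , refl = y , refl , +-cancelʳ-< (suc q) y R (subst (y + suc q <_) (size-LM′ q R) l₂)

  glue-M-range : ∀ x → q < x → x < suc q + R → q < glue x × glue x < suc q + R
  glue-M-range x l₁ l₂ with M-offset x l₁ l₂
  ... | y , refl , yR = subst (q <_) (sym (glue-M′ y yR)) (m≤n+m (suc q) (τ y)) ,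
                        subst₂ _<_ (sym (glue-M′ y yR)) (sym (size-LM′ q R)) (+-monoˡ-< (suc q) (τ-maps y yR))

  glue-R-range : ∀ x → suc q + R ≤ x → x < M′ → glue x < q
  glue-R-range x l₁ l₂ with R-offset x l₁ l₂
  ... | y , refl , a , b = subst (_< q) (sym (glue-R′ y a b)) (κ-highHalf y a b)

  glue-< : ∀ x → x < suc M′ → glue x < suc M′
  glue-< x x<N with region x x<N
  ... | rL l = <-trans (proj₂ (glue-L-range x l)) ≤-refl
  ... | rq refl = subst (_< suc M′) (sym glue-q) ≤-refl
  ... | rM l₁ l₂ = <-trans (proj₂ (glue-M-range x l₁ l₂)) (s≤s (≤-trans (m≤m+n (suc q + R) q) ≤-refl))
  ... | rR l₁ l₂ = <-trans (glue-R-range x l₁ l₂) (s≤s (≤-trans (m≤m+n q R) (≤-trans (n≤1+n _) (m≤m+n (suc q + R) q))))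
  ... | rT refl = subst (_< suc M′) (sym glue-T) (s≤s (≤-trans (m≤m+n q R) (≤-trans (n≤1+n _) (m≤m+n (suc q + R) q))))

  glue-involutive : ∀ x → x < suc M′ → glue (glue x) ≡ x
  glue-involutive x x<N with region x x<N
  ... | rL l = trans (cong glue (glue-L x l)) (trans (glue-R′ (κ x) (proj₁ (κ-lowHalf x l)) (proj₂ (κ-lowHalf x l))) (κ-involutive x (<-≤-trans l (m≤m+n q q))))
  ... | rq refl = trans (cong glue glue-q) glue-T
  ... | rM l₁ l₂ with M-offset x l₁ l₂
  ...   | y , refl , yR = trans (cong glue (glue-M′ y yR)) (trans (glue-M′ (τ y) (τ-maps y yR)) (cong (_+ suc q) (τ-involutive y yR)))
  glue-involutive x x<N | rR l₁ l₂ with R-offset x l₁ l₂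
  ...   | y , refl , a , b = trans (cong glue (glue-R′ y a b)) (trans (glue-L (κ y) (κ-highHalf y a b)) (cong (_+ suc R) (κ-involutive y b)))
  glue-involutive x x<N | rT refl = trans (cong glue glue-T) glue-q

  private
    glue-≤ : ∀ x → x < suc M′ → glue x ≤ M′
    glue-≤ x l = ≤-pred (glue-< x l)
    q<1+q+R : q < suc q + R
    q<1+q+R = s≤s (m≤m+n q R)

  -- Values on [0, q) lie above those on the middle block, which lie above those on (q + R, M′),
  -- so a 132 pattern either stays inside one copy of κ or τ or is ruled out by position.
  glue-avoids132 : ¬ Contains132 (suc M′) glue
  glue-avoids132 (a , b , c , c<N , a<b , b<c , v₁ , v₂) = go (region a a<N) (region b b<N) (region c c<N)
    where
    b<N = <-trans b<c c<N
    a<N = <-trans a<b b<N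
    go : Region a → Region b → Region c → ⊥
    go (rL la) _ (rL lc) = κ-avoids (a , b , c , <-≤-trans lc (m≤m+n q q) , a<b , b<c ,
         +-cancelʳ-< (suc R) _ _ (subst₂ _<_ (glue-L a la) (glue-L c lc) v₁) ,
         +-cancelʳ-< (suc R) _ _ (subst₂ _<_ (glue-L c lc) (glue-L b (<-trans b<c lc)) v₂))
    go (rL la) _ (rq refl) = <-irrefl refl (<-≤-trans (subst (_< glue b) glue-q v₂) (glue-≤ b b<N))
    go (rL la) _ (rM l₁ l₂) = <-irrefl refl (<-≤-trans (<-trans v₁ (proj₂ (glue-M-range c l₁ l₂))) (proj₁ (glue-L-range a la)))
    go (rL la) _ (rR l₁ l₂) = <-irrefl refl (<-≤-trans (<-trans v₁ (<-trans (glue-R-range c l₁ l₂) q<1+q+R)) (proj₁ (glue-L-range a la)))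
    go (rL la) _ (rT refl) = <-irrefl refl (<-≤-trans (<-trans v₁ (subst (_< suc q + R) (sym glue-T) q<1+q+R)) (proj₁ (glue-L-range a la)))
    go (rq refl) _ _ = <-irrefl refl (<-≤-trans (subst (_< glue c) glue-q v₁) (glue-≤ c c<N))
    go (rM la₁ la₂) (rL lb) _ = <-asym a<b (<-trans lb la₁)
    go (rM la₁ la₂) (rq refl) _ = <-asym a<b la₁
    go (rM la₁ la₂) (rR l₁ l₂) _ = <-asym (<-trans v₁ v₂) (<-trans (glue-R-range b l₁ l₂) (proj₁ (glue-M-range a la₁ la₂)))
    go (rM la₁ la₂) (rT refl) _ = <-asym (<-trans v₁ v₂) (subst (_< glue a) (sym glue-T) (proj₁ (glue-M-range a la₁ la₂)))
    go (rM la₁ la₂) (rM lb₁ lb₂) (rL lc) = <-asym b<c (<-trans lc lb₁)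
    go (rM la₁ la₂) (rM lb₁ lb₂) (rq refl) = <-asym b<c lb₁
    go (rM la₁ la₂) (rM lb₁ lb₂) (rR l₁ l₂) = <-asym v₁ (<-trans (glue-R-range c l₁ l₂) (proj₁ (glue-M-range a la₁ la₂)))
    go (rM la₁ la₂) (rM lb₁ lb₂) (rT refl) = <-asym v₁ (subst (_< glue a) (sym glue-T) (proj₁ (glue-M-range a la₁ la₂)))
    go (rM la₁ la₂) (rM lb₁ lb₂) (rM lc₁ lc₂) with M-offset a la₁ la₂ | M-offset b lb₁ lb₂ | M-offset c lc₁ lc₂
    ... | a′ , refl , _ | b′ , refl , _ | c′ , refl , c′R =
      τ-avoids (a′ , b′ , c′ , c′R , +-cancelʳ-< (suc q) a′ b′ a<b , +-cancelʳ-< (suc q) b′ c′ b<c ,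
          +-cancelʳ-< (suc q) _ _ (subst₂ _<_ (glue-M′ a′ (<-trans (+-cancelʳ-< (suc q) a′ b′ a<b) (<-trans (+-cancelʳ-< (suc q) b′ c′ b<c) c′R))) (glue-M′ c′ c′R) v₁) ,
          +-cancelʳ-< (suc q) _ _ (subst₂ _<_ (glue-M′ c′ c′R) (glue-M′ b′ (<-trans (+-cancelʳ-< (suc q) b′ c′ b<c) c′R)) v₂))
    go (rR la₁ la₂) _ (rL lc) = <-asym (<-trans a<b b<c) (<-trans lc (<-≤-trans q<1+q+R la₁))
    go (rR la₁ la₂) _ (rq refl) = <-asym (<-trans a<b b<c) (<-≤-trans q<1+q+R la₁)
    go (rR la₁ la₂) _ (rM l₁ l₂) = <-asym (<-trans a<b b<c) (<-≤-trans l₂ la₁)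
    go (rR la₁ la₂) _ (rT refl) = <-asym v₂ (subst (glue b <_) (sym glue-T) (glue-R-range b (≤-trans la₁ (<⇒≤ a<b)) b<c))
    go (rR la₁ la₂) _ (rR lc₁ lc₂) with R-offset a la₁ la₂ | R-offset b (≤-trans la₁ (<⇒≤ a<b)) (<-trans b<c lc₂) | R-offset c lc₁ lc₂
    ... | a′ , refl , a₁ , a₂ | b′ , refl , b₁ , b₂ | c′ , refl , c₁ , c₂ =
      κ-avoids (a′ , b′ , c′ , c₂ , +-cancelʳ-< (suc R) a′ b′ a<b , +-cancelʳ-< (suc R) b′ c′ b<c ,
          subst₂ _<_ (glue-R′ a′ a₁ a₂) (glue-R′ c′ c₁ c₂) v₁ , subst₂ _<_ (glue-R′ c′ c₁ c₂) (glue-R′ b′ b₁ b₂) v₂)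
    go (rT refl) _ _ = <-irrefl refl (<-≤-trans (<-trans a<b b<c) (≤-pred c<N))

  glue-fp : countN (suc M′) (isFix glue) ≡ countN R (λ x → τ x ≡ᵇ x)
  glue-fp = trans (cong (λ z → countN z (isFix glue)) (size-split′ q R))
          (trans (countN-+ (suc q) (R + suc q) (isFix glue))
          (trans (cong (countN (suc q) (isFix glue) +_) (countN-+ R (suc q) (λ x → isFix glue (suc q + x))))
          (trans (cong₂ _+_ left-no-fix (cong₂ _+_ middle-fix right-no-fix)) (+-identityʳ _))))
    where
    left-no-fix : countN (suc q) (isFix glue) ≡ 0
    left-no-fix = countN-none (suc q) (isFix glue) (λ x x<sq t → let e = T≡⁻ {glue x} {x} t in h x x<sq e)
      where
      h : ∀ x → x < suc q → glue x ≡ x → ⊥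
      h x x<sq e with m≤n⇒m<n∨m≡n (≤-pred x<sq)
      ... | inj₁ l = <-irrefl (sym e) (<-≤-trans (<-trans l q<1+q+R) (proj₁ (glue-L-range x l)))
      ... | inj₂ xq = <-irrefl (sym (trans (sym glue-q) (subst (λ z → glue z ≡ z) xq e))) (≤-trans (m≤m+n (suc q) R) (m≤m+n (suc q + R) q))
    middle-fix : countN R (λ x → isFix glue (suc q + x)) ≡ countN R (λ x → τ x ≡ᵇ x)
    middle-fix = countN-cong R _ _ (λ x x<R → trans (cong (_≡ᵇ (suc q + x)) (trans (cong glue (+-comm (suc q) x)) (glue-M′ x x<R)))
            (≡ᵇ-cong⇔ (τ x + suc q) (suc q + x) (τ x) x (λ e → +-cancelʳ-≡ (suc q) (τ x) x (trans e (+-comm (suc q) x)))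
                                                    (λ e → trans (cong (_+ suc q) e) (+-comm x (suc q)))))
    right-no-fix : countN (suc q) (λ x → isFix glue (suc q + (R + x))) ≡ 0
    right-no-fix = countN-none (suc q) _ (λ x x<sq t → h x x<sq (T≡⁻ {glue (suc q + (R + x))} {suc q + (R + x)} t))
      where
      h : ∀ x → x < suc q → glue (suc q + (R + x)) ≡ suc q + (R + x) → ⊥
      h x x<sq e with m≤n⇒m<n∨m≡n (≤-pred x<sq)
      ... | inj₁ l = <-irrefl e (<-≤-trans (glue-R-range p l₁ l₂) (≤-trans (n≤1+n q) (m≤m+n (suc q) (R + x))))
        where
        p = suc q + (R + x)
        l₁ : suc q + R ≤ p
        l₁ = +-monoʳ-≤ (suc q) (m≤m+n R x)
        l₂ : p < M′
        l₂ = subst (p <_) (sym (+-assoc (suc q) R q)) (+-monoʳ-< (suc q) (+-monoʳ-< R l))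
      ... | inj₂ xq = <-irrefl (trans (sym e1) e) (subst (λ z → q < suc q + (R + z)) (sym xq) (m≤m+n (suc q) (R + q)))
        where
        e1 : glue (suc q + (R + x)) ≡ q
        e1 = trans (cong (λ z → glue (suc q + (R + z))) xq) (trans (cong glue (sym (+-assoc (suc q) R q))) glue-T)

  outerOf-glue : ∀ x → x < q + q → outerOf q R glue x ≡ κ x
  outerOf-glue x x<2q with trichotomy x q
  ... | inj₁ x<q = trans (cong (λ b → if b then glue x ∸ suc R else glue (x + suc R)) (<⇒<ᵇ-true x<q))
                         (trans (cong (_∸ suc R) (glue-L x x<q)) (m+n∸n≡m (κ x) (suc R)))
  ... | inj₂ q≤x = trans (cong (λ b → if b then glue x ∸ suc R else glue (x + suc R)) (≥⇒<ᵇ-false (≡⊎<⇒≤ q≤x)))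
                         (glue-R′ x (≡⊎<⇒≤ q≤x) x<2q)

  innerOf-glue : ∀ x → x < R → innerOf q R glue x ≡ τ x
  innerOf-glue x x<R = trans (cong (_∸ suc q) (glue-M′ x x<R)) (m+n∸n≡m (τ x) (suc q))

glue-cong : ∀ q R (κ₁ τ₁ κ₂ τ₂ : ℕ → ℕ) → (∀ x → x < q + q → κ₁ x ≡ κ₂ x) → (∀ x → x < R → τ₁ x ≡ τ₂ x) →
  ∀ x → x < suc (suc q + R + q) → Glue.glue q R κ₁ τ₁ x ≡ Glue.glue q R κ₂ τ₂ x
glue-cong q R κ₁ τ₁ κ₂ τ₂ eκ eτ x x<N with Glue.region q R κ₁ τ₁ x x<N
... | Glue.rL l = trans (Glue.glue-L q R κ₁ τ₁ x l) (trans (cong (_+ suc R) (eκ x (<-≤-trans l (m≤m+n q q)))) (sym (Glue.glue-L q R κ₂ τ₂ x l)))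
... | Glue.rq refl = trans (Glue.glue-q q R κ₁ τ₁) (sym (Glue.glue-q q R κ₂ τ₂))
... | Glue.rT refl = trans (Glue.glue-T q R κ₁ τ₁) (sym (Glue.glue-T q R κ₂ τ₂))
... | Glue.rM l₁ l₂ with ≤⇒≡+ (suc q) x l₁
...   | y , refl = trans (Glue.glue-M q R κ₁ τ₁ (y + suc q) l₁ l₂)
                   (trans (cong (λ z → τ₁ z + suc q) (m+n∸n≡m y (suc q)))
                   (trans (cong (_+ suc q) (eτ y (+-cancelʳ-< (suc q) y R (subst (y + suc q <_) (size-LM′ q R) l₂))))
                   (trans (cong (λ z → τ₂ z + suc q) (sym (m+n∸n≡m y (suc q)))) (sym (Glue.glue-M q R κ₂ τ₂ (y + suc q) l₁ l₂)))))
glue-cong q R κ₁ τ₁ κ₂ τ₂ eκ eτ x x<N | Glue.rR l₁ l₂ with ≤⇒≡+ (suc R) x (≤-trans (s≤s (m≤n+m R q)) l₁)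
...   | y , refl = trans (Glue.glue-R q R κ₁ τ₁ (y + suc R) l₁ l₂)
                   (trans (cong κ₁ (m+n∸n≡m y (suc R)))
                   (trans (eκ y (+-cancelʳ-< (suc R) y (q + q) (subst (y + suc R <_) (size-split q R) l₂)))
                   (trans (cong κ₂ (sym (m+n∸n≡m y (suc R)))) (sym (Glue.glue-R q R κ₂ τ₂ (y + suc R) l₁ l₂)))))

-- Splitting a 132-avoiding involution at its last value

#above≤ : ∀ M y → countN M (λ z → y <ᵇ z) ≤ M ∸ suc y
#above≤ zero y = z≤n
#above≤ (suc M) y with y <ᵇ M in e
... | true = subst (countN M (λ z → y <ᵇ z) + 1 ≤_) (sym (trans (+-∸-assoc 1 (T<⁻ {y} {M} (Tb e))) refl))
               (subst (_≤ suc (M ∸ suc y)) (+-comm 1 _) (s≤s (#above≤ M y)))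
... | false = subst (_≤ suc M ∸ suc y) (sym (+-identityʳ _)) (≤-trans (#above≤ M y) (∸-monoˡ-≤ (suc y) (n≤1+n M)))

-- Let σ(M) = q < M.  The pattern (x, q, M) forces σ(x) ∈ (q, M) for x < q; counting the room
-- left for these q values shows that σ is determined blockwise as in Glue, and that 2q < M.
module LastValue (M q : ℕ) (f : ℕ → ℕ) (maps : MapsBelow (suc M) f) (inv : Involutive (suc M) f) (avoid : ¬ Contains132 (suc M) f)
              (f-last : f M ≡ q) (q<M : q < M) where
  open Involution (suc M) f maps inv using (injective)

  M<N : M < suc M
  M<N = ≤-refl
  fq : f q ≡ M
  fq = trans (cong f (sym f-last)) (inv M M<N)
  q<N : q < suc M
  q<N = <-trans q<M M<N

  ≢-q : ∀ y → y < suc M → y ≢ M → f y ≢ q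
  ≢-q y y<N ne e = ne (injective y M y<N M<N (trans e (sym f-last)))
  ≢-M : ∀ y → y < suc M → y ≢ q → f y ≢ M
  ≢-M y y<N ne e = ne (injective y q y<N q<N (trans e (sym fq)))

  left-values : ∀ x → x < q → q < f x × f x < M
  left-values x x<q with trichotomy (f x) q
  ... | inj₁ l = ⊥-elim (avoid (x , q , M , M<N , x<q , q<M , subst (f x <_) (sym f-last) l , subst₂ _<_ (sym f-last) (sym fq) q<M))
  ... | inj₂ (inj₁ e) = ⊥-elim (≢-q x x<N (λ e′ → <-irrefl e′ (<-trans x<q q<M)) e)
    where x<N = <-trans x<q q<N
  ... | inj₂ (inj₂ l) = l , ≤∧≢⇒< (≤-pred (maps x x<N)) (≢-M x x<N (λ e′ → <-irrefl e′ x<q))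
    where x<N = <-trans x<q q<N

  middle-below-left : ∀ y x → q < y → y < M → q < f y → x < q → y < f x
  middle-below-left y x q<y y<M q<fy x<q with trichotomy y (f x)
  ... | inj₁ l = l
  ... | inj₂ (inj₁ e) = ⊥-elim (<-asym (subst (_< q) (trans (sym (inv x x<N)) (cong f (sym e))) x<q) q<fy)
    where x<N = <-trans x<q q<N
  ... | inj₂ (inj₂ l) = ⊥-elim (avoid (f x , y , M , M<N , l , y<M ,
                           subst₂ _<_ (sym (inv x (<-trans x<q q<N))) (sym f-last) x<q , subst (_< f y) (sym f-last) q<fy))

  late-values-small : ∀ y → q < y → y < M → M ≤ q + y → f y < q
  late-values-small y q<y y<M le with trichotomy (f y) q
  ... | inj₁ l = l
  ... | inj₂ (inj₁ e) = ⊥-elim (≢-q y (<-trans y<M M<N) (λ e′ → <-irrefl e′ y<M) e)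
  ... | inj₂ (inj₂ q<fy) = ⊥-elim (<-irrefl refl (subst (_≤ q + y) (+-suc q y) (≤-trans (m≤o∸n⇒m+n≤o q y<M counting) le)))
    where
    counting : q ≤ M ∸ suc y
    counting = ≤-trans (subst (_≤ countN M (λ z → y <ᵇ z)) (countN-all q (λ _ → true) (λ _ _ → tt))
            (countN-injection q M (λ _ → true) (λ z → y <ᵇ z) f
              (λ x x<q _ → proj₂ (left-values x x<q) , T<⁺ (middle-below-left y x q<y y<M q<fy x<q))
              (λ a b a<q b<q _ _ e → injective a b (<-trans a<q q<N) (<-trans b<q q<N) e)))
            (#above≤ M y)

  early-values-large : ∀ y → q < y → y + q < M → q < f y
  early-values-large y q<y lt with trichotomy (f y) q
  ... | inj₂ (inj₂ l) = l
  ... | inj₂ (inj₁ e) = ⊥-elim (≢-q y y<N (λ e′ → <-irrefl e′ y<M) e)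
    where y<M = ≤-<-trans (m≤m+n y q) lt
          y<N = <-trans y<M M<N
  ... | inj₁ fy<q = ⊥-elim (<-irrefl (+-comm y q) (<-≤-trans lt (subst (_≤ q + y) (m∸n+n≡m (<⇒≤ y<M)) (+-monoˡ-≤ y counting))))
    where
    y<M = ≤-<-trans (m≤m+n y q) lt
    y<N = <-trans y<M M<N
    right-small : ∀ z → y ≤ z → z < M → f z < q
    right-small z y≤z z<M with trichotomy (f z) q
    ... | inj₁ l = l
    ... | inj₂ (inj₁ e) = ⊥-elim (≢-q z (<-trans z<M M<N) (λ e′ → <-irrefl e′ z<M) e)
    ... | inj₂ (inj₂ q<fz) = ⊥-elim (<-irrefl refl (<-≤-trans (subst (z <_) (inv y y<N) (middle-below-left z (f y) (<-≤-trans q<y y≤z) z<M q<fz fy<q)) y≤z))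
    counting : M ∸ y ≤ q
    counting = subst₂ _≤_ (countN-all (M ∸ y) (λ _ → true) (λ _ _ → tt)) (countN-all q (λ _ → true) (λ _ _ → tt))
           (countN-injection (M ∸ y) q (λ _ → true) (λ _ → true) (λ z → f (y + z))
             (λ z z< _ → right-small (y + z) (m≤m+n y z) (subst (y + z <_) (m+[n∸m]≡n (<⇒≤ y<M)) (+-monoʳ-< y z<)) , tt)
             (λ a b a< b< _ _ e → +-cancelˡ-≡ y a b (injective (y + a) (y + b) (lift-< a a<) (lift-< b b<) e)))
      where
      lift-< : ∀ a → a < M ∸ y → y + a < suc M
      lift-< a a< = <-trans (subst (y + a <_) (m+[n∸m]≡n (<⇒≤ y<M)) (+-monoʳ-< y a<)) M<N

  2q<M : q + q < M
  2q<M = subst (_≤ M) (+-suc q q) (m≤o∸n⇒m+n≤o q q<M counting)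
    where
    counting : q ≤ M ∸ suc q
    counting = ≤-trans (subst (_≤ countN M (λ z → q <ᵇ z)) (countN-all q (λ _ → true) (λ _ _ → tt))
            (countN-injection q M (λ _ → true) (λ z → q <ᵇ z) f
              (λ x x<q _ → proj₂ (left-values x x<q) , T<⁺ (proj₁ (left-values x x<q)))
              (λ a b a<q b<q _ _ e → injective a b (<-trans a<q q<N) (<-trans b<q q<N) e)))
            (#above≤ M q)

skipMiddle : ℕ → ℕ → ℕ → ℕ
skipMiddle q R v = if v <ᵇ q then v else v + suc R

skipMiddle-low : ∀ q R v → v < q → skipMiddle q R v ≡ v
skipMiddle-low q R v l rewrite <⇒<ᵇ-true l = refl
skipMiddle-high : ∀ q R v → q ≤ v → skipMiddle q R v ≡ v + suc R
skipMiddle-high q R v l rewrite ≥⇒<ᵇ-false {v} {q} l = refl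

skipMiddle-mono : ∀ q R u v → u < v → skipMiddle q R u < skipMiddle q R v
skipMiddle-mono q R u v u<v with trichotomy u q | trichotomy v q
... | inj₁ uq | inj₁ vq = subst₂ _<_ (sym (skipMiddle-low q R u uq)) (sym (skipMiddle-low q R v vq)) u<v
... | inj₁ uq | inj₂ vq = subst₂ _<_ (sym (skipMiddle-low q R u uq)) (sym (skipMiddle-high q R v (≡⊎<⇒≤ vq))) (<-≤-trans u<v (m≤m+n v _))
... | inj₂ uq | inj₁ vq = ⊥-elim (<-asym u<v (<-≤-trans vq (≡⊎<⇒≤ uq)))
... | inj₂ uq | inj₂ vq = subst₂ _<_ (sym (skipMiddle-high q R u (≡⊎<⇒≤ uq))) (sym (skipMiddle-high q R v (≡⊎<⇒≤ vq))) (+-monoˡ-< (suc R) u<v)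

module Split (q R : ℕ) (f : ℕ → ℕ) (maps : MapsBelow (suc (suc q + R + q)) f) (inv : Involutive (suc (suc q + R + q)) f)
               (avoid : ¬ Contains132 (suc (suc q + R + q)) f) (f-last : f (suc q + R + q) ≡ q) where
  M′ : ℕ
  M′ = suc q + R + q
  q<M′ : q < M′
  q<M′ = s≤s (≤-trans (m≤m+n q R) (m≤m+n (q + R) q))
  open LastValue M′ q f maps inv avoid f-last q<M′ public
  open Involution (suc M′) f maps inv using (injective)

  left↦right : ∀ x → x < q → suc q + R ≤ f x
  left↦right x x<q = ≮⇒≥ (λ lt → <-asym x<q (subst (q <_) (inv x (<-trans x<q q<N))
                    (early-values-large (f x) (proj₁ (left-values x x<q)) (+-monoˡ-< q lt))))

  middle↦middle : ∀ x → q < x → x < suc q + R → q < f x × f x < suc q + R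
  middle↦middle x q<x x<1+q+R = q<fx , ≰⇒> (λ ge → <-asym q<x (subst (_< q) (inv x x<N) (late-values-small (f x) q<fx (fx<M′ ge) (le ge))))
    where
    x<N : x < suc M′
    x<N = <-trans (<-≤-trans x<1+q+R (m≤m+n (suc q + R) q)) M<N
    q<fx : q < f x
    q<fx = early-values-large x q<x (+-monoˡ-< q x<1+q+R)
    fx<M′ : suc q + R ≤ f x → f x < M′
    fx<M′ _ = ≤∧≢⇒< (≤-pred (maps x x<N)) (≢-M x x<N (λ e → <-irrefl (sym e) q<x))
    le : suc q + R ≤ f x → M′ ≤ q + f x
    le ge = subst (M′ ≤_) (+-comm (f x) q) (+-monoˡ-≤ q ge)

  right↦left : ∀ x → suc q + R ≤ x → x < M′ → f x < q
  right↦left x le x<1+q+R = late-values-small x (<-≤-trans (s≤s (m≤m+n q R)) le) x<1+q+R (subst (M′ ≤_) (+-comm x q) (+-monoˡ-≤ q le))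

  outer inner : ℕ → ℕ
  outer = outerOf q R f
  inner = innerOf q R f

  outer-low : ∀ x → x < q → outer x + suc R ≡ f x
  outer-low x l rewrite <⇒<ᵇ-true l = m∸n+n≡m (≤-trans (s≤s (m≤n+m R q)) (left↦right x l))
  outer-high : ∀ x → q ≤ x → outer x ≡ f (x + suc R)
  outer-high x l rewrite ≥⇒<ᵇ-false {x} {q} l = refl


  κ-lowHalf : ∀ x → x < q → q ≤ outer x × outer x < q + q
  κ-lowHalf x l = +-cancelʳ-≤ (suc R) q (outer x) (subst₂ _≤_ (size-LM q R) (sym (outer-low x l)) (left↦right x l)) ,
           +-cancelʳ-< (suc R) (outer x) (q + q) (subst₂ _<_ (sym (outer-low x l)) (size-split q R) (proj₂ (left-values x l)))
  κ-highHalf : ∀ x → q ≤ x → x < q + q → outer x < q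
  κ-highHalf x l₁ l₂ = subst (_< q) (sym (outer-high x l₁)) (right↦left (x + suc R) (proj₁ (R-position q R x l₁ l₂)) (proj₂ (R-position q R x l₁ l₂)))
  κ-involutive : ∀ x → x < q + q → outer (outer x) ≡ x
  κ-involutive x l with trichotomy x q
  ... | inj₁ xq = trans (outer-high (outer x) (proj₁ (κ-lowHalf x xq))) (trans (cong f (outer-low x xq)) (inv x (<-trans xq q<N)))
  ... | inj₂ xq = +-cancelʳ-≡ (suc R) _ _ (trans (outer-low (outer x) (κ-highHalf x (≡⊎<⇒≤ xq) l))
                      (trans (cong f (outer-high x (≡⊎<⇒≤ xq))) (inv (x + suc R) (<-trans (proj₂ (R-position q R x (≡⊎<⇒≤ xq) l)) M<N))))
  κ-avoids : ¬ Contains132 (q + q) outer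
  κ-avoids h = avoid (Contains132-lift (q + q) (suc M′) outer f (skipMiddle q R) (skipMiddle q R) (skipMiddle-mono q R) (skipMiddle-mono q R) lift-< lift-≡ h)
    where
    lift-< : ∀ x → x < q + q → skipMiddle q R x < suc M′
    lift-< x l with trichotomy x q
    ... | inj₁ xq = subst (_< suc M′) (sym (skipMiddle-low q R x xq)) (<-trans xq q<N)
    ... | inj₂ xq = subst (_< suc M′) (sym (skipMiddle-high q R x (≡⊎<⇒≤ xq))) (<-trans (proj₂ (R-position q R x (≡⊎<⇒≤ xq) l)) M<N)
    lift-≡ : ∀ x → x < q + q → f (skipMiddle q R x) ≡ skipMiddle q R (outer x)
    lift-≡ x l with trichotomy x q
    ... | inj₁ xq = trans (cong f (skipMiddle-low q R x xq)) (trans (sym (outer-low x xq)) (sym (skipMiddle-high q R (outer x) (proj₁ (κ-lowHalf x xq)))))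
    ... | inj₂ xq = trans (cong f (skipMiddle-high q R x (≡⊎<⇒≤ xq)))
                          (trans (sym (outer-high x (≡⊎<⇒≤ xq))) (sym (skipMiddle-low q R (outer x) (κ-highHalf x (≡⊎<⇒≤ xq) l))))

  inner-eq : ∀ y → y < R → inner y + suc q ≡ f (y + suc q)
  inner-eq y l = m∸n+n≡m (proj₁ (middle↦middle (y + suc q) (proj₁ (M-position q R y l)) (proj₂ (M-position q R y l))))

  τ-maps : ∀ x → x < R → inner x < R
  τ-maps x l = +-cancelʳ-< (suc q) (inner x) R
    (subst₂ _<_ (sym (inner-eq x l)) (size-LM′ q R) (proj₂ (middle↦middle (x + suc q) (proj₁ (M-position q R x l)) (proj₂ (M-position q R x l)))))
  τ-involutive : ∀ x → x < R → inner (inner x) ≡ x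
  τ-involutive x l = +-cancelʳ-≡ (suc q) _ _ (trans (inner-eq (inner x) (τ-maps x l)) (trans (cong f (inner-eq x l)) (inv (x + suc q) (M-position< q R x l))))
  τ-avoids : ¬ Contains132 R inner
  τ-avoids h = avoid (Contains132-lift R (suc M′) inner f (_+ suc q) (_+ suc q) (λ x y l → +-monoˡ-< (suc q) l) (λ x y l → +-monoˡ-< (suc q) l)
               (M-position< q R) (λ x l → sym (inner-eq x l)) h)

  open Glue q R outer inner hiding (M′)
  glue-outer-inner≡f : ∀ x → x < suc M′ → glue x ≡ f x
  glue-outer-inner≡f x x<N with region x x<N
  ... | rL l = trans (glue-L x l) (outer-low x l)
  ... | rq refl = trans glue-q (sym fq)
  ... | rM l₁ l₂ with ≤⇒≡+ (suc q) x l₁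
  ...   | y , refl = trans (glue-M (y + suc q) l₁ l₂) (trans (cong (λ z → inner z + suc q) (m+n∸n≡m y (suc q)))
                        (inner-eq y (+-cancelʳ-< (suc q) y R (subst (y + suc q <_) (size-LM′ q R) l₂))))
  glue-outer-inner≡f x x<N | rR l₁ l₂ with ≤⇒≡+ (suc R) x (≤-trans (s≤s (m≤n+m R q)) l₁)
  ...   | y , refl = trans (glue-R (y + suc R) l₁ l₂) (trans (cong outer (m+n∸n≡m y (suc R)))
                        (outer-high y (+-cancelʳ-≤ (suc R) q y (subst (_≤ y + suc R) (size-LM q R) l₁))))
  glue-outer-inner≡f x x<N | rT refl = trans glue-T (sym f-last)

-- 132-avoiding involutions, counted by their last value

inv132 : ∀ {n} → (ℕ → Bool) → Fn n → Bool
inv132 P σ = isInvolution σ ∧ not (contains132 σ) ∧ P (fp σ)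

record Inv132 (n : ℕ) (P : ℕ → Bool) (f : ℕ → ℕ) : Set where
  field
    maps : MapsBelow n f
    involutive : Involutive n f
    avoids : ¬ Contains132 n f
    fixedPoints : T (P (countN n (isFix f)))

inv132⇒Inv132 : ∀ {n} P (σ : Fn n) → T (inv132 P σ) → Inv132 n P ⟦ σ ⟧
inv132⇒Inv132 P σ t = record
  { maps = ⟦⟧-< σ
  ; involutive = isInvolution⇒Involutive σ (proj₁ t₁)
  ; avoids = λ c → Tnot⁻ (proj₁ t₂) (Contains132⇒contains132 σ c)
  ; fixedPoints = subst (T ∘ P) (fp≡countN σ) (proj₂ t₂)
  }
  where
  t₁ = T∧⁻ {isInvolution σ} t
  t₂ = T∧⁻ {not (contains132 σ)} (proj₂ t₁)

Inv132⇒inv132 : ∀ {n P f} → Inv132 n P f → T (inv132 P (vecOf n f))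
Inv132⇒inv132 {n} {P} {f} I =
  T∧⁺ (Involutive⇒isInvolution σ σ-involutive)
      (T∧⁺ (Tnot⁺ (λ c → avoids (Contains132-cong n ⟦ σ ⟧ f ⟦σ⟧≡f (contains132⇒Contains132 σ c))))
           (subst (T ∘ P) (sym fp≡) fixedPoints))
  where
  open Inv132 I
  σ = vecOf n f
  ⟦σ⟧≡f : ∀ x → x < n → ⟦ σ ⟧ x ≡ f x
  ⟦σ⟧≡f x x<n = ⟦vecOf⟧ n f x x<n (maps x x<n)
  σ-involutive : Involutive n ⟦ σ ⟧
  σ-involutive x x<n = trans (cong ⟦ σ ⟧ (⟦σ⟧≡f x x<n)) (trans (⟦σ⟧≡f (f x) (maps x x<n)) (involutive x x<n))
  fp≡ : fp σ ≡ countN n (isFix f)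
  fp≡ = trans (fp≡countN σ) (countN-cong n _ _ (λ x x<n → cong (_≡ᵇ x) (⟦σ⟧≡f x x<n)))

vecOf≡ : ∀ {n} (σ : Fn n) g → (∀ x → x < n → g x ≡ ⟦ σ ⟧ x) → vecOf n g ≡ σ
vecOf≡ {n} σ g h = ⟦⟧-injective _ σ (λ x x<n →
  trans (⟦vecOf⟧ n g x x<n (subst (_< n) (sym (h x x<n)) (⟦⟧-< σ x x<n))) (h x x<n))

countN-isFix-suc : ∀ M f → f M ≡ M → countN (suc M) (isFix f) ≡ suc (countN M (isFix f))
countN-isFix-suc M f fM≡M rewrite fM≡M | ≡ᵇ-refl M = +-comm (countN M (isFix f)) 1

extendFixed : ℕ → (ℕ → ℕ) → ℕ → ℕ
extendFixed M g x = if x <ᵇ M then g x else M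

extendFixed-< : ∀ M g x → x < M → extendFixed M g x ≡ g x
extendFixed-< M g x x<M rewrite <⇒<ᵇ-true x<M = refl

extendFixed-M : ∀ M g → extendFixed M g M ≡ M
extendFixed-M M g rewrite ≥⇒<ᵇ-false (≤-refl {M}) = refl

Inv132-dropLast : ∀ {M P f} → Inv132 (suc M) P f → f M ≡ M → Inv132 M (P ∘ suc) f
Inv132-dropLast {M} {P} {f} I fM≡M = record
  { maps = maps′
  ; involutive = λ x x<M → involutive x (m<n⇒m<1+n x<M)
  ; avoids = λ (a , b , c , c<M , rest) → avoids (a , b , c , m<n⇒m<1+n c<M , rest)
  ; fixedPoints = subst (T ∘ P) (countN-isFix-suc M f fM≡M) fixedPoints
  }
  where
  open Inv132 I
  open Involution (suc M) f maps involutive using (injective)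
  maps′ : MapsBelow M f
  maps′ x x<M = ≤∧≢⇒< (≤-pred (maps x (m<n⇒m<1+n x<M)))
    (λ fx≡M → <-irrefl (injective x M (m<n⇒m<1+n x<M) ≤-refl (trans fx≡M (sym fM≡M))) x<M)

Inv132-extendFixed : ∀ {M P g} → Inv132 M (P ∘ suc) g → Inv132 (suc M) P (extendFixed M g)
Inv132-extendFixed {M} {P} {g} I = record
  { maps = maps′
  ; involutive = involutive′
  ; avoids = avoids′
  ; fixedPoints = subst (T ∘ P) (sym (trans (countN-isFix-suc M h (extendFixed-M M g)) (cong suc (countN-cong M _ _ (λ x x<M → cong (_≡ᵇ x) (extendFixed-< M g x x<M)))))) fixedPoints
  }
  where
  open Inv132 I
  h = extendFixed M g
  maps′ : MapsBelow (suc M) h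
  maps′ x x<1+M with m≤n⇒m<n∨m≡n (≤-pred x<1+M)
  ... | inj₁ x<M = subst (_< suc M) (sym (extendFixed-< M g x x<M)) (m<n⇒m<1+n (maps x x<M))
  ... | inj₂ refl = subst (_< suc x) (sym (extendFixed-M M g)) ≤-refl
  involutive′ : Involutive (suc M) h
  involutive′ x x<1+M with m≤n⇒m<n∨m≡n (≤-pred x<1+M)
  ... | inj₁ x<M = trans (cong h (extendFixed-< M g x x<M)) (trans (extendFixed-< M g (g x) (maps x x<M)) (involutive x x<M))
  ... | inj₂ refl = trans (cong h (extendFixed-M M g)) (extendFixed-M M g)
  avoids′ : ¬ Contains132 (suc M) h
  avoids′ (a , b , c , c<1+M , a<b , b<c , v₁ , v₂) with m≤n⇒m<n∨m≡n (≤-pred c<1+M)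
  ... | inj₂ refl = <-asym v₂ (subst₂ _<_ (sym (extendFixed-< M g b b<c)) (sym (extendFixed-M M g)) (maps b b<c))
  ... | inj₁ c<M = avoids (a , b , c , c<M , a<b , b<c ,
          subst₂ _<_ (extendFixed-< M g a a<M) (extendFixed-< M g c c<M) v₁ ,
          subst₂ _<_ (extendFixed-< M g c c<M) (extendFixed-< M g b b<M) v₂)
    where b<M = <-trans b<c c<M
          a<M = <-trans a<b b<M

inv132-lastFixed : ∀ M P → countB (λ σ → inv132 P σ ∧ (⟦ σ ⟧ M ≡ᵇ M)) (allVecs (suc M) (suc M)) ≡ countB (inv132 (P ∘ suc)) (allVecs M M)
inv132-lastFixed M P = countB-bijection _ _ _ _ (λ σ → vecOf M ⟦ σ ⟧) (λ τ → vecOf (suc M) (extendFixed M ⟦ τ ⟧))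
  (allVecs-unique _ _) (allVecs-unique _ _) forward backward
  where
  forward : ∀ σ → σ ∈ allVecs (suc M) (suc M) → T (inv132 P σ ∧ (⟦ σ ⟧ M ≡ᵇ M)) →
    vecOf M ⟦ σ ⟧ ∈ allVecs M M × T (inv132 (P ∘ suc) (vecOf M ⟦ σ ⟧)) × vecOf (suc M) (extendFixed M ⟦ vecOf M ⟦ σ ⟧ ⟧) ≡ σ
  forward σ _ t = allVecs-complete _ _ _ , Inv132⇒inv132 I , vecOf≡ σ (extendFixed M ⟦ vecOf M ⟦ σ ⟧ ⟧) restore
    where
    t₁ = T∧⁻ {inv132 P σ} t
    σM≡M = T≡⁻ {⟦ σ ⟧ M} {M} (proj₂ t₁)
    I : Inv132 M (P ∘ suc) ⟦ σ ⟧
    I = Inv132-dropLast (inv132⇒Inv132 P σ (proj₁ t₁)) σM≡M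
    restore : ∀ x → x < suc M → extendFixed M ⟦ vecOf M ⟦ σ ⟧ ⟧ x ≡ ⟦ σ ⟧ x
    restore x x<1+M with m≤n⇒m<n∨m≡n (≤-pred x<1+M)
    ... | inj₁ x<M = trans (extendFixed-< M ⟦ vecOf M ⟦ σ ⟧ ⟧ x x<M) (⟦vecOf⟧ M ⟦ σ ⟧ x x<M (Inv132.maps I x x<M))
    ... | inj₂ refl = trans (extendFixed-M M ⟦ vecOf M ⟦ σ ⟧ ⟧) (sym σM≡M)
  backward : ∀ τ → τ ∈ allVecs M M → T (inv132 (P ∘ suc) τ) →
    vecOf (suc M) (extendFixed M ⟦ τ ⟧) ∈ allVecs (suc M) (suc M) ×
    T (inv132 P (vecOf (suc M) (extendFixed M ⟦ τ ⟧)) ∧ (⟦ vecOf (suc M) (extendFixed M ⟦ τ ⟧) ⟧ M ≡ᵇ M)) ×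
    vecOf M ⟦ vecOf (suc M) (extendFixed M ⟦ τ ⟧) ⟧ ≡ τ
  backward τ _ t = allVecs-complete _ _ _ ,
    T∧⁺ {inv132 P (vecOf (suc M) (extendFixed M ⟦ τ ⟧))} (Inv132⇒inv132 J) (T≡⁺ (trans (⟦ext⟧ M ≤-refl) (extendFixed-M M ⟦ τ ⟧))) ,
    vecOf≡ τ ⟦ vecOf (suc M) (extendFixed M ⟦ τ ⟧) ⟧ (λ x x<M → trans (⟦ext⟧ x (m<n⇒m<1+n x<M)) (extendFixed-< M ⟦ τ ⟧ x x<M))
    where
    J : Inv132 (suc M) P (extendFixed M ⟦ τ ⟧)
    J = Inv132-extendFixed (inv132⇒Inv132 (P ∘ suc) τ t)
    ⟦ext⟧ : ∀ x → x < suc M → ⟦ vecOf (suc M) (extendFixed M ⟦ τ ⟧) ⟧ x ≡ extendFixed M ⟦ τ ⟧ x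
    ⟦ext⟧ x x<1+M = ⟦vecOf⟧ (suc M) (extendFixed M ⟦ τ ⟧) x x<1+M (Inv132.maps J x x<1+M)

countN-isFix≡0⇒≢ : ∀ n (g : ℕ → ℕ) → countN n (isFix g) ≡ 0 → ∀ x → x < n → g x ≢ x
countN-isFix≡0⇒≢ n g none x x<n gx≡x = <-irrefl (sym none) (<-≤-trans (s≤s z≤n) (countN-< (isFix g) (T≡⁺ {g x} {x} gx≡x) x<n))

-- A fixed-point-free 132-avoiding involution of [0, 2q) has its q excedances at [0, q),
-- so it exchanges [0, q) and [q, 2q).
module HalfSwap {q : ℕ} {κ : ℕ → ℕ} (I : Inv132 (q + q) (_≡ᵇ 0) κ) where
  open Inv132 I
  open Involution (q + q) κ maps involutive using (#fix+2#exc≡n; module Avoiding132)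
  open Avoiding132 avoids using (isExc⇔<#exc; #exc)

  no-fix : countN (q + q) (isFix κ) ≡ 0
  no-fix = T≡⁻ fixedPoints

  #exc≡q : #exc ≡ q
  #exc≡q = *-cancelˡ-≡ #exc q 2
    (trans (sym (cong (_+ 2 * #exc) no-fix)) (trans #fix+2#exc≡n (cong (q +_) (sym (+-identityʳ q)))))

  κ-lowHalf : ∀ x → x < q → q ≤ κ x × κ x < q + q
  κ-lowHalf x x<q =
    ≮⇒≥ (λ κx<q → <-asym x<κx (subst (κ x <_) (involutive x x<2q)
      (T<⁻ {κ x} {κ (κ x)} (proj₂ (isExc⇔<#exc (κ x) (maps x x<2q)) (subst (κ x <_) (sym #exc≡q) κx<q))))) ,
    maps x x<2q
    where
    x<2q = <-≤-trans x<q (m≤m+n q q)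
    x<κx : x < κ x
    x<κx = T<⁻ {x} {κ x} (proj₂ (isExc⇔<#exc x x<2q) (subst (x <_) (sym #exc≡q) x<q))

  κ-highHalf : ∀ x → q ≤ x → x < q + q → κ x < q
  κ-highHalf x q≤x x<2q =
    subst (κ x <_) #exc≡q (proj₁ (isExc⇔<#exc (κ x) (maps x x<2q)) (T<⁺ (subst (κ x <_) (sym (involutive x x<2q)) κx<x)))
    where
    κx<x : κ x < x
    κx<x = ≤∧≢⇒< (≮⇒≥ (λ x<κx → <-irrefl refl (<-≤-trans (proj₁ (isExc⇔<#exc x x<2q) (T<⁺ x<κx)) (subst (_≤ x) (sym #exc≡q) q≤x))))
                 (countN-isFix≡0⇒≢ (q + q) κ no-fix x x<2q)

inv132-lastPaired : ∀ q R P →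
  countB (λ σ → inv132 P σ ∧ (⟦ σ ⟧ (suc q + R + q) ≡ᵇ q)) (allVecs (suc (suc q + R + q)) (suc (suc q + R + q)))
  ≡ countB (λ p → inv132 (_≡ᵇ 0) (proj₁ p) ∧ inv132 P (proj₂ p)) (cartesianProduct (allVecs (q + q) (q + q)) (allVecs R R))
inv132-lastPaired q R P = countB-bijection _ _ _ _ split join
  (allVecs-unique _ _) (cartesianProduct⁺ (allVecs-unique _ _) (allVecs-unique _ _)) forward backward
  where
  M′ N : ℕ
  M′ = suc q + R + q
  N = suc M′
  split : Fn N → Fn (q + q) × Fn R
  split σ = vecOf (q + q) (outerOf q R ⟦ σ ⟧) , vecOf R (innerOf q R ⟦ σ ⟧)
  join : Fn (q + q) × Fn R → Fn N
  join (κv , τv) = vecOf N (Glue.glue q R ⟦ κv ⟧ ⟦ τv ⟧)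

  forward : ∀ σ → σ ∈ allVecs N N → T (inv132 P σ ∧ (⟦ σ ⟧ M′ ≡ᵇ q)) →
    split σ ∈ cartesianProduct (allVecs (q + q) (q + q)) (allVecs R R) ×
    T (inv132 (_≡ᵇ 0) (proj₁ (split σ)) ∧ inv132 P (proj₂ (split σ))) × join (split σ) ≡ σ
  forward σ _ t =
    ∈-cartesianProduct⁺ (allVecs-complete _ _ _) (allVecs-complete _ _ _) ,
    T∧⁺ (Inv132⇒inv132 Iκ) (Inv132⇒inv132 Iτ) ,
    vecOf≡ σ _ (λ x x<N → trans (glue-cong q R _ _ outer inner ⟦κv⟧≡outer ⟦τv⟧≡inner x x<N) (glue-outer-inner≡f x x<N))
    where
    t₁ = T∧⁻ {inv132 P σ} t
    I = inv132⇒Inv132 P σ (proj₁ t₁)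
    open Inv132 I
    open Split q R ⟦ σ ⟧ maps involutive avoids (T≡⁻ {⟦ σ ⟧ M′} {q} (proj₂ t₁))
    open Glued q R outer inner κ-lowHalf κ-highHalf κ-involutive κ-avoids τ-maps τ-involutive τ-avoids using (glue-fp)
    outer-maps : MapsBelow (q + q) outer
    outer-maps x x<2q with trichotomy x q
    ... | inj₁ x<q = proj₂ (κ-lowHalf x x<q)
    ... | inj₂ q≤x = <-≤-trans (κ-highHalf x (≡⊎<⇒≤ q≤x) x<2q) (m≤m+n q q)
    outer-no-fix : countN (q + q) (isFix outer) ≡ 0
    outer-no-fix = countN-none (q + q) _ (λ x x<2q e → no-fix x x<2q (T≡⁻ {outer x} {x} e))
      where
      no-fix : ∀ x → x < q + q → outer x ≢ x
      no-fix x x<2q e with trichotomy x q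
      ... | inj₁ x<q = <-irrefl (sym e) (<-≤-trans x<q (proj₁ (κ-lowHalf x x<q)))
      ... | inj₂ q≤x = <-irrefl e (<-≤-trans (κ-highHalf x (≡⊎<⇒≤ q≤x) x<2q) (≡⊎<⇒≤ q≤x))
    Iκ : Inv132 (q + q) (_≡ᵇ 0) outer
    Iκ = record { maps = outer-maps ; involutive = κ-involutive ; avoids = κ-avoids
                ; fixedPoints = T≡⁺ outer-no-fix }
    Iτ : Inv132 R P inner
    Iτ = record { maps = τ-maps ; involutive = τ-involutive ; avoids = τ-avoids
                ; fixedPoints = subst (T ∘ P) (trans (countN-cong N _ _ (λ x x<N → cong (_≡ᵇ x) (sym (glue-outer-inner≡f x x<N)))) glue-fp) fixedPoints }
    ⟦κv⟧≡outer : ∀ x → x < q + q → ⟦ vecOf (q + q) outer ⟧ x ≡ outer x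
    ⟦κv⟧≡outer x x<2q = ⟦vecOf⟧ (q + q) outer x x<2q (outer-maps x x<2q)
    ⟦τv⟧≡inner : ∀ x → x < R → ⟦ vecOf R inner ⟧ x ≡ inner x
    ⟦τv⟧≡inner x x<R = ⟦vecOf⟧ R inner x x<R (τ-maps x x<R)

  backward : ∀ p → p ∈ cartesianProduct (allVecs (q + q) (q + q)) (allVecs R R) → T (inv132 (_≡ᵇ 0) (proj₁ p) ∧ inv132 P (proj₂ p)) →
    join p ∈ allVecs N N × T (inv132 P (join p) ∧ (⟦ join p ⟧ M′ ≡ᵇ q)) × split (join p) ≡ p
  backward (κv , τv) _ t =
    allVecs-complete _ _ _ ,
    T∧⁺ {inv132 P (join (κv , τv))} (Inv132⇒inv132 Iσ) (T≡⁺ (trans (⟦σ⟧≡glue M′ ≤-refl) glue-T)) ,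
    cong₂ _,_ (vecOf≡ κv _ (λ x x<2q → trans (outerOf-cong x x<2q) (outerOf-glue x x<2q)))
              (vecOf≡ τv _ (λ x x<R → trans (cong (_∸ suc q) (⟦σ⟧≡glue (x + suc q) (M-position< q R x x<R))) (innerOf-glue x x<R)))
    where
    t₁ = T∧⁻ {inv132 (_≡ᵇ 0) κv} t
    Iκ = inv132⇒Inv132 (_≡ᵇ 0) κv (proj₁ t₁)
    Iτ = inv132⇒Inv132 P τv (proj₂ t₁)
    open HalfSwap {q} Iκ using (κ-lowHalf; κ-highHalf)
    open Glue q R ⟦ κv ⟧ ⟦ τv ⟧ using (glue; glue-T)
    open Glued q R ⟦ κv ⟧ ⟦ τv ⟧ κ-lowHalf κ-highHalf (Inv132.involutive Iκ) (Inv132.avoids Iκ)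
                                 (Inv132.maps Iτ) (Inv132.involutive Iτ) (Inv132.avoids Iτ)
    Iσ : Inv132 N P glue
    Iσ = record { maps = glue-< ; involutive = glue-involutive ; avoids = glue-avoids132
                ; fixedPoints = subst (T ∘ P) (sym glue-fp) (Inv132.fixedPoints Iτ) }
    ⟦σ⟧≡glue : ∀ x → x < N → ⟦ vecOf N glue ⟧ x ≡ glue x
    ⟦σ⟧≡glue x x<N = ⟦vecOf⟧ N glue x x<N (glue-< x x<N)
    outerOf-cong : ∀ x → x < q + q → outerOf q R ⟦ vecOf N glue ⟧ x ≡ outerOf q R glue x
    outerOf-cong x x<2q with trichotomy x q
    ... | inj₁ x<q = trans (cong (λ b → if b then ⟦ vecOf N glue ⟧ x ∸ suc R else ⟦ vecOf N glue ⟧ (x + suc R)) (<⇒<ᵇ-true x<q))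
      (trans (cong (_∸ suc R) (⟦σ⟧≡glue x (<-trans x<q (<-trans (s≤s (≤-trans (m≤m+n q R) (m≤m+n (q + R) q))) ≤-refl))))
             (sym (cong (λ b → if b then glue x ∸ suc R else glue (x + suc R)) (<⇒<ᵇ-true x<q))))
    ... | inj₂ q≤x = trans (cong (λ b → if b then ⟦ vecOf N glue ⟧ x ∸ suc R else ⟦ vecOf N glue ⟧ (x + suc R)) (≥⇒<ᵇ-false (≡⊎<⇒≤ q≤x)))
      (trans (⟦σ⟧≡glue (x + suc R) (<-trans (proj₂ (R-position q R x (≡⊎<⇒≤ q≤x) x<2q)) ≤-refl))
             (sym (cong (λ b → if b then glue x ∸ suc R else glue (x + suc R)) (≥⇒<ᵇ-false (≡⊎<⇒≤ q≤x)))))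

inv132-lastValue-none : ∀ M q P → q < M → M ≤ q + q → countB (λ σ → inv132 P σ ∧ (⟦ σ ⟧ M ≡ᵇ q)) (allVecs (suc M) (suc M)) ≡ 0
inv132-lastValue-none M q P q<M M≤2q = countB-none _ _ impossible
  where
  impossible : ∀ σ → σ ∈ allVecs (suc M) (suc M) → ¬ T (inv132 P σ ∧ (⟦ σ ⟧ M ≡ᵇ q))
  impossible σ _ t = <-irrefl refl (<-≤-trans 2q<M M≤2q)
    where
    t₁ = T∧⁻ {inv132 P σ} t
    open Inv132 (inv132⇒Inv132 P σ (proj₁ t₁))
    open LastValue M q ⟦ σ ⟧ maps involutive avoids (T≡⁻ {⟦ σ ⟧ M} {q} (proj₂ t₁)) q<M using (2q<M)

#inv132-last #words-last : ℕ → (ℕ → Bool) → ℕ → ℕ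
#inv132-last M P q = countB (λ σ → inv132 P σ ∧ (⟦ σ ⟧ M ≡ᵇ q)) (allVecs (suc M) (suc M))
#words-last M P q = countB (λ w → validWith P w ∧ (lastValue (suc M) w ≡ᵇ q)) (allWords (suc M))

paired-count : ∀ q R P →
  countB (inv132 (_≡ᵇ 0)) (allVecs (q + q) (q + q)) ≡ wordCount (q + q) (_≡ᵇ 0) →
  countB (inv132 P) (allVecs R R) ≡ wordCount R P →
  #inv132-last (suc q + R + q) P q ≡ #words-last (suc q + R + q) P q
paired-count q R P κ-count τ-count = begin
  #inv132-last (suc q + R + q) P q
    ≡⟨ inv132-lastPaired q R P ⟩
  countB (λ p → inv132 (_≡ᵇ 0) (proj₁ p) ∧ inv132 P (proj₂ p)) (cartesianProduct (allVecs (q + q) (q + q)) (allVecs R R))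
    ≡⟨ countB-cartesianProduct (allVecs (q + q) (q + q)) (allVecs R R) (inv132 (_≡ᵇ 0)) (inv132 P) ⟩
  countB (inv132 (_≡ᵇ 0)) (allVecs (q + q) (q + q)) * countB (inv132 P) (allVecs R R)
    ≡⟨ cong₂ _*_ (trans κ-count (cong (λ z → wordCount z (_≡ᵇ 0)) (sym 2q≡q+q))) τ-count ⟩
  wordCount (2 * q) (_≡ᵇ 0) * wordCount R P
    ≡⟨ cong (_* wordCount R P) (countB-cong _ (dyck 0) (allWords (2 * q)) (λ w _ → valid∧#F≡0≡dyck w)) ⟩
  countB (dyck 0) (allWords (2 * q)) * wordCount R P
    ≡⟨ sym (countB-cartesianProduct (allWords (2 * q)) (allWords R) (dyck 0) (validWith P)) ⟩
  countB (λ p → dyck 0 (proj₁ p) ∧ validWith P (proj₂ p)) (cartesianProduct (allWords (2 * q)) (allWords R))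
    ≡⟨ sym (words-headU q R P) ⟩
  countB (λ w → validWith P w ∧ (lastValue (2 + 2 * q + R) w ≡ᵇ q)) (allWords (2 + 2 * q + R))
    ≡⟨ cong (λ N → countB (λ w → validWith P w ∧ (lastValue N w ≡ᵇ q)) (allWords N)) (sym (size q R)) ⟩
  #words-last (suc q + R + q) P q ∎
  where
  open ≡-Reasoning
  2q≡q+q : 2 * q ≡ q + q
  2q≡q+q = cong (q +_) (+-identityʳ q)
  size : ∀ q R → suc (suc q + R + q) ≡ 2 + 2 * q + R
  size = solve-∀

-- Generalising over P lets the induction hypothesis be applied to P ∘ suc after a fixed last
-- point is deleted.
#inv132≡wordCount≤ : ∀ n m → m ≤ n → ∀ P → countB (inv132 P) (allVecs m m) ≡ wordCount m P
#inv132≡wordCount≤ n zero _ P = refl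
#inv132≡wordCount≤ (suc n) (suc M) (s≤s M≤n) P =
  trans (countB-byValue (inv132 P) (λ σ → ⟦ σ ⟧ M) (suc M) (allVecs (suc M) (suc M)) (λ σ _ _ → ⟦⟧-< σ M ≤-refl))
  (trans (sumN-cong (suc M) _ _ byLastValue)
  (sym (countB-byValue (validWith P) (lastValue (suc M)) (suc M) (allWords (suc M)) (λ w w∈ t → lastValue-< (suc M) P w (s≤s z≤n) w∈ t))))
  where
  IH : ∀ m → m ≤ M → ∀ P → countB (inv132 P) (allVecs m m) ≡ wordCount m P
  IH m m≤M = #inv132≡wordCount≤ n m (≤-trans m≤M M≤n)
  byLastValue : ∀ q → q < suc M → #inv132-last M P q ≡ #words-last M P q
  byLastValue q q<1+M with m≤n⇒m<n∨m≡n (≤-pred q<1+M)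
  ... | inj₂ refl = trans (inv132-lastFixed q P) (trans (IH q ≤-refl (P ∘ suc)) (sym (words-headF q P)))
  ... | inj₁ q<M with q + q <? M
  ...   | no q+q≮M = trans (inv132-lastValue-none M q P q<M (≮⇒≥ q+q≮M))
                           (sym (words-lastValue-none (suc M) q P (λ e → <-irrefl e q<M)
                                  (s≤s (s≤s (subst (M ≤_) (sym (cong (q +_) (+-identityʳ q))) (≮⇒≥ q+q≮M))))))
  ...   | yes 2q<M = subst (λ z → #inv132-last z P q ≡ #words-last z P q) size≡M
                       (paired-count q R P (IH (q + q) (<⇒≤ 2q<M) (_≡ᵇ 0)) (IH R (m∸n≤m M (suc (q + q))) P))
    where
    R = M ∸ suc (q + q)
    size≡M : suc q + R + q ≡ M
    size≡M = trans (regroup q R) (m+[n∸m]≡n 2q<M)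
      where regroup : ∀ q R → suc q + R + q ≡ suc (q + q) + R
            regroup = solve-∀

#inv132≡wordCount : ∀ n P → countB (inv132 P) (allVecs n n) ≡ wordCount n P
#inv132≡wordCount n = #inv132≡wordCount≤ n n ≤-refl

-- The statistics exc, ℓ and rk are determined by n and fp

fp+2exc≡n : ∀ {n} (σ : Fn n) → Involutive n ⟦ σ ⟧ → fp σ + 2 * exc σ ≡ n
fp+2exc≡n {n} σ inv =
  trans (cong₂ (λ a b → a + 2 * b) (fp≡countN σ) (exc≡countN σ)) (Involution.#fix+2#exc≡n n ⟦ σ ⟧ (⟦⟧-< σ) inv)

∧-congˡ : ∀ a {b c} → (T a → b ≡ c) → (a ∧ b) ≡ (a ∧ c)
∧-congˡ true h = h _
∧-congˡ false h = refl

∧-regroup : ∀ a b c {x y} → (T a → T b → T c → x ≡ y) → (a ∧ (b ∧ (c ∧ x))) ≡ ((a ∧ (b ∧ c)) ∧ y)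
∧-regroup true true true h = h _ _ _
∧-regroup true true false h = refl
∧-regroup true false c h = refl
∧-regroup false b c h = refl

exc≡ᵇ-determined : ∀ i e j n → i + 2 * e ≡ n → (e ≡ᵇ j) ≡ (i + 2 * j ≡ᵇ n)
exc≡ᵇ-determined i e j n i+2e≡n = ≡ᵇ-cong⇔ e j (i + 2 * j) n
  (λ e≡j → trans (cong (λ z → i + 2 * z) (sym e≡j)) i+2e≡n)
  (λ i+2j≡n → *-cancelˡ-≡ e j 2 (+-cancelˡ-≡ i (2 * e) (2 * j) (trans i+2e≡n (sym i+2j≡n))))

i+j≡ᵇk≡j≡ᵇn∸k : ∀ n i j k → k ≤ n → i + 2 * j ≡ n → (i + j ≡ᵇ k) ≡ (j ≡ᵇ n ∸ k)
i+j≡ᵇk≡j≡ᵇn∸k n i j k k≤n i+2j≡n = ≡ᵇ-cong⇔ (i + j) k j (n ∸ k)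
  (λ i+j≡k → sym (begin
     n ∸ k                 ≡⟨ cong₂ _∸_ (sym i+2j≡n) (sym i+j≡k) ⟩
     i + 2 * j ∸ (i + j)   ≡⟨ cong (_∸ (i + j)) (split i j) ⟩
     (i + j) + j ∸ (i + j) ≡⟨ m+n∸m≡n (i + j) j ⟩
     j                     ∎))
  (λ j≡n∸k → +-cancelʳ-≡ j (i + j) k (begin
     (i + j) + j           ≡⟨ sym (split i j) ⟩
     i + 2 * j             ≡⟨ i+2j≡n ⟩
     n                     ≡⟨ sym (m∸n+n≡m k≤n) ⟩
     n ∸ k + k             ≡⟨ cong (_+ k) (sym j≡n∸k) ⟩
     j + k                 ≡⟨ +-comm j k ⟩
     k + j                 ∎))
  where
  open ≡-Reasoning
  split : ∀ i j → i + 2 * j ≡ (i + j) + j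
  split = solve-∀

admissible : ℕ → ℕ → ℕ → ℕ → Bool
admissible n i j k = (i + 2 * j ≡ᵇ n) ∧ (j ≡ᵇ n ∸ k)

module _ (n i j k : ℕ) (k≤n : k ≤ n) where

  count321≡ : count321 n i j k ≡ countB (λ σ → inv321 (_≡ᵇ i) σ ∧ admissible n i j k) (allVecs n n)
  count321≡ = countB-cong _ _ (allVecs n n) (λ σ _ →
    ∧-regroup (isInvolution σ) (not (contains321 σ)) (fp σ ≡ᵇ i) (λ t-inv t-avoid t-fp →
      let inv = isInvolution⇒Involutive σ t-inv in
      let avoid = λ c → Tnot⁻ t-avoid (Contains321⇒contains321 σ c) in
      let i+2e≡n = trans (cong (_+ 2 * exc σ) (sym (T≡⁻ {fp σ} {i} t-fp))) (fp+2exc≡n σ inv) in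
      begin
        (exc σ ≡ᵇ j) ∧ (lis σ ≡ᵇ k)
          ≡⟨ cong (λ l → (exc σ ≡ᵇ j) ∧ (l ≡ᵇ k)) (trans (Avoiding321.lis≡fp+exc σ inv avoid) (cong (_+ exc σ) (T≡⁻ {fp σ} {i} t-fp))) ⟩
        (exc σ ≡ᵇ j) ∧ (i + exc σ ≡ᵇ k)
          ≡⟨ ∧-congˡ (exc σ ≡ᵇ j) (λ e≡j → cong (λ z → i + z ≡ᵇ k) (T≡⁻ {exc σ} {j} e≡j)) ⟩
        (exc σ ≡ᵇ j) ∧ (i + j ≡ᵇ k)
          ≡⟨ cong (_∧ (i + j ≡ᵇ k)) (exc≡ᵇ-determined i (exc σ) j n i+2e≡n) ⟩
        (i + 2 * j ≡ᵇ n) ∧ (i + j ≡ᵇ k)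
          ≡⟨ ∧-congˡ (i + 2 * j ≡ᵇ n) (λ t → i+j≡ᵇk≡j≡ᵇn∸k n i j k k≤n (T≡⁻ {i + 2 * j} {n} t)) ⟩
        admissible n i j k ∎))
    where open ≡-Reasoning

  count132≡ : count132 n i j (n ∸ k) ≡ countB (λ σ → inv132 (_≡ᵇ i) σ ∧ admissible n i j k) (allVecs n n)
  count132≡ = countB-cong _ _ (allVecs n n) (λ σ _ →
    ∧-regroup (isInvolution σ) (not (contains132 σ)) (fp σ ≡ᵇ i) (λ t-inv t-avoid t-fp →
      let inv = isInvolution⇒Involutive σ t-inv in
      let avoid = λ c → Tnot⁻ t-avoid (Contains132⇒contains132 σ c) in
      let i+2e≡n = trans (cong (_+ 2 * exc σ) (sym (T≡⁻ {fp σ} {i} t-fp))) (fp+2exc≡n σ inv) in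
      begin
        (exc σ ≡ᵇ j) ∧ (rk σ ≡ᵇ n ∸ k)
          ≡⟨ cong (λ r → (exc σ ≡ᵇ j) ∧ (r ≡ᵇ n ∸ k)) (rk≡exc σ inv avoid) ⟩
        (exc σ ≡ᵇ j) ∧ (exc σ ≡ᵇ n ∸ k)
          ≡⟨ ∧-congˡ (exc σ ≡ᵇ j) (λ e≡j → cong (_≡ᵇ n ∸ k) (T≡⁻ {exc σ} {j} e≡j)) ⟩
        (exc σ ≡ᵇ j) ∧ (j ≡ᵇ n ∸ k)
          ≡⟨ cong (_∧ (j ≡ᵇ n ∸ k)) (exc≡ᵇ-determined i (exc σ) j n i+2e≡n) ⟩
        admissible n i j k ∎))
    where open ≡-Reasoning

theorem4 : (n : ℕ) → 1 ≤ n → (i j k : ℕ) → i ≤ n → j ≤ n → k ≤ n →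
    count321 n i j k ≡ count132 n i j (n ∸ k)
theorem4 n _ i j k _ _ k≤n = begin
  count321 n i j k                                         ≡⟨ count321≡ n i j k k≤n ⟩
  countB (λ σ → inv321 (_≡ᵇ i) σ ∧ adm) (allVecs n n)      ≡⟨ countB-∧-const (inv321 (_≡ᵇ i)) adm (allVecs n n) ⟩
  (if adm then countB (inv321 (_≡ᵇ i)) (allVecs n n) else 0) ≡⟨ cong (if adm then_else 0) #inv321≡#inv132 ⟩
  (if adm then countB (inv132 (_≡ᵇ i)) (allVecs n n) else 0) ≡⟨ sym (countB-∧-const (inv132 (_≡ᵇ i)) adm (allVecs n n)) ⟩
  countB (λ σ → inv132 (_≡ᵇ i) σ ∧ adm) (allVecs n n)      ≡⟨ sym (count132≡ n i j k k≤n) ⟩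
  count132 n i j (n ∸ k)                                   ∎
  where
  open ≡-Reasoning
  adm : Bool
  adm = admissible n i j k
  #inv321≡#inv132 : countB (inv321 (_≡ᵇ i)) (allVecs n n) ≡ countB (inv132 (_≡ᵇ i)) (allVecs n n)
  #inv321≡#inv132 = trans (#inv321≡wordCount n (_≡ᵇ i)) (sym (#inv132≡wordCount n (_≡ᵇ i)))
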